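{- There exist $4$-GDDs of types $2^7 5^9$, $2^{10} 5^9$, $2^9 5^{13}$, $2^{13} 5^{12}$ and $2^3 5^{16}$.
   Context: A $4$-GDD is a triple $(X,\mathcal{G},\mathcal{B})$ where $X$ is a finite point set, $\mathcal{G}$ a partition of $X$ into groups, and $\mathcal{B}$ a collection of $4$-element subsets (blocks) such that no block meets a group in more than one point and any two points from distinct groups lie in exactly one common block. Type $2^t5^s$ means $t$ groups of size $2$ and $s$ groups of size $5$. -}

module Defs where

open import Data.Nat using (ℕ; _+_)
open import Data.Fin using (Fin; _≟_)
open import Data.Fin.Base using (splitAt)
open import Data.Sum using (_⊎_; inj₁; inj₂)
open import Data.List using (List; length; filter; allFin)
open import Data.List.Membership.Propositional using (_∈_)
open import Data.List.Relation.Unary.Unique.Propositional using (Unique)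
open import Data.List.Relation.Unary.Any using (any?)
open import Data.Product using (_×_; Σ)
open import Data.Vec using (Vec; toList)
open import Relation.Nullary using (¬_; Dec)
open import Relation.Nullary.Decidable using (_×-dec_)
open import Relation.Binary.PropositionalEquality using (_≡_; _≢_)

-- A block is a 4-tuple of points; it is regarded as the 4-element set of its entries
-- (the entries are required to be pairwise distinct).
Block : ℕ → Set
Block v = Vec (Fin v) 4

_∈B?_ : ∀ {v} (x : Fin v) (b : Block v) → Dec (x ∈ toList b)
x ∈B? b = any? (x ≟_) (toList b)

blocksThrough : ∀ {v} → Fin v → Fin v → List (Block v) → List (Block v)
blocksThrough x y = filter (λ b → (x ∈B? b) ×-dec (y ∈B? b))

groupSize : ∀ {v g} → (Fin v → Fin g) → Fin g → ℕ
groupSize {v} grp i = length (filter (λ x → grp x ≟ i) (allFin v))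

-- A 4-GDD on the point set X = Fin v, whose groups are the fibres of
-- grp : Fin v → Fin g (the partition G), with block collection B.
record Is4GDD {v g : ℕ} (grp : Fin v → Fin g) (B : List (Block v)) : Set where
  field
    block-distinct : ∀ b → b ∈ B → Unique (toList b)
    block-transversal : ∀ b → b ∈ B → ∀ x y → x ∈ toList b → y ∈ toList b → x ≢ y → grp x ≢ grp y
    pair-once : ∀ x y → grp x ≢ grp y → length (blocksThrough x y B) ≡ 1

-- Group sizes realise type 2^t 5^s: there are t + s groups, the first t of size 2
-- and the remaining s of size 5 (the groups are nonempty, so grp is a genuine partition).
HasType2-5 : ∀ {v} (t s : ℕ) → (Fin v → Fin (t + s)) → Set
HasType2-5 t s grp = ∀ i → sizeSpec (splitAt t i) (groupSize grp i)
  where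
  sizeSpec : Fin t ⊎ Fin s → ℕ → Set
  sizeSpec (inj₁ _) n = n ≡ 2
  sizeSpec (inj₂ _) n = n ≡ 5

Exists4GDD-2-5 : ℕ → ℕ → Set
Exists4GDD-2-5 t s =
  Σ ℕ λ v → Σ (Fin v → Fin (t + s)) λ grp → Σ (List (Block v)) λ B →
    HasType2-5 t s grp × Is4GDD grp B

module Submission where

-- Each design is exhibited by an explicit list of blocks on the points 0, …, v − 1,
-- the points 0, …, 2t − 1 forming the groups of size 2 in consecutive pairs and the
-- remaining points the groups of size 5.  All axioms are then decided by evaluation;
-- the only reasoning needed is that counting the numeric blocks through two numbers
-- counts the blocks of Fin v through the corresponding points, which holds as soon
-- as every block entry is below v.

open import Defs
open import Data.Bool using (true; false; _∧_; if_then_else_)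
open import Data.Fin using (Fin; toℕ; splitAt; _≟_)
open import Data.Fin.Properties using (all?; toℕ-fromℕ<; toℕ-injective; toℕ<n)
open import Data.List using (List; []; _∷_; length; map; filter)
open import Data.List.Properties using (length-map)
open import Data.List.Membership.Propositional using (_∈_)
open import Data.List.Membership.Propositional.Properties using (∈-map⁺; ∈-map⁻)
open import Data.Nat as ℕ using (ℕ; _+_; _*_; _∸_; _/_; _<_; _<ᵇ_; _<?_; NonZero)
open import Data.List.Membership.DecPropositional ℕ._≟_ using (_∈?_)
open import Data.List.Relation.Unary.All as All using (All; []; _∷_)
open import Data.List.Relation.Unary.AllPairs as AllPairs using (AllPairs; []; _∷_)
open import Data.List.Relation.Unary.Any using (here; there)
open import Data.Nat.DivMod using (_mod_; m%n<n; m<n⇒m%n≡m)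
open import Data.Product using (_×_; _,_)
open import Data.Sum using ([_,_]′; inj₁; inj₂)
open import Data.Vec as Vec using (Vec; []; _∷_; toList)
open import Data.Vec.Properties using (toList-map)
open import Function using (_∘_; const; _⇔_; mk⇔)
open import Level using (Level)
open import Relation.Binary using (Symmetric)
open import Relation.Binary.PropositionalEquality using (_≡_; _≢_; refl; sym; trans; cong; cong₂; subst; ≢-sym; module ≡-Reasoning)
open import Relation.Nullary using (Dec; does; ¬?; _×-dec_; _→-dec_; contradiction)
open import Relation.Nullary.Decidable using (True; toWitness; does-⇔)
open import Relation.Unary using (Pred; Decidable)

module _ {a b p : Level} {A : Set a} {B : Set b} where

  filter-map : ∀ {P : Pred B p} (P? : Decidable P) (f : A → B) xs →
               filter P? (map f xs) ≡ map f (filter (P? ∘ f) xs)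
  filter-map P? f [] = refl
  filter-map P? f (x ∷ xs) with does (P? (f x))
  ... | true  = cong (f x ∷_) (filter-map P? f xs)
  ... | false = filter-map P? f xs

module _ {a p q : Level} {A : Set a} {P : Pred A p} {Q : Pred A q} (P? : Decidable P) (Q? : Decidable Q) where

  filter-cong : ∀ {xs} → All (λ x → does (P? x) ≡ does (Q? x)) xs → filter P? xs ≡ filter Q? xs
  filter-cong {[]}     []       = refl
  filter-cong {x ∷ xs} (e ∷ es) with does (P? x) | does (Q? x) | e
  ... | true  | _ | refl = cong (x ∷_) (filter-cong es)
  ... | false | _ | refl = filter-cong es

  filter-×-dec : ∀ xs → filter (λ x → P? x ×-dec Q? x) xs ≡ filter Q? (filter P? xs)
  filter-×-dec []       = refl
  filter-×-dec (x ∷ xs) with does (P? x)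
  ... | false = filter-×-dec xs
  ... | true with does (Q? x)
  ...   | true  = cong (x ∷_) (filter-×-dec xs)
  ...   | false = filter-×-dec xs

module _ {a r : Level} {A : Set a} {R : A → A → Set r} (R-sym : Symmetric R) where

  AllPairs-∈ : ∀ {xs x y} → AllPairs R xs → x ∈ xs → y ∈ xs → x ≢ y → R x y
  AllPairs-∈ (_  ∷ _)   (here refl) (here refl) x≢y = contradiction refl x≢y
  AllPairs-∈ (Rx ∷ _)   (here refl) (there y∈)  _   = All.lookup Rx y∈
  AllPairs-∈ (Ry ∷ _)   (there x∈)  (here refl) _   = R-sym (All.lookup Ry x∈)
  AllPairs-∈ (_  ∷ Rxs) (there x∈)  (there y∈)  x≢y = AllPairs-∈ Rxs x∈ y∈ x≢y

module Points (v : ℕ) {{_ : NonZero v}} where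

  point : ℕ → Fin v
  point n = n mod v

  toℕ-point : ∀ {n} → n < v → toℕ (point n) ≡ n
  toℕ-point {n} n<v = trans (toℕ-fromℕ< (m%n<n n v)) (m<n⇒m%n≡m n<v)

  point-toℕ : ∀ x → point (toℕ x) ≡ x
  point-toℕ x = toℕ-injective (toℕ-point (toℕ<n x))

  ∈-map-point⇔ : ∀ {ns x} → All (_< v) ns → x ∈ map point ns ⇔ toℕ x ∈ ns
  ∈-map-point⇔ {ns} {x} ns<v = mk⇔ to from
    where
    to : x ∈ map point ns → toℕ x ∈ ns
    to x∈ with ∈-map⁻ point x∈
    ... | n , n∈ , refl = subst (_∈ ns) (sym (toℕ-point (All.lookup ns<v n∈))) n∈
    from : toℕ x ∈ ns → x ∈ map point ns
    from n∈ = subst (_∈ map point ns) (point-toℕ x) (∈-map⁺ point n∈)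

  ∈-point-block⇔ : ∀ {x} (β : Vec ℕ 4) → All (_< v) (toList β) →
                   x ∈ toList (Vec.map point β) ⇔ toℕ x ∈ toList β
  ∈-point-block⇔ β β<v rewrite toList-map point β = ∈-map-point⇔ β<v

module Certificate (v g : ℕ) {{_ : NonZero v}} {{_ : NonZero g}}
                   (group : ℕ → ℕ) (blocks : List (Vec ℕ 4)) where

  open Points v

  grp : Fin v → Fin g
  grp x = group (toℕ x) mod g

  B : List (Block v)
  B = map (Vec.map point) blocks

  _∈ᵛ?_ : (n : ℕ) (β : Vec ℕ 4) → Dec (n ∈ toList β)
  n ∈ᵛ? β = n ∈? toList β

  Transversal : Set
  Transversal = All (AllPairs (λ x y → grp x ≢ grp y) ∘ toList) B

  InRange : Set
  InRange = All (All (_< v) ∘ toList) blocks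

  PairsOnceIn : Fin v → List (Vec ℕ 4) → Set
  PairsOnceIn x row = ∀ y → grp x ≢ grp y → length (filter (toℕ y ∈ᵛ?_) row) ≡ 1

  -- The blocks through x are filtered once per x rather than once per pair,
  -- which keeps the evaluation of valid? fast.
  PairsOnce : Set
  PairsOnce = ∀ x → PairsOnceIn x (filter (toℕ x ∈ᵛ?_) blocks)

  Valid : Set
  Valid = Transversal × InRange × PairsOnce

  valid? : Dec Valid
  valid? = transversal? ×-dec inRange? ×-dec all? (λ x → pairsOnceIn? x (filter (toℕ x ∈ᵛ?_) blocks))
    where
    transversal? : Dec Transversal
    transversal? = All.all? (AllPairs.allPairs? (λ x y → ¬? (grp x ≟ grp y)) ∘ toList) B
    inRange? : Dec InRange
    inRange? = All.all? (All.all? (_<? v) ∘ toList) blocks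
    pairsOnceIn? : ∀ x row → Dec (PairsOnceIn x row)
    pairsOnceIn? x row = all? λ y → ¬? (grp x ≟ grp y) →-dec length (filter (toℕ y ∈ᵛ?_) row) ℕ.≟ 1

  valid⇒Is4GDD : Valid → Is4GDD grp B
  valid⇒Is4GDD (transversal , inRange , pairsOnce) = record
    { block-distinct    = λ b b∈ → AllPairs.map (λ g≢ → g≢ ∘ cong grp) (All.lookup transversal b∈)
    ; block-transversal = λ b b∈ x y x∈ y∈ → AllPairs-∈ ≢-sym (All.lookup transversal b∈) x∈ y∈
    ; pair-once         = pair-once
    }
    where
    open ≡-Reasoning

    through? : ∀ x y (β : Vec ℕ 4) → Dec (x ∈ toList (Vec.map point β) × y ∈ toList (Vec.map point β))
    through? x y β = (x ∈B? Vec.map point β) ×-dec (y ∈B? Vec.map point β)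

    pair-once : ∀ x y → grp x ≢ grp y → length (blocksThrough x y B) ≡ 1
    pair-once x y gx≢gy = begin
      length (blocksThrough x y B)
        ≡⟨ cong length (filter-map _ (Vec.map point) blocks) ⟩
      length (map (Vec.map point) (filter (through? x y) blocks))
        ≡⟨ length-map (Vec.map point) (filter (through? x y) blocks) ⟩
      length (filter (through? x y) blocks)
        ≡⟨ cong length (filter-cong (through? x y) _ (All.map same-membership inRange)) ⟩
      length (filter (λ β → (toℕ x ∈ᵛ? β) ×-dec (toℕ y ∈ᵛ? β)) blocks)
        ≡⟨ cong length (filter-×-dec (toℕ x ∈ᵛ?_) (toℕ y ∈ᵛ?_) blocks) ⟩
      length (filter (toℕ y ∈ᵛ?_) (filter (toℕ x ∈ᵛ?_) blocks))
        ≡⟨ pairsOnce x y gx≢gy ⟩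
      1 ∎
      where
      same-membership : ∀ {β} → All (_< v) (toList β) →
                        does (through? x y β) ≡ does ((toℕ x ∈ᵛ? β) ×-dec (toℕ y ∈ᵛ? β))
      same-membership {β} β<v = cong₂ _∧_ (does-⇔ (∈-point-block⇔ β β<v) (x ∈B? _) (toℕ x ∈ᵛ? β))
                                  (does-⇔ (∈-point-block⇔ β β<v) (y ∈B? _) (toℕ y ∈ᵛ? β))

sizes⇒HasType2-5 : ∀ {v} t s (grp : Fin v → Fin (t + s)) →
                   (∀ i → groupSize grp i ≡ [ const 2 , const 5 ]′ (splitAt t i)) →
                   HasType2-5 t s grp
sizes⇒HasType2-5 t s grp sizes i with splitAt t i | sizes i
... | inj₁ _ | size≡2 = size≡2
... | inj₂ _ | size≡5 = size≡5

groupOf2-5 : ℕ → ℕ → ℕ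
groupOf2-5 t n = if n <ᵇ 2 * t then n / 2 else t + (n ∸ 2 * t) / 5

module _ (t s v : ℕ) {{_ : NonZero v}} {{_ : NonZero (t + s)}} (blocks : List (Vec ℕ 4)) where

  open Certificate v (t + s) (groupOf2-5 t) blocks

  exists4GDD-2-5 : {_ : True valid?} →
                   {_ : True (all? λ i → groupSize grp i ℕ.≟ [ const 2 , const 5 ]′ (splitAt t i))} →
                   Exists4GDD-2-5 t s
  exists4GDD-2-5 {valid} {sizes} =
    v , grp , B , sizes⇒HasType2-5 t s grp (toWitness sizes) , valid⇒Is4GDD (toWitness valid)

blocks-2⁷5⁹ : List (Vec ℕ 4)
blocks-2⁷5⁹ =
  (14 ∷ 19 ∷ 46 ∷  6 ∷ []) ∷ (14 ∷ 24 ∷ 52 ∷  7 ∷ []) ∷ (14 ∷ 20 ∷ 37 ∷ 12 ∷ []) ∷ (14 ∷ 25 ∷ 43 ∷ 45 ∷ []) ∷ (14 ∷ 21 ∷ 30 ∷ 50 ∷ []) ∷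
  (14 ∷ 26 ∷ 42 ∷ 48 ∷ []) ∷ (14 ∷ 22 ∷ 32 ∷ 53 ∷ []) ∷ (14 ∷ 27 ∷ 31 ∷  1 ∷ []) ∷ (14 ∷ 23 ∷ 56 ∷  9 ∷ []) ∷ (14 ∷ 28 ∷ 55 ∷  4 ∷ []) ∷
  (14 ∷ 29 ∷ 40 ∷ 11 ∷ []) ∷ (14 ∷ 34 ∷ 33 ∷ 10 ∷ []) ∷ (14 ∷ 39 ∷ 54 ∷  5 ∷ []) ∷ (14 ∷ 35 ∷ 57 ∷ 13 ∷ []) ∷ (14 ∷ 36 ∷ 41 ∷  2 ∷ []) ∷
  (14 ∷ 38 ∷ 47 ∷  8 ∷ []) ∷ (14 ∷ 44 ∷ 51 ∷  3 ∷ []) ∷ (14 ∷ 49 ∷ 58 ∷  0 ∷ []) ∷ (19 ∷ 24 ∷ 51 ∷  8 ∷ []) ∷ (19 ∷ 15 ∷ 57 ∷  9 ∷ []) ∷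
  (19 ∷ 25 ∷ 42 ∷  1 ∷ []) ∷ (19 ∷ 16 ∷ 29 ∷ 50 ∷ []) ∷ (19 ∷ 26 ∷ 35 ∷ 55 ∷ []) ∷ (19 ∷ 17 ∷ 33 ∷ 53 ∷ []) ∷ (19 ∷ 27 ∷ 37 ∷ 58 ∷ []) ∷
  (19 ∷ 18 ∷ 36 ∷  3 ∷ []) ∷ (19 ∷ 28 ∷ 47 ∷ 11 ∷ []) ∷ (19 ∷ 34 ∷ 31 ∷  7 ∷ []) ∷ (19 ∷ 39 ∷ 38 ∷ 12 ∷ []) ∷ (19 ∷ 30 ∷ 45 ∷ 10 ∷ []) ∷
  (19 ∷ 40 ∷ 48 ∷ 13 ∷ []) ∷ (19 ∷ 41 ∷ 32 ∷  4 ∷ []) ∷ (19 ∷ 43 ∷ 52 ∷  0 ∷ []) ∷ (19 ∷ 44 ∷ 54 ∷  2 ∷ []) ∷ (19 ∷ 49 ∷ 56 ∷  5 ∷ []) ∷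
  (24 ∷ 15 ∷ 56 ∷  0 ∷ []) ∷ (24 ∷ 20 ∷ 48 ∷ 11 ∷ []) ∷ (24 ∷ 16 ∷ 33 ∷  3 ∷ []) ∷ (24 ∷ 21 ∷ 34 ∷ 55 ∷ []) ∷ (24 ∷ 17 ∷ 40 ∷ 46 ∷ []) ∷
  (24 ∷ 22 ∷ 38 ∷ 58 ∷ []) ∷ (24 ∷ 18 ∷ 42 ∷ 44 ∷ []) ∷ (24 ∷ 23 ∷ 41 ∷  5 ∷ []) ∷ (24 ∷ 29 ∷ 57 ∷  2 ∷ []) ∷ (24 ∷ 39 ∷ 36 ∷  9 ∷ []) ∷
  (24 ∷ 30 ∷ 43 ∷  1 ∷ []) ∷ (24 ∷ 35 ∷ 50 ∷ 12 ∷ []) ∷ (24 ∷ 31 ∷ 53 ∷ 13 ∷ []) ∷ (24 ∷ 32 ∷ 37 ∷  6 ∷ []) ∷ (24 ∷ 49 ∷ 45 ∷  4 ∷ []) ∷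
  (24 ∷ 54 ∷ 47 ∷ 10 ∷ []) ∷ (15 ∷ 20 ∷ 47 ∷  2 ∷ []) ∷ (15 ∷ 25 ∷ 53 ∷  7 ∷ []) ∷ (15 ∷ 21 ∷ 38 ∷  5 ∷ []) ∷ (15 ∷ 26 ∷ 39 ∷ 46 ∷ []) ∷
  (15 ∷ 22 ∷ 31 ∷ 51 ∷ []) ∷ (15 ∷ 27 ∷ 43 ∷ 44 ∷ []) ∷ (15 ∷ 23 ∷ 33 ∷ 49 ∷ []) ∷ (15 ∷ 28 ∷ 32 ∷ 10 ∷ []) ∷ (15 ∷ 29 ∷ 35 ∷  3 ∷ []) ∷
  (15 ∷ 34 ∷ 48 ∷  4 ∷ []) ∷ (15 ∷ 30 ∷ 41 ∷ 11 ∷ []) ∷ (15 ∷ 40 ∷ 55 ∷  1 ∷ []) ∷ (15 ∷ 36 ∷ 58 ∷ 13 ∷ []) ∷ (15 ∷ 37 ∷ 42 ∷  8 ∷ []) ∷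
  (15 ∷ 54 ∷ 50 ∷  6 ∷ []) ∷ (15 ∷ 45 ∷ 52 ∷ 12 ∷ []) ∷ (20 ∷ 25 ∷ 52 ∷  4 ∷ []) ∷ (20 ∷ 16 ∷ 58 ∷  9 ∷ []) ∷ (20 ∷ 26 ∷ 43 ∷ 10 ∷ []) ∷
  (20 ∷ 17 ∷ 30 ∷ 51 ∷ []) ∷ (20 ∷ 27 ∷ 36 ∷ 56 ∷ []) ∷ (20 ∷ 18 ∷ 29 ∷ 49 ∷ []) ∷ (20 ∷ 28 ∷ 38 ∷ 54 ∷ []) ∷ (20 ∷ 34 ∷ 40 ∷  5 ∷ []) ∷
  (20 ∷ 39 ∷ 53 ∷  6 ∷ []) ∷ (20 ∷ 35 ∷ 32 ∷  7 ∷ []) ∷ (20 ∷ 31 ∷ 46 ∷  3 ∷ []) ∷ (20 ∷ 41 ∷ 44 ∷ 13 ∷ []) ∷ (20 ∷ 42 ∷ 33 ∷  0 ∷ []) ∷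
  (20 ∷ 45 ∷ 55 ∷  8 ∷ []) ∷ (20 ∷ 50 ∷ 57 ∷  1 ∷ []) ∷ (25 ∷ 16 ∷ 57 ∷  6 ∷ []) ∷ (25 ∷ 21 ∷ 44 ∷ 11 ∷ []) ∷ (25 ∷ 17 ∷ 29 ∷ 12 ∷ []) ∷
  (25 ∷ 22 ∷ 35 ∷ 56 ∷ []) ∷ (25 ∷ 18 ∷ 41 ∷ 47 ∷ []) ∷ (25 ∷ 23 ∷ 34 ∷ 54 ∷ []) ∷ (25 ∷ 39 ∷ 31 ∷ 10 ∷ []) ∷ (25 ∷ 30 ∷ 58 ∷  8 ∷ []) ∷
  (25 ∷ 40 ∷ 37 ∷  9 ∷ []) ∷ (25 ∷ 36 ∷ 51 ∷  5 ∷ []) ∷ (25 ∷ 32 ∷ 49 ∷ 13 ∷ []) ∷ (25 ∷ 33 ∷ 38 ∷  2 ∷ []) ∷ (25 ∷ 50 ∷ 46 ∷  0 ∷ []) ∷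
  (25 ∷ 55 ∷ 48 ∷  3 ∷ []) ∷ (16 ∷ 21 ∷ 48 ∷  8 ∷ []) ∷ (16 ∷ 26 ∷ 49 ∷  7 ∷ []) ∷ (16 ∷ 22 ∷ 34 ∷  1 ∷ []) ∷ (16 ∷ 27 ∷ 40 ∷ 47 ∷ []) ∷
  (16 ∷ 23 ∷ 32 ∷ 52 ∷ []) ∷ (16 ∷ 28 ∷ 39 ∷ 45 ∷ []) ∷ (16 ∷ 30 ∷ 36 ∷ 12 ∷ []) ∷ (16 ∷ 35 ∷ 44 ∷  0 ∷ []) ∷ (16 ∷ 31 ∷ 42 ∷ 11 ∷ []) ∷
  (16 ∷ 41 ∷ 56 ∷ 10 ∷ []) ∷ (16 ∷ 37 ∷ 54 ∷ 13 ∷ []) ∷ (16 ∷ 38 ∷ 43 ∷  4 ∷ []) ∷ (16 ∷ 55 ∷ 51 ∷  2 ∷ []) ∷ (16 ∷ 46 ∷ 53 ∷  5 ∷ []) ∷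
  (21 ∷ 26 ∷ 53 ∷  0 ∷ []) ∷ (21 ∷ 17 ∷ 54 ∷  9 ∷ []) ∷ (21 ∷ 27 ∷ 39 ∷  3 ∷ []) ∷ (21 ∷ 18 ∷ 31 ∷ 52 ∷ []) ∷ (21 ∷ 28 ∷ 37 ∷ 57 ∷ []) ∷
  (21 ∷ 29 ∷ 43 ∷  6 ∷ []) ∷ (21 ∷ 35 ∷ 41 ∷  1 ∷ []) ∷ (21 ∷ 40 ∷ 49 ∷  2 ∷ []) ∷ (21 ∷ 36 ∷ 33 ∷  7 ∷ []) ∷ (21 ∷ 32 ∷ 47 ∷ 12 ∷ []) ∷
  (21 ∷ 42 ∷ 45 ∷ 13 ∷ []) ∷ (21 ∷ 46 ∷ 56 ∷  4 ∷ []) ∷ (21 ∷ 51 ∷ 58 ∷ 10 ∷ []) ∷ (26 ∷ 17 ∷ 58 ∷  2 ∷ []) ∷ (26 ∷ 22 ∷ 45 ∷ 11 ∷ []) ∷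
  (26 ∷ 18 ∷ 30 ∷  5 ∷ []) ∷ (26 ∷ 23 ∷ 36 ∷ 57 ∷ []) ∷ (26 ∷ 29 ∷ 34 ∷  8 ∷ []) ∷ (26 ∷ 40 ∷ 32 ∷  3 ∷ []) ∷ (26 ∷ 31 ∷ 54 ∷  4 ∷ []) ∷
  (26 ∷ 41 ∷ 38 ∷  9 ∷ []) ∷ (26 ∷ 37 ∷ 52 ∷  1 ∷ []) ∷ (26 ∷ 33 ∷ 50 ∷ 13 ∷ []) ∷ (26 ∷ 44 ∷ 56 ∷ 12 ∷ []) ∷ (26 ∷ 51 ∷ 47 ∷  6 ∷ []) ∷
  (17 ∷ 22 ∷ 44 ∷  4 ∷ []) ∷ (17 ∷ 27 ∷ 50 ∷  7 ∷ []) ∷ (17 ∷ 23 ∷ 35 ∷ 10 ∷ []) ∷ (17 ∷ 28 ∷ 41 ∷ 48 ∷ []) ∷ (17 ∷ 34 ∷ 39 ∷  0 ∷ []) ∷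
  (17 ∷ 31 ∷ 37 ∷  5 ∷ []) ∷ (17 ∷ 36 ∷ 45 ∷  6 ∷ []) ∷ (17 ∷ 32 ∷ 43 ∷ 11 ∷ []) ∷ (17 ∷ 42 ∷ 57 ∷  3 ∷ []) ∷ (17 ∷ 38 ∷ 55 ∷ 13 ∷ []) ∷
  (17 ∷ 49 ∷ 47 ∷  1 ∷ []) ∷ (17 ∷ 56 ∷ 52 ∷  8 ∷ []) ∷ (22 ∷ 27 ∷ 49 ∷  6 ∷ []) ∷ (22 ∷ 18 ∷ 55 ∷  9 ∷ []) ∷ (22 ∷ 28 ∷ 40 ∷ 12 ∷ []) ∷
  (22 ∷ 29 ∷ 37 ∷  7 ∷ []) ∷ (22 ∷ 39 ∷ 30 ∷  2 ∷ []) ∷ (22 ∷ 36 ∷ 42 ∷ 10 ∷ []) ∷ (22 ∷ 41 ∷ 50 ∷  8 ∷ []) ∷ (22 ∷ 33 ∷ 48 ∷  5 ∷ []) ∷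
  (22 ∷ 43 ∷ 46 ∷ 13 ∷ []) ∷ (22 ∷ 54 ∷ 52 ∷  3 ∷ []) ∷ (22 ∷ 47 ∷ 57 ∷  0 ∷ []) ∷ (27 ∷ 18 ∷ 54 ∷  8 ∷ []) ∷ (27 ∷ 23 ∷ 46 ∷ 11 ∷ []) ∷
  (27 ∷ 29 ∷ 51 ∷ 13 ∷ []) ∷ (27 ∷ 34 ∷ 42 ∷  9 ∷ []) ∷ (27 ∷ 30 ∷ 35 ∷  4 ∷ []) ∷ (27 ∷ 41 ∷ 33 ∷ 12 ∷ []) ∷ (27 ∷ 32 ∷ 55 ∷  0 ∷ []) ∷
  (27 ∷ 38 ∷ 53 ∷ 10 ∷ []) ∷ (27 ∷ 45 ∷ 57 ∷  5 ∷ []) ∷ (27 ∷ 52 ∷ 48 ∷  2 ∷ []) ∷ (18 ∷ 23 ∷ 45 ∷  0 ∷ []) ∷ (18 ∷ 28 ∷ 51 ∷  7 ∷ []) ∷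
  (18 ∷ 34 ∷ 56 ∷ 13 ∷ []) ∷ (18 ∷ 39 ∷ 33 ∷ 11 ∷ []) ∷ (18 ∷ 35 ∷ 40 ∷  6 ∷ []) ∷ (18 ∷ 32 ∷ 38 ∷  1 ∷ []) ∷ (18 ∷ 37 ∷ 46 ∷  2 ∷ []) ∷
  (18 ∷ 43 ∷ 58 ∷ 12 ∷ []) ∷ (18 ∷ 50 ∷ 48 ∷ 10 ∷ []) ∷ (18 ∷ 57 ∷ 53 ∷  4 ∷ []) ∷ (23 ∷ 28 ∷ 50 ∷  2 ∷ []) ∷ (23 ∷ 29 ∷ 44 ∷  1 ∷ []) ∷
  (23 ∷ 39 ∷ 47 ∷ 13 ∷ []) ∷ (23 ∷ 30 ∷ 38 ∷  7 ∷ []) ∷ (23 ∷ 40 ∷ 31 ∷  8 ∷ []) ∷ (23 ∷ 37 ∷ 43 ∷  3 ∷ []) ∷ (23 ∷ 42 ∷ 51 ∷  4 ∷ []) ∷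
  (23 ∷ 55 ∷ 53 ∷ 12 ∷ []) ∷ (23 ∷ 48 ∷ 58 ∷  6 ∷ []) ∷ (28 ∷ 29 ∷ 42 ∷  5 ∷ []) ∷ (28 ∷ 34 ∷ 49 ∷  3 ∷ []) ∷ (28 ∷ 30 ∷ 52 ∷ 13 ∷ []) ∷
  (28 ∷ 35 ∷ 43 ∷  9 ∷ []) ∷ (28 ∷ 31 ∷ 36 ∷  0 ∷ []) ∷ (28 ∷ 33 ∷ 56 ∷  6 ∷ []) ∷ (28 ∷ 44 ∷ 53 ∷  8 ∷ []) ∷ (28 ∷ 46 ∷ 58 ∷  1 ∷ []) ∷
  (29 ∷ 39 ∷ 52 ∷ 58 ∷ []) ∷ (29 ∷ 36 ∷ 47 ∷  4 ∷ []) ∷ (29 ∷ 41 ∷ 54 ∷  0 ∷ []) ∷ (29 ∷ 38 ∷ 56 ∷ 48 ∷ []) ∷ (29 ∷ 45 ∷ 53 ∷  9 ∷ []) ∷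
  (29 ∷ 55 ∷ 46 ∷ 10 ∷ []) ∷ (34 ∷ 30 ∷ 44 ∷ 57 ∷ []) ∷ (34 ∷ 41 ∷ 52 ∷  6 ∷ []) ∷ (34 ∷ 32 ∷ 45 ∷  2 ∷ []) ∷ (34 ∷ 43 ∷ 47 ∷ 53 ∷ []) ∷
  (34 ∷ 50 ∷ 58 ∷ 11 ∷ []) ∷ (34 ∷ 46 ∷ 51 ∷ 12 ∷ []) ∷ (39 ∷ 35 ∷ 49 ∷ 48 ∷ []) ∷ (39 ∷ 32 ∷ 57 ∷  8 ∷ []) ∷ (39 ∷ 37 ∷ 50 ∷  4 ∷ []) ∷
  (39 ∷ 44 ∷ 55 ∷  7 ∷ []) ∷ (39 ∷ 51 ∷ 56 ∷  1 ∷ []) ∷ (30 ∷ 40 ∷ 54 ∷ 53 ∷ []) ∷ (30 ∷ 37 ∷ 48 ∷  0 ∷ []) ∷ (30 ∷ 42 ∷ 55 ∷  6 ∷ []) ∷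
  (30 ∷ 49 ∷ 46 ∷  9 ∷ []) ∷ (30 ∷ 56 ∷ 47 ∷  3 ∷ []) ∷ (35 ∷ 31 ∷ 45 ∷ 58 ∷ []) ∷ (35 ∷ 42 ∷ 53 ∷  2 ∷ []) ∷ (35 ∷ 33 ∷ 46 ∷  8 ∷ []) ∷
  (35 ∷ 54 ∷ 51 ∷ 11 ∷ []) ∷ (35 ∷ 47 ∷ 52 ∷  5 ∷ []) ∷ (40 ∷ 36 ∷ 44 ∷ 50 ∷ []) ∷ (40 ∷ 33 ∷ 58 ∷  4 ∷ []) ∷ (40 ∷ 38 ∷ 51 ∷  0 ∷ []) ∷
  (40 ∷ 45 ∷ 56 ∷  7 ∷ []) ∷ (40 ∷ 52 ∷ 57 ∷ 10 ∷ []) ∷ (31 ∷ 41 ∷ 49 ∷ 55 ∷ []) ∷ (31 ∷ 38 ∷ 44 ∷  6 ∷ []) ∷ (31 ∷ 43 ∷ 56 ∷  2 ∷ []) ∷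
  (31 ∷ 50 ∷ 47 ∷  9 ∷ []) ∷ (31 ∷ 57 ∷ 48 ∷ 12 ∷ []) ∷ (36 ∷ 32 ∷ 54 ∷ 46 ∷ []) ∷ (36 ∷ 43 ∷ 49 ∷  8 ∷ []) ∷ (36 ∷ 55 ∷ 52 ∷ 11 ∷ []) ∷
  (36 ∷ 48 ∷ 53 ∷  1 ∷ []) ∷ (41 ∷ 37 ∷ 45 ∷ 51 ∷ []) ∷ (41 ∷ 46 ∷ 57 ∷  7 ∷ []) ∷ (41 ∷ 53 ∷ 58 ∷  3 ∷ []) ∷ (32 ∷ 42 ∷ 50 ∷ 56 ∷ []) ∷
  (32 ∷ 44 ∷ 58 ∷  5 ∷ []) ∷ (32 ∷ 51 ∷ 48 ∷  9 ∷ []) ∷ (37 ∷ 33 ∷ 55 ∷ 47 ∷ []) ∷ (37 ∷ 44 ∷ 49 ∷ 10 ∷ []) ∷ (37 ∷ 56 ∷ 53 ∷ 11 ∷ []) ∷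
  (42 ∷ 38 ∷ 46 ∷ 52 ∷ []) ∷ (42 ∷ 49 ∷ 54 ∷ 12 ∷ []) ∷ (42 ∷ 47 ∷ 58 ∷  7 ∷ []) ∷ (33 ∷ 43 ∷ 51 ∷ 57 ∷ []) ∷ (33 ∷ 44 ∷ 52 ∷  9 ∷ []) ∷
  (33 ∷ 54 ∷ 45 ∷  1 ∷ []) ∷ (38 ∷ 49 ∷ 57 ∷ 11 ∷ []) ∷ (38 ∷ 45 ∷ 50 ∷  3 ∷ []) ∷ (43 ∷ 54 ∷ 48 ∷  7 ∷ []) ∷ (43 ∷ 50 ∷ 55 ∷  5 ∷ []) ∷
  ( 0 ∷  2 ∷  6 ∷ 13 ∷ []) ∷ ( 0 ∷  4 ∷ 12 ∷ 11 ∷ []) ∷ ( 0 ∷  8 ∷ 10 ∷  7 ∷ []) ∷ ( 0 ∷  3 ∷  5 ∷  9 ∷ []) ∷ ( 2 ∷  4 ∷  8 ∷  1 ∷ []) ∷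
  ( 2 ∷ 10 ∷ 12 ∷  9 ∷ []) ∷ ( 2 ∷  5 ∷  7 ∷ 11 ∷ []) ∷ ( 4 ∷  6 ∷ 10 ∷  3 ∷ []) ∷ ( 4 ∷  7 ∷  9 ∷ 13 ∷ []) ∷ ( 6 ∷  8 ∷ 12 ∷  5 ∷ []) ∷
  ( 6 ∷  1 ∷  9 ∷ 11 ∷ []) ∷ ( 8 ∷  3 ∷ 11 ∷ 13 ∷ []) ∷ (10 ∷  1 ∷  5 ∷ 13 ∷ []) ∷ (12 ∷  1 ∷  3 ∷  7 ∷ []) ∷
  []

blocks-2¹⁰5⁹ : List (Vec ℕ 4)
blocks-2¹⁰5⁹ =
  (20 ∷ 25 ∷ 57 ∷  9 ∷ []) ∷ (20 ∷ 30 ∷ 63 ∷  2 ∷ []) ∷ (20 ∷ 26 ∷ 40 ∷  3 ∷ []) ∷ (20 ∷ 31 ∷ 51 ∷ 10 ∷ []) ∷ (20 ∷ 27 ∷ 49 ∷  6 ∷ []) ∷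
  (20 ∷ 32 ∷ 42 ∷ 12 ∷ []) ∷ (20 ∷ 28 ∷ 59 ∷  1 ∷ []) ∷ (20 ∷ 33 ∷ 39 ∷  4 ∷ []) ∷ (20 ∷ 29 ∷ 53 ∷ 18 ∷ []) ∷ (20 ∷ 34 ∷ 52 ∷  7 ∷ []) ∷
  (20 ∷ 35 ∷ 54 ∷ 19 ∷ []) ∷ (20 ∷ 45 ∷ 43 ∷ 16 ∷ []) ∷ (20 ∷ 36 ∷ 60 ∷ 17 ∷ []) ∷ (20 ∷ 41 ∷ 46 ∷  8 ∷ []) ∷ (20 ∷ 37 ∷ 56 ∷ 11 ∷ []) ∷
  (20 ∷ 47 ∷ 62 ∷ 15 ∷ []) ∷ (20 ∷ 38 ∷ 61 ∷  0 ∷ []) ∷ (20 ∷ 48 ∷ 55 ∷ 14 ∷ []) ∷ (20 ∷ 44 ∷ 50 ∷ 13 ∷ []) ∷ (20 ∷ 58 ∷ 64 ∷  5 ∷ []) ∷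
  (25 ∷ 30 ∷ 62 ∷ 10 ∷ []) ∷ (25 ∷ 21 ∷ 54 ∷  4 ∷ []) ∷ (25 ∷ 31 ∷ 45 ∷  5 ∷ []) ∷ (25 ∷ 22 ∷ 56 ∷ 12 ∷ []) ∷ (25 ∷ 32 ∷ 35 ∷  8 ∷ []) ∷
  (25 ∷ 23 ∷ 47 ∷ 14 ∷ []) ∷ (25 ∷ 33 ∷ 64 ∷  3 ∷ []) ∷ (25 ∷ 24 ∷ 44 ∷  6 ∷ []) ∷ (25 ∷ 34 ∷ 58 ∷  0 ∷ []) ∷ (25 ∷ 40 ∷ 59 ∷ 19 ∷ []) ∷
  (25 ∷ 36 ∷ 48 ∷ 18 ∷ []) ∷ (25 ∷ 41 ∷ 51 ∷ 17 ∷ []) ∷ (25 ∷ 46 ∷ 37 ∷  1 ∷ []) ∷ (25 ∷ 42 ∷ 61 ∷ 11 ∷ []) ∷ (25 ∷ 38 ∷ 53 ∷ 15 ∷ []) ∷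
  (25 ∷ 43 ∷ 52 ∷  2 ∷ []) ∷ (25 ∷ 39 ∷ 60 ∷ 16 ∷ []) ∷ (25 ∷ 49 ∷ 55 ∷ 13 ∷ []) ∷ (25 ∷ 50 ∷ 63 ∷  7 ∷ []) ∷ (30 ∷ 21 ∷ 53 ∷ 12 ∷ []) ∷
  (30 ∷ 26 ∷ 59 ∷  6 ∷ []) ∷ (30 ∷ 22 ∷ 36 ∷  7 ∷ []) ∷ (30 ∷ 27 ∷ 61 ∷ 14 ∷ []) ∷ (30 ∷ 23 ∷ 40 ∷  1 ∷ []) ∷ (30 ∷ 28 ∷ 38 ∷ 16 ∷ []) ∷
  (30 ∷ 24 ∷ 50 ∷  5 ∷ []) ∷ (30 ∷ 29 ∷ 49 ∷  8 ∷ []) ∷ (30 ∷ 35 ∷ 60 ∷ 13 ∷ []) ∷ (30 ∷ 45 ∷ 64 ∷ 19 ∷ []) ∷ (30 ∷ 41 ∷ 39 ∷  0 ∷ []) ∷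
  (30 ∷ 46 ∷ 56 ∷ 17 ∷ []) ∷ (30 ∷ 37 ∷ 42 ∷  3 ∷ []) ∷ (30 ∷ 47 ∷ 52 ∷ 11 ∷ []) ∷ (30 ∷ 43 ∷ 58 ∷ 15 ∷ []) ∷ (30 ∷ 48 ∷ 57 ∷  4 ∷ []) ∷
  (30 ∷ 44 ∷ 51 ∷ 18 ∷ []) ∷ (30 ∷ 55 ∷ 54 ∷  9 ∷ []) ∷ (21 ∷ 26 ∷ 58 ∷ 14 ∷ []) ∷ (21 ∷ 31 ∷ 64 ∷  8 ∷ []) ∷ (21 ∷ 27 ∷ 41 ∷  9 ∷ []) ∷
  (21 ∷ 32 ∷ 52 ∷ 16 ∷ []) ∷ (21 ∷ 28 ∷ 45 ∷  3 ∷ []) ∷ (21 ∷ 33 ∷ 43 ∷ 18 ∷ []) ∷ (21 ∷ 29 ∷ 55 ∷  7 ∷ []) ∷ (21 ∷ 34 ∷ 35 ∷  1 ∷ []) ∷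
  (21 ∷ 40 ∷ 51 ∷ 13 ∷ []) ∷ (21 ∷ 36 ∷ 50 ∷ 19 ∷ []) ∷ (21 ∷ 46 ∷ 44 ∷  2 ∷ []) ∷ (21 ∷ 37 ∷ 61 ∷ 17 ∷ []) ∷ (21 ∷ 42 ∷ 47 ∷  5 ∷ []) ∷
  (21 ∷ 38 ∷ 57 ∷ 11 ∷ []) ∷ (21 ∷ 48 ∷ 63 ∷ 15 ∷ []) ∷ (21 ∷ 39 ∷ 62 ∷  6 ∷ []) ∷ (21 ∷ 49 ∷ 56 ∷  0 ∷ []) ∷ (21 ∷ 60 ∷ 59 ∷ 10 ∷ []) ∷
  (26 ∷ 31 ∷ 63 ∷ 16 ∷ []) ∷ (26 ∷ 22 ∷ 50 ∷  1 ∷ []) ∷ (26 ∷ 32 ∷ 46 ∷ 10 ∷ []) ∷ (26 ∷ 23 ∷ 57 ∷ 18 ∷ []) ∷ (26 ∷ 33 ∷ 36 ∷  5 ∷ []) ∷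
  (26 ∷ 24 ∷ 48 ∷  0 ∷ []) ∷ (26 ∷ 34 ∷ 60 ∷  9 ∷ []) ∷ (26 ∷ 35 ∷ 61 ∷  2 ∷ []) ∷ (26 ∷ 45 ∷ 56 ∷ 13 ∷ []) ∷ (26 ∷ 41 ∷ 55 ∷ 19 ∷ []) ∷
  (26 ∷ 37 ∷ 49 ∷  4 ∷ []) ∷ (26 ∷ 42 ∷ 52 ∷ 17 ∷ []) ∷ (26 ∷ 47 ∷ 38 ∷  7 ∷ []) ∷ (26 ∷ 43 ∷ 62 ∷ 11 ∷ []) ∷ (26 ∷ 39 ∷ 54 ∷ 15 ∷ []) ∷
  (26 ∷ 44 ∷ 53 ∷  8 ∷ []) ∷ (26 ∷ 51 ∷ 64 ∷ 12 ∷ []) ∷ (31 ∷ 22 ∷ 54 ∷ 18 ∷ []) ∷ (31 ∷ 27 ∷ 55 ∷  3 ∷ []) ∷ (31 ∷ 23 ∷ 37 ∷ 12 ∷ []) ∷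
  (31 ∷ 28 ∷ 62 ∷  0 ∷ []) ∷ (31 ∷ 24 ∷ 41 ∷  7 ∷ []) ∷ (31 ∷ 29 ∷ 39 ∷  2 ∷ []) ∷ (31 ∷ 35 ∷ 42 ∷  6 ∷ []) ∷ (31 ∷ 40 ∷ 52 ∷  4 ∷ []) ∷
  (31 ∷ 36 ∷ 61 ∷ 13 ∷ []) ∷ (31 ∷ 46 ∷ 60 ∷ 19 ∷ []) ∷ (31 ∷ 47 ∷ 57 ∷ 17 ∷ []) ∷ (31 ∷ 38 ∷ 43 ∷  9 ∷ []) ∷ (31 ∷ 48 ∷ 53 ∷ 11 ∷ []) ∷
  (31 ∷ 44 ∷ 59 ∷ 15 ∷ []) ∷ (31 ∷ 49 ∷ 58 ∷  1 ∷ []) ∷ (31 ∷ 50 ∷ 56 ∷ 14 ∷ []) ∷ (22 ∷ 27 ∷ 59 ∷  0 ∷ []) ∷ (22 ∷ 32 ∷ 60 ∷  5 ∷ []) ∷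
  (22 ∷ 28 ∷ 42 ∷ 14 ∷ []) ∷ (22 ∷ 33 ∷ 53 ∷  2 ∷ []) ∷ (22 ∷ 29 ∷ 46 ∷  9 ∷ []) ∷ (22 ∷ 34 ∷ 44 ∷  4 ∷ []) ∷ (22 ∷ 35 ∷ 63 ∷  3 ∷ []) ∷
  (22 ∷ 40 ∷ 47 ∷  8 ∷ []) ∷ (22 ∷ 45 ∷ 57 ∷  6 ∷ []) ∷ (22 ∷ 41 ∷ 52 ∷ 13 ∷ []) ∷ (22 ∷ 37 ∷ 51 ∷ 19 ∷ []) ∷ (22 ∷ 38 ∷ 62 ∷ 17 ∷ []) ∷
  (22 ∷ 43 ∷ 48 ∷ 10 ∷ []) ∷ (22 ∷ 39 ∷ 58 ∷ 11 ∷ []) ∷ (22 ∷ 49 ∷ 64 ∷ 15 ∷ []) ∷ (22 ∷ 55 ∷ 61 ∷ 16 ∷ []) ∷ (27 ∷ 32 ∷ 64 ∷  2 ∷ []) ∷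
  (27 ∷ 23 ∷ 51 ∷  7 ∷ []) ∷ (27 ∷ 33 ∷ 47 ∷ 16 ∷ []) ∷ (27 ∷ 24 ∷ 58 ∷  4 ∷ []) ∷ (27 ∷ 34 ∷ 37 ∷ 10 ∷ []) ∷ (27 ∷ 35 ∷ 50 ∷ 15 ∷ []) ∷
  (27 ∷ 40 ∷ 54 ∷  5 ∷ []) ∷ (27 ∷ 45 ∷ 38 ∷  1 ∷ []) ∷ (27 ∷ 36 ∷ 62 ∷  8 ∷ []) ∷ (27 ∷ 46 ∷ 57 ∷ 13 ∷ []) ∷ (27 ∷ 42 ∷ 56 ∷ 19 ∷ []) ∷
  (27 ∷ 43 ∷ 53 ∷ 17 ∷ []) ∷ (27 ∷ 48 ∷ 39 ∷ 12 ∷ []) ∷ (27 ∷ 44 ∷ 63 ∷ 11 ∷ []) ∷ (27 ∷ 60 ∷ 52 ∷ 18 ∷ []) ∷ (32 ∷ 23 ∷ 50 ∷  4 ∷ []) ∷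
  (32 ∷ 28 ∷ 56 ∷  9 ∷ []) ∷ (32 ∷ 24 ∷ 38 ∷ 18 ∷ []) ∷ (32 ∷ 29 ∷ 63 ∷  6 ∷ []) ∷ (32 ∷ 40 ∷ 55 ∷ 15 ∷ []) ∷ (32 ∷ 45 ∷ 59 ∷  7 ∷ []) ∷
  (32 ∷ 36 ∷ 43 ∷  3 ∷ []) ∷ (32 ∷ 41 ∷ 53 ∷  1 ∷ []) ∷ (32 ∷ 37 ∷ 62 ∷ 13 ∷ []) ∷ (32 ∷ 47 ∷ 61 ∷ 19 ∷ []) ∷ (32 ∷ 48 ∷ 58 ∷ 17 ∷ []) ∷
  (32 ∷ 39 ∷ 44 ∷ 14 ∷ []) ∷ (32 ∷ 49 ∷ 54 ∷ 11 ∷ []) ∷ (32 ∷ 51 ∷ 57 ∷  0 ∷ []) ∷ (23 ∷ 28 ∷ 55 ∷  6 ∷ []) ∷ (23 ∷ 33 ∷ 61 ∷ 10 ∷ []) ∷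
  (23 ∷ 29 ∷ 43 ∷  0 ∷ []) ∷ (23 ∷ 34 ∷ 54 ∷  8 ∷ []) ∷ (23 ∷ 35 ∷ 59 ∷ 11 ∷ []) ∷ (23 ∷ 45 ∷ 60 ∷ 15 ∷ []) ∷ (23 ∷ 36 ∷ 64 ∷  9 ∷ []) ∷
  (23 ∷ 41 ∷ 48 ∷  5 ∷ []) ∷ (23 ∷ 46 ∷ 58 ∷  3 ∷ []) ∷ (23 ∷ 42 ∷ 53 ∷ 13 ∷ []) ∷ (23 ∷ 38 ∷ 52 ∷ 19 ∷ []) ∷ (23 ∷ 39 ∷ 63 ∷ 17 ∷ []) ∷
  (23 ∷ 44 ∷ 49 ∷ 16 ∷ []) ∷ (23 ∷ 56 ∷ 62 ∷  2 ∷ []) ∷ (28 ∷ 33 ∷ 60 ∷  8 ∷ []) ∷ (28 ∷ 24 ∷ 52 ∷ 12 ∷ []) ∷ (28 ∷ 34 ∷ 48 ∷  2 ∷ []) ∷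
  (28 ∷ 35 ∷ 49 ∷ 18 ∷ []) ∷ (28 ∷ 40 ∷ 64 ∷ 11 ∷ []) ∷ (28 ∷ 36 ∷ 51 ∷ 15 ∷ []) ∷ (28 ∷ 41 ∷ 50 ∷ 10 ∷ []) ∷ (28 ∷ 46 ∷ 39 ∷  7 ∷ []) ∷
  (28 ∷ 37 ∷ 63 ∷  5 ∷ []) ∷ (28 ∷ 47 ∷ 58 ∷ 13 ∷ []) ∷ (28 ∷ 43 ∷ 57 ∷ 19 ∷ []) ∷ (28 ∷ 44 ∷ 54 ∷ 17 ∷ []) ∷ (28 ∷ 61 ∷ 53 ∷  4 ∷ []) ∷
  (33 ∷ 24 ∷ 51 ∷  1 ∷ []) ∷ (33 ∷ 29 ∷ 57 ∷ 14 ∷ []) ∷ (33 ∷ 35 ∷ 40 ∷  0 ∷ []) ∷ (33 ∷ 45 ∷ 50 ∷ 11 ∷ []) ∷ (33 ∷ 41 ∷ 56 ∷ 15 ∷ []) ∷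
  (33 ∷ 46 ∷ 55 ∷ 12 ∷ []) ∷ (33 ∷ 37 ∷ 44 ∷  9 ∷ []) ∷ (33 ∷ 42 ∷ 54 ∷  7 ∷ []) ∷ (33 ∷ 38 ∷ 63 ∷ 13 ∷ []) ∷ (33 ∷ 48 ∷ 62 ∷ 19 ∷ []) ∷
  (33 ∷ 49 ∷ 59 ∷ 17 ∷ []) ∷ (33 ∷ 52 ∷ 58 ∷  6 ∷ []) ∷ (24 ∷ 29 ∷ 56 ∷  3 ∷ []) ∷ (24 ∷ 34 ∷ 62 ∷ 16 ∷ []) ∷ (24 ∷ 35 ∷ 64 ∷ 17 ∷ []) ∷
  (24 ∷ 40 ∷ 45 ∷  2 ∷ []) ∷ (24 ∷ 36 ∷ 55 ∷ 11 ∷ []) ∷ (24 ∷ 46 ∷ 61 ∷ 15 ∷ []) ∷ (24 ∷ 37 ∷ 60 ∷ 14 ∷ []) ∷ (24 ∷ 42 ∷ 49 ∷ 10 ∷ []) ∷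
  (24 ∷ 47 ∷ 59 ∷  9 ∷ []) ∷ (24 ∷ 43 ∷ 54 ∷ 13 ∷ []) ∷ (24 ∷ 39 ∷ 53 ∷ 19 ∷ []) ∷ (24 ∷ 57 ∷ 63 ∷  8 ∷ []) ∷ (29 ∷ 34 ∷ 61 ∷  5 ∷ []) ∷
  (29 ∷ 35 ∷ 47 ∷ 12 ∷ []) ∷ (29 ∷ 40 ∷ 50 ∷ 17 ∷ []) ∷ (29 ∷ 45 ∷ 36 ∷  4 ∷ []) ∷ (29 ∷ 41 ∷ 60 ∷ 11 ∷ []) ∷ (29 ∷ 37 ∷ 52 ∷ 15 ∷ []) ∷
  (29 ∷ 42 ∷ 51 ∷ 16 ∷ []) ∷ (29 ∷ 38 ∷ 64 ∷ 10 ∷ []) ∷ (29 ∷ 48 ∷ 59 ∷ 13 ∷ []) ∷ (29 ∷ 44 ∷ 58 ∷ 19 ∷ []) ∷ (29 ∷ 62 ∷ 54 ∷  1 ∷ []) ∷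
  (34 ∷ 40 ∷ 38 ∷ 14 ∷ []) ∷ (34 ∷ 45 ∷ 55 ∷ 17 ∷ []) ∷ (34 ∷ 36 ∷ 41 ∷  6 ∷ []) ∷ (34 ∷ 46 ∷ 51 ∷ 11 ∷ []) ∷ (34 ∷ 42 ∷ 57 ∷ 15 ∷ []) ∷
  (34 ∷ 47 ∷ 56 ∷ 18 ∷ []) ∷ (34 ∷ 43 ∷ 50 ∷ 12 ∷ []) ∷ (34 ∷ 39 ∷ 64 ∷ 13 ∷ []) ∷ (34 ∷ 49 ∷ 63 ∷ 19 ∷ []) ∷ (34 ∷ 53 ∷ 59 ∷  3 ∷ []) ∷
  (35 ∷ 45 ∷ 51 ∷ 14 ∷ []) ∷ (35 ∷ 41 ∷ 58 ∷ 16 ∷ []) ∷ (35 ∷ 46 ∷ 53 ∷  5 ∷ []) ∷ (35 ∷ 43 ∷ 56 ∷  4 ∷ []) ∷ (35 ∷ 48 ∷ 52 ∷  9 ∷ []) ∷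
  (35 ∷ 44 ∷ 55 ∷ 10 ∷ []) ∷ (35 ∷ 57 ∷ 62 ∷  7 ∷ []) ∷ (40 ∷ 36 ∷ 56 ∷ 16 ∷ []) ∷ (40 ∷ 46 ∷ 63 ∷ 18 ∷ []) ∷ (40 ∷ 37 ∷ 58 ∷  7 ∷ []) ∷
  (40 ∷ 48 ∷ 61 ∷  6 ∷ []) ∷ (40 ∷ 39 ∷ 57 ∷ 10 ∷ []) ∷ (40 ∷ 49 ∷ 60 ∷ 12 ∷ []) ∷ (40 ∷ 62 ∷ 53 ∷  9 ∷ []) ∷ (45 ∷ 41 ∷ 61 ∷ 18 ∷ []) ∷
  (45 ∷ 37 ∷ 54 ∷  0 ∷ []) ∷ (45 ∷ 42 ∷ 63 ∷  9 ∷ []) ∷ (45 ∷ 39 ∷ 52 ∷  8 ∷ []) ∷ (45 ∷ 44 ∷ 62 ∷ 12 ∷ []) ∷ (45 ∷ 53 ∷ 58 ∷ 10 ∷ []) ∷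
  (36 ∷ 46 ∷ 52 ∷  0 ∷ []) ∷ (36 ∷ 42 ∷ 59 ∷  2 ∷ []) ∷ (36 ∷ 47 ∷ 54 ∷ 10 ∷ []) ∷ (36 ∷ 44 ∷ 57 ∷  1 ∷ []) ∷ (36 ∷ 49 ∷ 53 ∷ 14 ∷ []) ∷
  (36 ∷ 58 ∷ 63 ∷ 12 ∷ []) ∷ (41 ∷ 37 ∷ 57 ∷  2 ∷ []) ∷ (41 ∷ 47 ∷ 64 ∷  4 ∷ []) ∷ (41 ∷ 38 ∷ 59 ∷ 12 ∷ []) ∷ (41 ∷ 49 ∷ 62 ∷  3 ∷ []) ∷
  (41 ∷ 63 ∷ 54 ∷ 14 ∷ []) ∷ (46 ∷ 42 ∷ 62 ∷  4 ∷ []) ∷ (46 ∷ 38 ∷ 50 ∷  6 ∷ []) ∷ (46 ∷ 43 ∷ 64 ∷ 14 ∷ []) ∷ (46 ∷ 54 ∷ 59 ∷ 16 ∷ []) ∷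
  (37 ∷ 47 ∷ 53 ∷  6 ∷ []) ∷ (37 ∷ 43 ∷ 55 ∷  8 ∷ []) ∷ (37 ∷ 48 ∷ 50 ∷ 16 ∷ []) ∷ (37 ∷ 59 ∷ 64 ∷ 18 ∷ []) ∷ (42 ∷ 38 ∷ 58 ∷  8 ∷ []) ∷
  (42 ∷ 48 ∷ 60 ∷  1 ∷ []) ∷ (42 ∷ 39 ∷ 55 ∷ 18 ∷ []) ∷ (42 ∷ 50 ∷ 64 ∷  0 ∷ []) ∷ (47 ∷ 43 ∷ 63 ∷  1 ∷ []) ∷ (47 ∷ 39 ∷ 51 ∷  3 ∷ []) ∷
  (47 ∷ 44 ∷ 60 ∷  0 ∷ []) ∷ (47 ∷ 50 ∷ 55 ∷  2 ∷ []) ∷ (38 ∷ 48 ∷ 54 ∷  3 ∷ []) ∷ (38 ∷ 44 ∷ 56 ∷  5 ∷ []) ∷ (38 ∷ 49 ∷ 51 ∷  2 ∷ []) ∷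
  (38 ∷ 55 ∷ 60 ∷  4 ∷ []) ∷ (43 ∷ 39 ∷ 59 ∷  5 ∷ []) ∷ (43 ∷ 49 ∷ 61 ∷  7 ∷ []) ∷ (43 ∷ 60 ∷ 51 ∷  6 ∷ []) ∷ (48 ∷ 44 ∷ 64 ∷  7 ∷ []) ∷
  (48 ∷ 51 ∷ 56 ∷  8 ∷ []) ∷ (39 ∷ 49 ∷ 50 ∷  9 ∷ []) ∷ (39 ∷ 56 ∷ 61 ∷  1 ∷ []) ∷ (44 ∷ 61 ∷ 52 ∷  3 ∷ []) ∷ (49 ∷ 52 ∷ 57 ∷  5 ∷ []) ∷
  (50 ∷ 60 ∷ 57 ∷  3 ∷ []) ∷ (50 ∷ 61 ∷ 59 ∷  8 ∷ []) ∷ (50 ∷ 62 ∷ 58 ∷ 18 ∷ []) ∷ (55 ∷ 51 ∷ 62 ∷  5 ∷ []) ∷ (55 ∷ 52 ∷ 64 ∷  1 ∷ []) ∷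
  (55 ∷ 53 ∷ 63 ∷  0 ∷ []) ∷ (60 ∷ 56 ∷ 53 ∷  7 ∷ []) ∷ (60 ∷ 58 ∷ 54 ∷  2 ∷ []) ∷ (51 ∷ 61 ∷ 58 ∷  9 ∷ []) ∷ (51 ∷ 63 ∷ 59 ∷  4 ∷ []) ∷
  (56 ∷ 52 ∷ 63 ∷ 10 ∷ []) ∷ (56 ∷ 54 ∷ 64 ∷  6 ∷ []) ∷ (61 ∷ 57 ∷ 54 ∷ 12 ∷ []) ∷ (52 ∷ 62 ∷ 59 ∷ 14 ∷ []) ∷ (57 ∷ 53 ∷ 64 ∷ 16 ∷ []) ∷
  ( 0 ∷  2 ∷  7 ∷ 12 ∷ []) ∷ ( 0 ∷  4 ∷  3 ∷ 19 ∷ []) ∷ ( 0 ∷  6 ∷  9 ∷ 15 ∷ []) ∷ ( 0 ∷  8 ∷  5 ∷ 10 ∷ []) ∷ ( 0 ∷ 14 ∷ 18 ∷ 17 ∷ []) ∷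
  ( 0 ∷ 16 ∷ 11 ∷ 13 ∷ []) ∷ ( 2 ∷  4 ∷  9 ∷ 14 ∷ []) ∷ ( 2 ∷  6 ∷  5 ∷ 11 ∷ []) ∷ ( 2 ∷  8 ∷  1 ∷ 17 ∷ []) ∷ ( 2 ∷ 10 ∷ 16 ∷ 19 ∷ []) ∷
  ( 2 ∷ 18 ∷ 13 ∷ 15 ∷ []) ∷ ( 4 ∷  6 ∷  1 ∷ 16 ∷ []) ∷ ( 4 ∷  8 ∷  7 ∷ 13 ∷ []) ∷ ( 4 ∷ 10 ∷ 15 ∷ 17 ∷ []) ∷ ( 4 ∷ 12 ∷ 18 ∷ 11 ∷ []) ∷
  ( 6 ∷  8 ∷  3 ∷ 18 ∷ []) ∷ ( 6 ∷ 10 ∷ 14 ∷ 13 ∷ []) ∷ ( 6 ∷ 12 ∷ 17 ∷ 19 ∷ []) ∷ ( 8 ∷ 12 ∷ 16 ∷ 15 ∷ []) ∷ ( 8 ∷ 14 ∷ 11 ∷ 19 ∷ []) ∷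
  ( 1 ∷  3 ∷ 11 ∷ 15 ∷ []) ∷ ( 1 ∷  5 ∷ 12 ∷ 14 ∷ []) ∷ ( 1 ∷  7 ∷ 10 ∷ 18 ∷ []) ∷ ( 1 ∷  9 ∷ 13 ∷ 19 ∷ []) ∷ ( 3 ∷  5 ∷ 13 ∷ 17 ∷ []) ∷
  ( 3 ∷  7 ∷ 14 ∷ 16 ∷ []) ∷ ( 3 ∷  9 ∷ 10 ∷ 12 ∷ []) ∷ ( 5 ∷  7 ∷ 15 ∷ 19 ∷ []) ∷ ( 5 ∷  9 ∷ 16 ∷ 18 ∷ []) ∷ ( 7 ∷  9 ∷ 11 ∷ 17 ∷ []) ∷
  []

blocks-2⁹5¹³ : List (Vec ℕ 4)
blocks-2⁹5¹³ =
  (18 ∷ 23 ∷ 43 ∷  3 ∷ []) ∷ (18 ∷ 28 ∷ 34 ∷ 11 ∷ []) ∷ (18 ∷ 33 ∷ 63 ∷ 78 ∷ []) ∷ (18 ∷ 38 ∷ 47 ∷  1 ∷ []) ∷ (18 ∷ 24 ∷ 42 ∷  7 ∷ []) ∷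
  (18 ∷ 29 ∷ 71 ∷ 82 ∷ []) ∷ (18 ∷ 39 ∷ 31 ∷ 17 ∷ []) ∷ (18 ∷ 44 ∷ 73 ∷ 72 ∷ []) ∷ (18 ∷ 25 ∷ 56 ∷  9 ∷ []) ∷ (18 ∷ 30 ∷ 76 ∷  8 ∷ []) ∷
  (18 ∷ 35 ∷ 53 ∷ 70 ∷ []) ∷ (18 ∷ 40 ∷ 64 ∷ 10 ∷ []) ∷ (18 ∷ 45 ∷ 49 ∷ 12 ∷ []) ∷ (18 ∷ 26 ∷ 75 ∷ 52 ∷ []) ∷ (18 ∷ 36 ∷ 46 ∷  4 ∷ []) ∷
  (18 ∷ 41 ∷ 60 ∷ 80 ∷ []) ∷ (18 ∷ 27 ∷ 32 ∷ 16 ∷ []) ∷ (18 ∷ 37 ∷ 48 ∷ 13 ∷ []) ∷ (18 ∷ 58 ∷ 54 ∷ 81 ∷ []) ∷ (18 ∷ 68 ∷ 62 ∷  5 ∷ []) ∷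
  (18 ∷ 59 ∷ 50 ∷  2 ∷ []) ∷ (18 ∷ 69 ∷ 77 ∷ 15 ∷ []) ∷ (18 ∷ 74 ∷ 57 ∷  6 ∷ []) ∷ (18 ∷ 55 ∷ 65 ∷ 14 ∷ []) ∷ (18 ∷ 51 ∷ 67 ∷  0 ∷ []) ∷
  (18 ∷ 61 ∷ 66 ∷ 79 ∷ []) ∷ (23 ∷ 28 ∷ 19 ∷  5 ∷ []) ∷ (23 ∷ 33 ∷ 39 ∷ 12 ∷ []) ∷ (23 ∷ 38 ∷ 68 ∷ 79 ∷ []) ∷ (23 ∷ 29 ∷ 47 ∷  9 ∷ []) ∷
  (23 ∷ 34 ∷ 76 ∷ 80 ∷ []) ∷ (23 ∷ 44 ∷ 36 ∷ 78 ∷ []) ∷ (23 ∷ 20 ∷ 49 ∷ 77 ∷ []) ∷ (23 ∷ 30 ∷ 61 ∷ 11 ∷ []) ∷ (23 ∷ 35 ∷ 52 ∷ 10 ∷ []) ∷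
  (23 ∷ 40 ∷ 58 ∷ 75 ∷ []) ∷ (23 ∷ 45 ∷ 69 ∷  7 ∷ []) ∷ (23 ∷ 21 ∷ 54 ∷ 14 ∷ []) ∷ (23 ∷ 31 ∷ 51 ∷ 57 ∷ []) ∷ (23 ∷ 41 ∷ 22 ∷  1 ∷ []) ∷
  (23 ∷ 46 ∷ 65 ∷ 81 ∷ []) ∷ (23 ∷ 32 ∷ 37 ∷  0 ∷ []) ∷ (23 ∷ 42 ∷ 53 ∷ 15 ∷ []) ∷ (23 ∷ 48 ∷ 74 ∷ 17 ∷ []) ∷ (23 ∷ 63 ∷ 59 ∷ 82 ∷ []) ∷
  (23 ∷ 73 ∷ 67 ∷  6 ∷ []) ∷ (23 ∷ 64 ∷ 55 ∷  4 ∷ []) ∷ (23 ∷ 50 ∷ 62 ∷  8 ∷ []) ∷ (23 ∷ 60 ∷ 70 ∷ 16 ∷ []) ∷ (23 ∷ 56 ∷ 72 ∷  2 ∷ []) ∷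
  (23 ∷ 66 ∷ 71 ∷ 13 ∷ []) ∷ (28 ∷ 33 ∷ 24 ∷  6 ∷ []) ∷ (28 ∷ 38 ∷ 44 ∷ 14 ∷ []) ∷ (28 ∷ 43 ∷ 73 ∷ 13 ∷ []) ∷ (28 ∷ 39 ∷ 52 ∷ 81 ∷ []) ∷
  (28 ∷ 20 ∷ 41 ∷ 79 ∷ []) ∷ (28 ∷ 25 ∷ 48 ∷ 54 ∷ []) ∷ (28 ∷ 35 ∷ 66 ∷ 12 ∷ []) ∷ (28 ∷ 40 ∷ 57 ∷  7 ∷ []) ∷ (28 ∷ 45 ∷ 63 ∷ 51 ∷ []) ∷
  (28 ∷ 21 ∷ 74 ∷  9 ∷ []) ∷ (28 ∷ 26 ∷ 59 ∷ 16 ∷ []) ∷ (28 ∷ 36 ∷ 56 ∷ 62 ∷ []) ∷ (28 ∷ 46 ∷ 27 ∷  3 ∷ []) ∷ (28 ∷ 22 ∷ 70 ∷ 82 ∷ []) ∷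
  (28 ∷ 37 ∷ 42 ∷  2 ∷ []) ∷ (28 ∷ 47 ∷ 58 ∷ 17 ∷ []) ∷ (28 ∷ 53 ∷ 50 ∷ 78 ∷ []) ∷ (28 ∷ 68 ∷ 64 ∷ 80 ∷ []) ∷ (28 ∷ 49 ∷ 72 ∷  8 ∷ []) ∷
  (28 ∷ 69 ∷ 60 ∷  1 ∷ []) ∷ (28 ∷ 55 ∷ 67 ∷ 10 ∷ []) ∷ (28 ∷ 65 ∷ 75 ∷  0 ∷ []) ∷ (28 ∷ 61 ∷ 77 ∷  4 ∷ []) ∷ (28 ∷ 71 ∷ 76 ∷ 15 ∷ []) ∷
  (33 ∷ 38 ∷ 29 ∷  8 ∷ []) ∷ (33 ∷ 43 ∷ 20 ∷ 16 ∷ []) ∷ (33 ∷ 19 ∷ 49 ∷ 15 ∷ []) ∷ (33 ∷ 44 ∷ 57 ∷ 82 ∷ []) ∷ (33 ∷ 25 ∷ 46 ∷ 13 ∷ []) ∷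
  (33 ∷ 30 ∷ 53 ∷ 59 ∷ []) ∷ (33 ∷ 40 ∷ 71 ∷ 14 ∷ []) ∷ (33 ∷ 45 ∷ 62 ∷  9 ∷ []) ∷ (33 ∷ 21 ∷ 68 ∷ 56 ∷ []) ∷ (33 ∷ 26 ∷ 50 ∷ 11 ∷ []) ∷
  (33 ∷ 31 ∷ 64 ∷  0 ∷ []) ∷ (33 ∷ 41 ∷ 61 ∷ 67 ∷ []) ∷ (33 ∷ 22 ∷ 32 ∷  5 ∷ []) ∷ (33 ∷ 27 ∷ 75 ∷ 80 ∷ []) ∷ (33 ∷ 42 ∷ 47 ∷  4 ∷ []) ∷
  (33 ∷ 48 ∷ 66 ∷  1 ∷ []) ∷ (33 ∷ 58 ∷ 55 ∷ 79 ∷ []) ∷ (33 ∷ 73 ∷ 69 ∷ 81 ∷ []) ∷ (33 ∷ 54 ∷ 77 ∷ 10 ∷ []) ∷ (33 ∷ 74 ∷ 65 ∷  3 ∷ []) ∷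
  (33 ∷ 60 ∷ 72 ∷  7 ∷ []) ∷ (33 ∷ 70 ∷ 51 ∷  2 ∷ []) ∷ (33 ∷ 76 ∷ 52 ∷ 17 ∷ []) ∷ (38 ∷ 43 ∷ 34 ∷ 10 ∷ []) ∷ (38 ∷ 19 ∷ 25 ∷  0 ∷ []) ∷
  (38 ∷ 24 ∷ 54 ∷ 17 ∷ []) ∷ (38 ∷ 20 ∷ 62 ∷ 80 ∷ []) ∷ (38 ∷ 30 ∷ 22 ∷ 15 ∷ []) ∷ (38 ∷ 35 ∷ 58 ∷ 64 ∷ []) ∷ (38 ∷ 45 ∷ 76 ∷ 16 ∷ []) ∷
  (38 ∷ 21 ∷ 67 ∷ 11 ∷ []) ∷ (38 ∷ 26 ∷ 73 ∷ 61 ∷ []) ∷ (38 ∷ 31 ∷ 55 ∷ 12 ∷ []) ∷ (38 ∷ 36 ∷ 69 ∷  2 ∷ []) ∷ (38 ∷ 46 ∷ 66 ∷ 72 ∷ []) ∷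
  (38 ∷ 27 ∷ 37 ∷  6 ∷ []) ∷ (38 ∷ 32 ∷ 51 ∷ 81 ∷ []) ∷ (38 ∷ 48 ∷ 59 ∷  7 ∷ []) ∷ (38 ∷ 53 ∷ 71 ∷  3 ∷ []) ∷ (38 ∷ 63 ∷ 60 ∷ 13 ∷ []) ∷
  (38 ∷ 49 ∷ 74 ∷ 82 ∷ []) ∷ (38 ∷ 50 ∷ 70 ∷  5 ∷ []) ∷ (38 ∷ 65 ∷ 77 ∷  9 ∷ []) ∷ (38 ∷ 75 ∷ 56 ∷  4 ∷ []) ∷ (38 ∷ 52 ∷ 57 ∷ 78 ∷ []) ∷
  (43 ∷ 19 ∷ 39 ∷  7 ∷ []) ∷ (43 ∷ 24 ∷ 30 ∷  2 ∷ []) ∷ (43 ∷ 29 ∷ 59 ∷ 78 ∷ []) ∷ (43 ∷ 25 ∷ 67 ∷ 81 ∷ []) ∷ (43 ∷ 35 ∷ 27 ∷ 17 ∷ []) ∷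
  (43 ∷ 40 ∷ 63 ∷ 69 ∷ []) ∷ (43 ∷ 21 ∷ 52 ∷  0 ∷ []) ∷ (43 ∷ 26 ∷ 72 ∷ 12 ∷ []) ∷ (43 ∷ 31 ∷ 49 ∷ 66 ∷ []) ∷ (43 ∷ 36 ∷ 60 ∷ 14 ∷ []) ∷
  (43 ∷ 41 ∷ 74 ∷  4 ∷ []) ∷ (43 ∷ 22 ∷ 71 ∷ 77 ∷ []) ∷ (43 ∷ 32 ∷ 42 ∷  8 ∷ []) ∷ (43 ∷ 37 ∷ 56 ∷ 82 ∷ []) ∷ (43 ∷ 48 ∷ 70 ∷ 11 ∷ []) ∷
  (43 ∷ 53 ∷ 64 ∷  9 ∷ []) ∷ (43 ∷ 58 ∷ 76 ∷  5 ∷ []) ∷ (43 ∷ 68 ∷ 65 ∷ 15 ∷ []) ∷ (43 ∷ 54 ∷ 50 ∷ 80 ∷ []) ∷ (43 ∷ 55 ∷ 75 ∷  6 ∷ []) ∷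
  (43 ∷ 51 ∷ 61 ∷  1 ∷ []) ∷ (43 ∷ 57 ∷ 62 ∷ 79 ∷ []) ∷ (19 ∷ 24 ∷ 44 ∷  9 ∷ []) ∷ (19 ∷ 29 ∷ 35 ∷  4 ∷ []) ∷ (19 ∷ 34 ∷ 64 ∷ 79 ∷ []) ∷
  (19 ∷ 30 ∷ 72 ∷ 82 ∷ []) ∷ (19 ∷ 40 ∷ 32 ∷ 78 ∷ []) ∷ (19 ∷ 45 ∷ 68 ∷ 74 ∷ []) ∷ (19 ∷ 26 ∷ 57 ∷  2 ∷ []) ∷ (19 ∷ 31 ∷ 77 ∷ 14 ∷ []) ∷
  (19 ∷ 36 ∷ 54 ∷ 71 ∷ []) ∷ (19 ∷ 41 ∷ 65 ∷ 16 ∷ []) ∷ (19 ∷ 46 ∷ 50 ∷  1 ∷ []) ∷ (19 ∷ 27 ∷ 48 ∷ 76 ∷ []) ∷ (19 ∷ 37 ∷ 47 ∷ 10 ∷ []) ∷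
  (19 ∷ 42 ∷ 61 ∷ 80 ∷ []) ∷ (19 ∷ 53 ∷ 75 ∷ 12 ∷ []) ∷ (19 ∷ 58 ∷ 69 ∷ 11 ∷ []) ∷ (19 ∷ 63 ∷ 52 ∷  6 ∷ []) ∷ (19 ∷ 73 ∷ 70 ∷ 17 ∷ []) ∷
  (19 ∷ 59 ∷ 55 ∷ 81 ∷ []) ∷ (19 ∷ 60 ∷ 51 ∷  8 ∷ []) ∷ (19 ∷ 56 ∷ 66 ∷  3 ∷ []) ∷ (19 ∷ 62 ∷ 67 ∷ 13 ∷ []) ∷ (24 ∷ 29 ∷ 20 ∷ 11 ∷ []) ∷
  (24 ∷ 34 ∷ 40 ∷  1 ∷ []) ∷ (24 ∷ 39 ∷ 69 ∷ 13 ∷ []) ∷ (24 ∷ 35 ∷ 77 ∷ 80 ∷ []) ∷ (24 ∷ 45 ∷ 37 ∷ 79 ∷ []) ∷ (24 ∷ 21 ∷ 73 ∷ 50 ∷ []) ∷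
  (24 ∷ 31 ∷ 62 ∷  4 ∷ []) ∷ (24 ∷ 36 ∷ 48 ∷ 16 ∷ []) ∷ (24 ∷ 41 ∷ 59 ∷ 76 ∷ []) ∷ (24 ∷ 46 ∷ 70 ∷  0 ∷ []) ∷ (24 ∷ 22 ∷ 55 ∷  3 ∷ []) ∷
  (24 ∷ 32 ∷ 53 ∷ 52 ∷ []) ∷ (24 ∷ 47 ∷ 66 ∷ 81 ∷ []) ∷ (24 ∷ 58 ∷ 51 ∷ 14 ∷ []) ∷ (24 ∷ 63 ∷ 74 ∷ 12 ∷ []) ∷ (24 ∷ 68 ∷ 57 ∷  8 ∷ []) ∷
  (24 ∷ 49 ∷ 75 ∷ 78 ∷ []) ∷ (24 ∷ 64 ∷ 60 ∷ 82 ∷ []) ∷ (24 ∷ 65 ∷ 56 ∷ 10 ∷ []) ∷ (24 ∷ 61 ∷ 71 ∷  5 ∷ []) ∷ (24 ∷ 67 ∷ 72 ∷ 15 ∷ []) ∷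
  (29 ∷ 34 ∷ 25 ∷ 12 ∷ []) ∷ (29 ∷ 39 ∷ 45 ∷  3 ∷ []) ∷ (29 ∷ 44 ∷ 74 ∷ 15 ∷ []) ∷ (29 ∷ 40 ∷ 48 ∷ 81 ∷ []) ∷ (29 ∷ 21 ∷ 42 ∷ 13 ∷ []) ∷
  (29 ∷ 26 ∷ 49 ∷ 55 ∷ []) ∷ (29 ∷ 36 ∷ 67 ∷  1 ∷ []) ∷ (29 ∷ 41 ∷ 53 ∷  0 ∷ []) ∷ (29 ∷ 46 ∷ 64 ∷ 52 ∷ []) ∷ (29 ∷ 22 ∷ 75 ∷  2 ∷ []) ∷
  (29 ∷ 27 ∷ 60 ∷  5 ∷ []) ∷ (29 ∷ 37 ∷ 58 ∷ 57 ∷ []) ∷ (29 ∷ 63 ∷ 56 ∷ 16 ∷ []) ∷ (29 ∷ 68 ∷ 50 ∷ 14 ∷ []) ∷ (29 ∷ 73 ∷ 62 ∷ 10 ∷ []) ∷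
  (29 ∷ 54 ∷ 51 ∷ 79 ∷ []) ∷ (29 ∷ 69 ∷ 65 ∷ 80 ∷ []) ∷ (29 ∷ 70 ∷ 61 ∷  7 ∷ []) ∷ (29 ∷ 66 ∷ 76 ∷  6 ∷ []) ∷ (29 ∷ 72 ∷ 77 ∷ 17 ∷ []) ∷
  (34 ∷ 39 ∷ 30 ∷ 14 ∷ []) ∷ (34 ∷ 44 ∷ 21 ∷  5 ∷ []) ∷ (34 ∷ 20 ∷ 50 ∷ 17 ∷ []) ∷ (34 ∷ 45 ∷ 53 ∷ 82 ∷ []) ∷ (34 ∷ 26 ∷ 47 ∷ 15 ∷ []) ∷
  (34 ∷ 31 ∷ 54 ∷ 60 ∷ []) ∷ (34 ∷ 41 ∷ 72 ∷  3 ∷ []) ∷ (34 ∷ 46 ∷ 58 ∷  2 ∷ []) ∷ (34 ∷ 22 ∷ 69 ∷ 57 ∷ []) ∷ (34 ∷ 27 ∷ 51 ∷  4 ∷ []) ∷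
  (34 ∷ 32 ∷ 65 ∷  6 ∷ []) ∷ (34 ∷ 42 ∷ 63 ∷ 62 ∷ []) ∷ (34 ∷ 48 ∷ 77 ∷ 78 ∷ []) ∷ (34 ∷ 68 ∷ 61 ∷  0 ∷ []) ∷ (34 ∷ 73 ∷ 55 ∷ 16 ∷ []) ∷
  (34 ∷ 49 ∷ 67 ∷  7 ∷ []) ∷ (34 ∷ 59 ∷ 56 ∷ 13 ∷ []) ∷ (34 ∷ 74 ∷ 70 ∷ 81 ∷ []) ∷ (34 ∷ 75 ∷ 66 ∷  9 ∷ []) ∷ (34 ∷ 71 ∷ 52 ∷  8 ∷ []) ∷
  (39 ∷ 44 ∷ 35 ∷ 16 ∷ []) ∷ (39 ∷ 20 ∷ 26 ∷  6 ∷ []) ∷ (39 ∷ 25 ∷ 55 ∷ 78 ∷ []) ∷ (39 ∷ 21 ∷ 58 ∷ 80 ∷ []) ∷ (39 ∷ 36 ∷ 59 ∷ 65 ∷ []) ∷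
  (39 ∷ 46 ∷ 77 ∷  5 ∷ []) ∷ (39 ∷ 22 ∷ 63 ∷  4 ∷ []) ∷ (39 ∷ 27 ∷ 74 ∷ 62 ∷ []) ∷ (39 ∷ 32 ∷ 56 ∷  1 ∷ []) ∷ (39 ∷ 37 ∷ 70 ∷  8 ∷ []) ∷
  (39 ∷ 47 ∷ 68 ∷ 67 ∷ []) ∷ (39 ∷ 48 ∷ 53 ∷ 79 ∷ []) ∷ (39 ∷ 73 ∷ 66 ∷  2 ∷ []) ∷ (39 ∷ 49 ∷ 60 ∷  0 ∷ []) ∷ (39 ∷ 54 ∷ 72 ∷  9 ∷ []) ∷
  (39 ∷ 64 ∷ 61 ∷ 15 ∷ []) ∷ (39 ∷ 50 ∷ 75 ∷ 82 ∷ []) ∷ (39 ∷ 51 ∷ 71 ∷ 11 ∷ []) ∷ (39 ∷ 76 ∷ 57 ∷ 10 ∷ []) ∷ (44 ∷ 20 ∷ 40 ∷  0 ∷ []) ∷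
  (44 ∷ 25 ∷ 31 ∷  8 ∷ []) ∷ (44 ∷ 30 ∷ 60 ∷ 79 ∷ []) ∷ (44 ∷ 26 ∷ 63 ∷ 81 ∷ []) ∷ (44 ∷ 41 ∷ 64 ∷ 70 ∷ []) ∷ (44 ∷ 22 ∷ 48 ∷  6 ∷ []) ∷
  (44 ∷ 27 ∷ 68 ∷  1 ∷ []) ∷ (44 ∷ 32 ∷ 50 ∷ 67 ∷ []) ∷ (44 ∷ 37 ∷ 61 ∷  3 ∷ []) ∷ (44 ∷ 42 ∷ 75 ∷ 10 ∷ []) ∷ (44 ∷ 53 ∷ 58 ∷ 13 ∷ []) ∷
  (44 ∷ 49 ∷ 71 ∷  4 ∷ []) ∷ (44 ∷ 54 ∷ 65 ∷  2 ∷ []) ∷ (44 ∷ 59 ∷ 77 ∷ 11 ∷ []) ∷ (44 ∷ 69 ∷ 66 ∷ 17 ∷ []) ∷ (44 ∷ 55 ∷ 51 ∷ 80 ∷ []) ∷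
  (44 ∷ 56 ∷ 76 ∷ 12 ∷ []) ∷ (44 ∷ 52 ∷ 62 ∷  7 ∷ []) ∷ (20 ∷ 25 ∷ 45 ∷  2 ∷ []) ∷ (20 ∷ 30 ∷ 36 ∷ 10 ∷ []) ∷ (20 ∷ 35 ∷ 65 ∷ 13 ∷ []) ∷
  (20 ∷ 31 ∷ 68 ∷ 82 ∷ []) ∷ (20 ∷ 46 ∷ 69 ∷ 75 ∷ []) ∷ (20 ∷ 27 ∷ 53 ∷  8 ∷ []) ∷ (20 ∷ 32 ∷ 73 ∷  3 ∷ []) ∷ (20 ∷ 37 ∷ 55 ∷ 72 ∷ []) ∷
  (20 ∷ 42 ∷ 66 ∷  5 ∷ []) ∷ (20 ∷ 47 ∷ 51 ∷  7 ∷ []) ∷ (20 ∷ 48 ∷ 64 ∷ 12 ∷ []) ∷ (20 ∷ 58 ∷ 63 ∷ 15 ∷ []) ∷ (20 ∷ 54 ∷ 76 ∷  1 ∷ []) ∷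
  (20 ∷ 59 ∷ 70 ∷  4 ∷ []) ∷ (20 ∷ 74 ∷ 71 ∷ 78 ∷ []) ∷ (20 ∷ 60 ∷ 56 ∷ 81 ∷ []) ∷ (20 ∷ 61 ∷ 52 ∷ 14 ∷ []) ∷ (20 ∷ 57 ∷ 67 ∷  9 ∷ []) ∷
  (25 ∷ 30 ∷ 21 ∷  4 ∷ []) ∷ (25 ∷ 35 ∷ 41 ∷  7 ∷ []) ∷ (25 ∷ 40 ∷ 70 ∷ 15 ∷ []) ∷ (25 ∷ 36 ∷ 73 ∷ 80 ∷ []) ∷ (25 ∷ 22 ∷ 74 ∷ 51 ∷ []) ∷
  (25 ∷ 32 ∷ 58 ∷ 10 ∷ []) ∷ (25 ∷ 37 ∷ 49 ∷  5 ∷ []) ∷ (25 ∷ 42 ∷ 60 ∷ 77 ∷ []) ∷ (25 ∷ 47 ∷ 71 ∷  6 ∷ []) ∷ (25 ∷ 53 ∷ 69 ∷ 14 ∷ []) ∷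
  (25 ∷ 63 ∷ 68 ∷ 17 ∷ []) ∷ (25 ∷ 59 ∷ 52 ∷  3 ∷ []) ∷ (25 ∷ 64 ∷ 75 ∷  1 ∷ []) ∷ (25 ∷ 50 ∷ 76 ∷ 79 ∷ []) ∷ (25 ∷ 65 ∷ 61 ∷ 82 ∷ []) ∷
  (25 ∷ 66 ∷ 57 ∷ 16 ∷ []) ∷ (25 ∷ 62 ∷ 72 ∷ 11 ∷ []) ∷ (30 ∷ 35 ∷ 26 ∷  1 ∷ []) ∷ (30 ∷ 40 ∷ 46 ∷  9 ∷ []) ∷ (30 ∷ 45 ∷ 75 ∷ 17 ∷ []) ∷
  (30 ∷ 41 ∷ 49 ∷ 81 ∷ []) ∷ (30 ∷ 27 ∷ 50 ∷ 56 ∷ []) ∷ (30 ∷ 37 ∷ 63 ∷  7 ∷ []) ∷ (30 ∷ 42 ∷ 54 ∷  6 ∷ []) ∷ (30 ∷ 47 ∷ 48 ∷ 65 ∷ []) ∷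
  (30 ∷ 58 ∷ 74 ∷ 16 ∷ []) ∷ (30 ∷ 68 ∷ 73 ∷ 78 ∷ []) ∷ (30 ∷ 64 ∷ 57 ∷  5 ∷ []) ∷ (30 ∷ 69 ∷ 51 ∷  3 ∷ []) ∷ (30 ∷ 55 ∷ 52 ∷ 13 ∷ []) ∷
  (30 ∷ 70 ∷ 66 ∷ 80 ∷ []) ∷ (30 ∷ 71 ∷ 62 ∷  0 ∷ []) ∷ (30 ∷ 67 ∷ 77 ∷ 12 ∷ []) ∷ (35 ∷ 40 ∷ 31 ∷  3 ∷ []) ∷ (35 ∷ 45 ∷ 22 ∷ 11 ∷ []) ∷
  (35 ∷ 21 ∷ 51 ∷ 78 ∷ []) ∷ (35 ∷ 46 ∷ 54 ∷ 82 ∷ []) ∷ (35 ∷ 32 ∷ 55 ∷ 61 ∷ []) ∷ (35 ∷ 42 ∷ 68 ∷  9 ∷ []) ∷ (35 ∷ 47 ∷ 59 ∷  8 ∷ []) ∷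
  (35 ∷ 48 ∷ 72 ∷ 14 ∷ []) ∷ (35 ∷ 63 ∷ 50 ∷  0 ∷ []) ∷ (35 ∷ 73 ∷ 49 ∷ 79 ∷ []) ∷ (35 ∷ 69 ∷ 62 ∷  6 ∷ []) ∷ (35 ∷ 74 ∷ 56 ∷  5 ∷ []) ∷
  (35 ∷ 60 ∷ 57 ∷ 15 ∷ []) ∷ (35 ∷ 75 ∷ 71 ∷ 81 ∷ []) ∷ (35 ∷ 76 ∷ 67 ∷  2 ∷ []) ∷ (40 ∷ 45 ∷ 36 ∷  5 ∷ []) ∷ (40 ∷ 21 ∷ 27 ∷ 12 ∷ []) ∷
  (40 ∷ 26 ∷ 56 ∷ 79 ∷ []) ∷ (40 ∷ 22 ∷ 59 ∷ 80 ∷ []) ∷ (40 ∷ 37 ∷ 60 ∷ 66 ∷ []) ∷ (40 ∷ 47 ∷ 73 ∷ 11 ∷ []) ∷ (40 ∷ 53 ∷ 77 ∷ 16 ∷ []) ∷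
  (40 ∷ 68 ∷ 55 ∷  2 ∷ []) ∷ (40 ∷ 49 ∷ 54 ∷ 13 ∷ []) ∷ (40 ∷ 74 ∷ 67 ∷  8 ∷ []) ∷ (40 ∷ 50 ∷ 61 ∷  6 ∷ []) ∷ (40 ∷ 65 ∷ 62 ∷ 17 ∷ []) ∷
  (40 ∷ 51 ∷ 76 ∷ 82 ∷ []) ∷ (40 ∷ 52 ∷ 72 ∷  4 ∷ []) ∷ (45 ∷ 21 ∷ 41 ∷  6 ∷ []) ∷ (45 ∷ 26 ∷ 32 ∷ 14 ∷ []) ∷ (45 ∷ 31 ∷ 61 ∷ 13 ∷ []) ∷
  (45 ∷ 27 ∷ 64 ∷ 81 ∷ []) ∷ (45 ∷ 42 ∷ 65 ∷ 71 ∷ []) ∷ (45 ∷ 48 ∷ 58 ∷  0 ∷ []) ∷ (45 ∷ 73 ∷ 60 ∷  4 ∷ []) ∷ (45 ∷ 54 ∷ 59 ∷ 15 ∷ []) ∷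
  (45 ∷ 50 ∷ 72 ∷ 10 ∷ []) ∷ (45 ∷ 55 ∷ 66 ∷  8 ∷ []) ∷ (45 ∷ 70 ∷ 67 ∷ 78 ∷ []) ∷ (45 ∷ 56 ∷ 52 ∷ 80 ∷ []) ∷ (45 ∷ 57 ∷ 77 ∷  1 ∷ []) ∷
  (21 ∷ 26 ∷ 46 ∷  8 ∷ []) ∷ (21 ∷ 31 ∷ 37 ∷ 16 ∷ []) ∷ (21 ∷ 36 ∷ 66 ∷ 15 ∷ []) ∷ (21 ∷ 32 ∷ 69 ∷ 82 ∷ []) ∷ (21 ∷ 47 ∷ 70 ∷ 76 ∷ []) ∷
  (21 ∷ 48 ∷ 62 ∷  3 ∷ []) ∷ (21 ∷ 53 ∷ 63 ∷  2 ∷ []) ∷ (21 ∷ 49 ∷ 65 ∷  1 ∷ []) ∷ (21 ∷ 59 ∷ 64 ∷ 17 ∷ []) ∷ (21 ∷ 55 ∷ 77 ∷  7 ∷ []) ∷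
  (21 ∷ 60 ∷ 71 ∷ 10 ∷ []) ∷ (21 ∷ 75 ∷ 72 ∷ 79 ∷ []) ∷ (21 ∷ 61 ∷ 57 ∷ 81 ∷ []) ∷ (26 ∷ 31 ∷ 22 ∷ 10 ∷ []) ∷ (26 ∷ 36 ∷ 42 ∷  0 ∷ []) ∷
  (26 ∷ 41 ∷ 71 ∷ 17 ∷ []) ∷ (26 ∷ 37 ∷ 74 ∷ 80 ∷ []) ∷ (26 ∷ 48 ∷ 60 ∷  9 ∷ []) ∷ (26 ∷ 53 ∷ 67 ∷  5 ∷ []) ∷ (26 ∷ 58 ∷ 68 ∷  4 ∷ []) ∷
  (26 ∷ 54 ∷ 70 ∷  3 ∷ []) ∷ (26 ∷ 64 ∷ 69 ∷ 78 ∷ []) ∷ (26 ∷ 65 ∷ 76 ∷  7 ∷ []) ∷ (26 ∷ 51 ∷ 77 ∷ 13 ∷ []) ∷ (26 ∷ 66 ∷ 62 ∷ 82 ∷ []) ∷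
  (31 ∷ 36 ∷ 27 ∷  7 ∷ []) ∷ (31 ∷ 41 ∷ 47 ∷  2 ∷ []) ∷ (31 ∷ 46 ∷ 76 ∷ 78 ∷ []) ∷ (31 ∷ 42 ∷ 50 ∷ 81 ∷ []) ∷ (31 ∷ 48 ∷ 56 ∷ 15 ∷ []) ∷
  (31 ∷ 53 ∷ 65 ∷ 11 ∷ []) ∷ (31 ∷ 58 ∷ 72 ∷  6 ∷ []) ∷ (31 ∷ 63 ∷ 73 ∷  1 ∷ []) ∷ (31 ∷ 59 ∷ 75 ∷  5 ∷ []) ∷ (31 ∷ 69 ∷ 74 ∷ 79 ∷ []) ∷
  (31 ∷ 70 ∷ 52 ∷  9 ∷ []) ∷ (31 ∷ 71 ∷ 67 ∷ 80 ∷ []) ∷ (36 ∷ 41 ∷ 32 ∷  9 ∷ []) ∷ (36 ∷ 22 ∷ 52 ∷ 79 ∷ []) ∷ (36 ∷ 47 ∷ 55 ∷ 82 ∷ []) ∷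
  (36 ∷ 53 ∷ 61 ∷ 17 ∷ []) ∷ (36 ∷ 58 ∷ 70 ∷ 12 ∷ []) ∷ (36 ∷ 63 ∷ 77 ∷  8 ∷ []) ∷ (36 ∷ 68 ∷ 49 ∷  3 ∷ []) ∷ (36 ∷ 64 ∷ 51 ∷  6 ∷ []) ∷
  (36 ∷ 74 ∷ 50 ∷ 13 ∷ []) ∷ (36 ∷ 75 ∷ 57 ∷ 11 ∷ []) ∷ (36 ∷ 76 ∷ 72 ∷ 81 ∷ []) ∷ (41 ∷ 46 ∷ 37 ∷ 11 ∷ []) ∷ (41 ∷ 27 ∷ 57 ∷ 13 ∷ []) ∷
  (41 ∷ 48 ∷ 68 ∷ 10 ∷ []) ∷ (41 ∷ 58 ∷ 66 ∷ 78 ∷ []) ∷ (41 ∷ 63 ∷ 75 ∷ 14 ∷ []) ∷ (41 ∷ 73 ∷ 54 ∷  5 ∷ []) ∷ (41 ∷ 69 ∷ 56 ∷  8 ∷ []) ∷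
  (41 ∷ 50 ∷ 55 ∷ 15 ∷ []) ∷ (41 ∷ 51 ∷ 62 ∷ 12 ∷ []) ∷ (41 ∷ 52 ∷ 77 ∷ 82 ∷ []) ∷ (46 ∷ 22 ∷ 42 ∷ 12 ∷ []) ∷ (46 ∷ 32 ∷ 62 ∷ 15 ∷ []) ∷
  (46 ∷ 48 ∷ 57 ∷ 80 ∷ []) ∷ (46 ∷ 53 ∷ 73 ∷  7 ∷ []) ∷ (46 ∷ 63 ∷ 71 ∷ 79 ∷ []) ∷ (46 ∷ 68 ∷ 51 ∷ 16 ∷ []) ∷ (46 ∷ 49 ∷ 59 ∷  6 ∷ []) ∷
  (46 ∷ 74 ∷ 61 ∷ 10 ∷ []) ∷ (46 ∷ 55 ∷ 60 ∷ 17 ∷ []) ∷ (46 ∷ 56 ∷ 67 ∷ 14 ∷ []) ∷ (22 ∷ 27 ∷ 47 ∷ 14 ∷ []) ∷ (22 ∷ 37 ∷ 67 ∷ 17 ∷ []) ∷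
  (22 ∷ 53 ∷ 62 ∷ 81 ∷ []) ∷ (22 ∷ 58 ∷ 49 ∷  9 ∷ []) ∷ (22 ∷ 68 ∷ 76 ∷ 13 ∷ []) ∷ (22 ∷ 73 ∷ 56 ∷  0 ∷ []) ∷ (22 ∷ 54 ∷ 64 ∷  8 ∷ []) ∷
  (22 ∷ 50 ∷ 66 ∷  7 ∷ []) ∷ (22 ∷ 60 ∷ 65 ∷ 78 ∷ []) ∷ (22 ∷ 61 ∷ 72 ∷ 16 ∷ []) ∷ (27 ∷ 42 ∷ 72 ∷ 78 ∷ []) ∷ (27 ∷ 58 ∷ 67 ∷ 82 ∷ []) ∷
  (27 ∷ 63 ∷ 54 ∷ 11 ∷ []) ∷ (27 ∷ 73 ∷ 52 ∷ 15 ∷ []) ∷ (27 ∷ 49 ∷ 61 ∷  2 ∷ []) ∷ (27 ∷ 59 ∷ 69 ∷ 10 ∷ []) ∷ (27 ∷ 55 ∷ 71 ∷  9 ∷ []) ∷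
  (27 ∷ 65 ∷ 70 ∷ 79 ∷ []) ∷ (27 ∷ 66 ∷ 77 ∷  0 ∷ []) ∷ (32 ∷ 47 ∷ 77 ∷ 79 ∷ []) ∷ (32 ∷ 48 ∷ 71 ∷  2 ∷ []) ∷ (32 ∷ 63 ∷ 72 ∷ 80 ∷ []) ∷
  (32 ∷ 68 ∷ 59 ∷ 12 ∷ []) ∷ (32 ∷ 49 ∷ 57 ∷ 17 ∷ []) ∷ (32 ∷ 54 ∷ 66 ∷  4 ∷ []) ∷ (32 ∷ 64 ∷ 74 ∷  7 ∷ []) ∷ (32 ∷ 60 ∷ 76 ∷ 11 ∷ []) ∷
  (32 ∷ 70 ∷ 75 ∷ 13 ∷ []) ∷ (37 ∷ 53 ∷ 76 ∷  4 ∷ []) ∷ (37 ∷ 68 ∷ 77 ∷ 81 ∷ []) ∷ (37 ∷ 73 ∷ 64 ∷ 14 ∷ []) ∷ (37 ∷ 54 ∷ 62 ∷ 78 ∷ []) ∷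
  (37 ∷ 59 ∷ 71 ∷  1 ∷ []) ∷ (37 ∷ 69 ∷ 50 ∷  9 ∷ []) ∷ (37 ∷ 65 ∷ 52 ∷ 12 ∷ []) ∷ (37 ∷ 75 ∷ 51 ∷ 15 ∷ []) ∷ (42 ∷ 48 ∷ 73 ∷ 82 ∷ []) ∷
  (42 ∷ 58 ∷ 52 ∷  1 ∷ []) ∷ (42 ∷ 49 ∷ 69 ∷ 16 ∷ []) ∷ (42 ∷ 59 ∷ 67 ∷ 79 ∷ []) ∷ (42 ∷ 64 ∷ 76 ∷  3 ∷ []) ∷ (42 ∷ 74 ∷ 55 ∷ 11 ∷ []) ∷
  (42 ∷ 70 ∷ 57 ∷ 14 ∷ []) ∷ (42 ∷ 51 ∷ 56 ∷ 17 ∷ []) ∷ (47 ∷ 53 ∷ 49 ∷ 80 ∷ []) ∷ (47 ∷ 63 ∷ 57 ∷  3 ∷ []) ∷ (47 ∷ 54 ∷ 74 ∷  0 ∷ []) ∷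
  (47 ∷ 64 ∷ 72 ∷ 13 ∷ []) ∷ (47 ∷ 69 ∷ 52 ∷  5 ∷ []) ∷ (47 ∷ 50 ∷ 60 ∷ 12 ∷ []) ∷ (47 ∷ 75 ∷ 62 ∷ 16 ∷ []) ∷ (47 ∷ 56 ∷ 61 ∷ 78 ∷ []) ∷
  (48 ∷ 63 ∷ 55 ∷  5 ∷ []) ∷ (48 ∷ 69 ∷ 67 ∷  4 ∷ []) ∷ (48 ∷ 75 ∷ 61 ∷  8 ∷ []) ∷ (53 ∷ 68 ∷ 60 ∷  6 ∷ []) ∷ (53 ∷ 74 ∷ 72 ∷  1 ∷ []) ∷
  (53 ∷ 51 ∷ 66 ∷ 10 ∷ []) ∷ (58 ∷ 73 ∷ 65 ∷  8 ∷ []) ∷ (58 ∷ 50 ∷ 77 ∷  3 ∷ []) ∷ (58 ∷ 56 ∷ 71 ∷  7 ∷ []) ∷ (63 ∷ 49 ∷ 70 ∷ 10 ∷ []) ∷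
  (63 ∷ 61 ∷ 76 ∷  9 ∷ []) ∷ (68 ∷ 54 ∷ 75 ∷  7 ∷ []) ∷ (68 ∷ 66 ∷ 52 ∷ 11 ∷ []) ∷ (73 ∷ 59 ∷ 51 ∷  9 ∷ []) ∷ (73 ∷ 71 ∷ 57 ∷ 12 ∷ []) ∷
  (49 ∷ 64 ∷ 56 ∷ 11 ∷ []) ∷ (49 ∷ 76 ∷ 62 ∷ 14 ∷ []) ∷ (54 ∷ 69 ∷ 61 ∷ 12 ∷ []) ∷ (54 ∷ 52 ∷ 67 ∷ 16 ∷ []) ∷ (59 ∷ 74 ∷ 66 ∷ 14 ∷ []) ∷
  (59 ∷ 57 ∷ 72 ∷  0 ∷ []) ∷ (64 ∷ 50 ∷ 71 ∷ 16 ∷ []) ∷ (64 ∷ 62 ∷ 77 ∷  2 ∷ []) ∷ (69 ∷ 55 ∷ 76 ∷  0 ∷ []) ∷ (74 ∷ 60 ∷ 52 ∷  2 ∷ []) ∷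
  (50 ∷ 65 ∷ 57 ∷  4 ∷ []) ∷ (55 ∷ 70 ∷ 62 ∷  1 ∷ []) ∷ (60 ∷ 75 ∷ 67 ∷  3 ∷ []) ∷ (65 ∷ 51 ∷ 72 ∷  5 ∷ []) ∷ (70 ∷ 56 ∷ 77 ∷  6 ∷ []) ∷
  ( 0 ∷  2 ∷  4 ∷ 81 ∷ []) ∷ ( 0 ∷  3 ∷  8 ∷  7 ∷ []) ∷ ( 0 ∷  5 ∷ 16 ∷ 15 ∷ []) ∷ ( 0 ∷  6 ∷ 17 ∷ 78 ∷ []) ∷ ( 0 ∷ 10 ∷ 12 ∷ 82 ∷ []) ∷
  ( 0 ∷  9 ∷ 14 ∷ 80 ∷ []) ∷ ( 0 ∷ 11 ∷ 13 ∷ 79 ∷ []) ∷ ( 2 ∷  1 ∷ 12 ∷ 17 ∷ []) ∷ ( 2 ∷  5 ∷ 10 ∷  9 ∷ []) ∷ ( 2 ∷  6 ∷ 14 ∷ 82 ∷ []) ∷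
  ( 2 ∷  8 ∷ 13 ∷ 78 ∷ []) ∷ ( 2 ∷  7 ∷ 15 ∷ 79 ∷ []) ∷ ( 2 ∷ 11 ∷ 16 ∷ 80 ∷ []) ∷ ( 4 ∷  1 ∷  6 ∷ 11 ∷ []) ∷ ( 4 ∷  3 ∷ 14 ∷ 13 ∷ []) ∷
  ( 4 ∷  8 ∷ 16 ∷ 82 ∷ []) ∷ ( 4 ∷ 10 ∷ 15 ∷ 78 ∷ []) ∷ ( 4 ∷  7 ∷ 12 ∷ 80 ∷ []) ∷ ( 4 ∷  9 ∷ 17 ∷ 79 ∷ []) ∷ ( 1 ∷  3 ∷  5 ∷ 80 ∷ []) ∷
  ( 1 ∷  8 ∷ 14 ∷ 79 ∷ []) ∷ ( 1 ∷ 10 ∷ 13 ∷ 81 ∷ []) ∷ ( 1 ∷  7 ∷ 16 ∷ 78 ∷ []) ∷ ( 1 ∷  9 ∷ 15 ∷ 82 ∷ []) ∷ ( 3 ∷  6 ∷ 15 ∷ 81 ∷ []) ∷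
  ( 3 ∷ 10 ∷ 16 ∷ 79 ∷ []) ∷ ( 3 ∷  9 ∷ 12 ∷ 78 ∷ []) ∷ ( 3 ∷ 11 ∷ 17 ∷ 82 ∷ []) ∷ ( 5 ∷  6 ∷ 12 ∷ 79 ∷ []) ∷ ( 5 ∷  8 ∷ 17 ∷ 81 ∷ []) ∷
  ( 5 ∷  7 ∷ 13 ∷ 82 ∷ []) ∷ ( 5 ∷ 11 ∷ 14 ∷ 78 ∷ []) ∷ ( 6 ∷  8 ∷ 10 ∷ 80 ∷ []) ∷ ( 6 ∷  9 ∷ 16 ∷ 13 ∷ []) ∷ ( 8 ∷ 11 ∷ 12 ∷ 15 ∷ []) ∷
  (10 ∷  7 ∷ 14 ∷ 17 ∷ []) ∷ ( 7 ∷  9 ∷ 11 ∷ 81 ∷ []) ∷ (12 ∷ 14 ∷ 16 ∷ 81 ∷ []) ∷ (13 ∷ 15 ∷ 17 ∷ 80 ∷ []) ∷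
  []

blocks-2¹³5¹² : List (Vec ℕ 4)
blocks-2¹³5¹² =
  (26 ∷ 31 ∷ 73 ∷ 14 ∷ []) ∷ (26 ∷ 36 ∷ 72 ∷ 11 ∷ []) ∷ (26 ∷ 41 ∷ 67 ∷  3 ∷ []) ∷ (26 ∷ 32 ∷ 63 ∷  4 ∷ []) ∷ (26 ∷ 37 ∷ 47 ∷ 10 ∷ []) ∷
  (26 ∷ 42 ∷ 80 ∷  0 ∷ []) ∷ (26 ∷ 33 ∷ 52 ∷ 20 ∷ []) ∷ (26 ∷ 38 ∷ 53 ∷ 65 ∷ []) ∷ (26 ∷ 43 ∷ 50 ∷  2 ∷ []) ∷ (26 ∷ 34 ∷ 83 ∷  1 ∷ []) ∷
  (26 ∷ 39 ∷ 60 ∷ 13 ∷ []) ∷ (26 ∷ 44 ∷ 57 ∷  9 ∷ []) ∷ (26 ∷ 35 ∷ 71 ∷ 22 ∷ []) ∷ (26 ∷ 40 ∷ 81 ∷  7 ∷ []) ∷ (26 ∷ 45 ∷ 68 ∷ 12 ∷ []) ∷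
  (26 ∷ 46 ∷ 84 ∷  8 ∷ []) ∷ (26 ∷ 51 ∷ 79 ∷ 21 ∷ []) ∷ (26 ∷ 56 ∷ 54 ∷ 18 ∷ []) ∷ (26 ∷ 61 ∷ 82 ∷ 25 ∷ []) ∷ (26 ∷ 62 ∷ 74 ∷ 17 ∷ []) ∷
  (26 ∷ 48 ∷ 59 ∷ 16 ∷ []) ∷ (26 ∷ 58 ∷ 76 ∷  6 ∷ []) ∷ (26 ∷ 49 ∷ 75 ∷ 19 ∷ []) ∷ (26 ∷ 64 ∷ 70 ∷ 15 ∷ []) ∷ (26 ∷ 55 ∷ 66 ∷ 23 ∷ []) ∷
  (26 ∷ 77 ∷ 69 ∷ 24 ∷ []) ∷ (26 ∷ 78 ∷ 85 ∷  5 ∷ []) ∷ (31 ∷ 36 ∷ 78 ∷ 16 ∷ []) ∷ (31 ∷ 41 ∷ 77 ∷ 13 ∷ []) ∷ (31 ∷ 27 ∷ 72 ∷  5 ∷ []) ∷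
  (31 ∷ 37 ∷ 49 ∷  6 ∷ []) ∷ (31 ∷ 42 ∷ 52 ∷ 12 ∷ []) ∷ (31 ∷ 28 ∷ 85 ∷  2 ∷ []) ∷ (31 ∷ 38 ∷ 57 ∷ 22 ∷ []) ∷ (31 ∷ 43 ∷ 46 ∷ 58 ∷ []) ∷
  (31 ∷ 29 ∷ 55 ∷  4 ∷ []) ∷ (31 ∷ 39 ∷ 69 ∷  3 ∷ []) ∷ (31 ∷ 44 ∷ 65 ∷  0 ∷ []) ∷ (31 ∷ 30 ∷ 62 ∷ 11 ∷ []) ∷ (31 ∷ 40 ∷ 76 ∷ 24 ∷ []) ∷
  (31 ∷ 45 ∷ 67 ∷  9 ∷ []) ∷ (31 ∷ 51 ∷ 70 ∷ 10 ∷ []) ∷ (31 ∷ 56 ∷ 84 ∷ 21 ∷ []) ∷ (31 ∷ 61 ∷ 59 ∷ 20 ∷ []) ∷ (31 ∷ 47 ∷ 68 ∷ 25 ∷ []) ∷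
  (31 ∷ 48 ∷ 79 ∷ 17 ∷ []) ∷ (31 ∷ 53 ∷ 64 ∷ 18 ∷ []) ∷ (31 ∷ 63 ∷ 81 ∷  8 ∷ []) ∷ (31 ∷ 54 ∷ 80 ∷ 19 ∷ []) ∷ (31 ∷ 50 ∷ 75 ∷ 15 ∷ []) ∷
  (31 ∷ 60 ∷ 71 ∷ 23 ∷ []) ∷ (31 ∷ 66 ∷ 83 ∷  7 ∷ []) ∷ (31 ∷ 82 ∷ 74 ∷  1 ∷ []) ∷ (36 ∷ 41 ∷ 83 ∷ 18 ∷ []) ∷ (36 ∷ 27 ∷ 82 ∷  0 ∷ []) ∷
  (36 ∷ 32 ∷ 77 ∷  7 ∷ []) ∷ (36 ∷ 42 ∷ 54 ∷  8 ∷ []) ∷ (36 ∷ 28 ∷ 57 ∷ 14 ∷ []) ∷ (36 ∷ 33 ∷ 66 ∷  4 ∷ []) ∷ (36 ∷ 43 ∷ 62 ∷ 24 ∷ []) ∷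
  (36 ∷ 29 ∷ 51 ∷ 63 ∷ []) ∷ (36 ∷ 34 ∷ 60 ∷  6 ∷ []) ∷ (36 ∷ 44 ∷ 74 ∷  5 ∷ []) ∷ (36 ∷ 30 ∷ 46 ∷  2 ∷ []) ∷ (36 ∷ 35 ∷ 48 ∷ 13 ∷ []) ∷
  (36 ∷ 45 ∷ 81 ∷  1 ∷ []) ∷ (36 ∷ 56 ∷ 75 ∷ 12 ∷ []) ∷ (36 ∷ 61 ∷ 70 ∷ 21 ∷ []) ∷ (36 ∷ 47 ∷ 64 ∷ 22 ∷ []) ∷ (36 ∷ 52 ∷ 73 ∷ 25 ∷ []) ∷
  (36 ∷ 53 ∷ 84 ∷ 17 ∷ []) ∷ (36 ∷ 58 ∷ 50 ∷ 20 ∷ []) ∷ (36 ∷ 49 ∷ 67 ∷ 10 ∷ []) ∷ (36 ∷ 59 ∷ 85 ∷ 19 ∷ []) ∷ (36 ∷ 55 ∷ 80 ∷ 15 ∷ []) ∷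
  (36 ∷ 65 ∷ 76 ∷ 23 ∷ []) ∷ (36 ∷ 71 ∷ 69 ∷  9 ∷ []) ∷ (36 ∷ 68 ∷ 79 ∷  3 ∷ []) ∷ (41 ∷ 27 ∷ 69 ∷ 20 ∷ []) ∷ (41 ∷ 32 ∷ 68 ∷  2 ∷ []) ∷
  (41 ∷ 37 ∷ 82 ∷  9 ∷ []) ∷ (41 ∷ 28 ∷ 59 ∷ 10 ∷ []) ∷ (41 ∷ 33 ∷ 62 ∷ 16 ∷ []) ∷ (41 ∷ 38 ∷ 71 ∷  6 ∷ []) ∷ (41 ∷ 29 ∷ 48 ∷  1 ∷ []) ∷
  (41 ∷ 34 ∷ 56 ∷ 49 ∷ []) ∷ (41 ∷ 39 ∷ 65 ∷  8 ∷ []) ∷ (41 ∷ 30 ∷ 79 ∷  7 ∷ []) ∷ (41 ∷ 35 ∷ 51 ∷  4 ∷ []) ∷ (41 ∷ 40 ∷ 53 ∷  0 ∷ []) ∷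
  (41 ∷ 46 ∷ 81 ∷ 23 ∷ []) ∷ (41 ∷ 61 ∷ 80 ∷ 14 ∷ []) ∷ (41 ∷ 47 ∷ 75 ∷ 21 ∷ []) ∷ (41 ∷ 52 ∷ 50 ∷ 24 ∷ []) ∷ (41 ∷ 57 ∷ 78 ∷ 25 ∷ []) ∷
  (41 ∷ 58 ∷ 70 ∷ 17 ∷ []) ∷ (41 ∷ 63 ∷ 55 ∷ 22 ∷ []) ∷ (41 ∷ 54 ∷ 72 ∷ 12 ∷ []) ∷ (41 ∷ 64 ∷ 66 ∷ 19 ∷ []) ∷ (41 ∷ 60 ∷ 85 ∷ 15 ∷ []) ∷
  (41 ∷ 76 ∷ 74 ∷ 11 ∷ []) ∷ (41 ∷ 73 ∷ 84 ∷  5 ∷ []) ∷ (27 ∷ 32 ∷ 74 ∷ 22 ∷ []) ∷ (27 ∷ 37 ∷ 73 ∷  4 ∷ []) ∷ (27 ∷ 42 ∷ 68 ∷ 11 ∷ []) ∷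
  (27 ∷ 33 ∷ 64 ∷ 12 ∷ []) ∷ (27 ∷ 38 ∷ 48 ∷ 18 ∷ []) ∷ (27 ∷ 43 ∷ 76 ∷  8 ∷ []) ∷ (27 ∷ 34 ∷ 53 ∷  3 ∷ []) ∷ (27 ∷ 39 ∷ 61 ∷ 54 ∷ []) ∷
  (27 ∷ 44 ∷ 46 ∷ 10 ∷ []) ∷ (27 ∷ 35 ∷ 84 ∷  9 ∷ []) ∷ (27 ∷ 40 ∷ 56 ∷  6 ∷ []) ∷ (27 ∷ 45 ∷ 58 ∷  2 ∷ []) ∷ (27 ∷ 51 ∷ 67 ∷ 23 ∷ []) ∷
  (27 ∷ 47 ∷ 85 ∷ 16 ∷ []) ∷ (27 ∷ 52 ∷ 80 ∷ 21 ∷ []) ∷ (27 ∷ 57 ∷ 55 ∷  1 ∷ []) ∷ (27 ∷ 62 ∷ 83 ∷ 25 ∷ []) ∷ (27 ∷ 63 ∷ 75 ∷ 17 ∷ []) ∷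
  (27 ∷ 49 ∷ 60 ∷ 24 ∷ []) ∷ (27 ∷ 59 ∷ 77 ∷ 14 ∷ []) ∷ (27 ∷ 50 ∷ 71 ∷ 19 ∷ []) ∷ (27 ∷ 65 ∷ 66 ∷ 15 ∷ []) ∷ (27 ∷ 81 ∷ 79 ∷ 13 ∷ []) ∷
  (27 ∷ 78 ∷ 70 ∷  7 ∷ []) ∷ (32 ∷ 37 ∷ 79 ∷ 24 ∷ []) ∷ (32 ∷ 42 ∷ 78 ∷  6 ∷ []) ∷ (32 ∷ 28 ∷ 73 ∷ 13 ∷ []) ∷ (32 ∷ 38 ∷ 50 ∷ 14 ∷ []) ∷
  (32 ∷ 43 ∷ 53 ∷ 20 ∷ []) ∷ (32 ∷ 29 ∷ 81 ∷ 10 ∷ []) ∷ (32 ∷ 39 ∷ 58 ∷  5 ∷ []) ∷ (32 ∷ 44 ∷ 47 ∷ 59 ∷ []) ∷ (32 ∷ 30 ∷ 51 ∷ 12 ∷ []) ∷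
  (32 ∷ 40 ∷ 70 ∷ 11 ∷ []) ∷ (32 ∷ 45 ∷ 61 ∷  8 ∷ []) ∷ (32 ∷ 46 ∷ 71 ∷ 15 ∷ []) ∷ (32 ∷ 56 ∷ 72 ∷ 23 ∷ []) ∷ (32 ∷ 52 ∷ 66 ∷ 18 ∷ []) ∷
  (32 ∷ 57 ∷ 85 ∷ 21 ∷ []) ∷ (32 ∷ 62 ∷ 60 ∷  3 ∷ []) ∷ (32 ∷ 48 ∷ 69 ∷ 25 ∷ []) ∷ (32 ∷ 49 ∷ 80 ∷ 17 ∷ []) ∷ (32 ∷ 54 ∷ 65 ∷  1 ∷ []) ∷
  (32 ∷ 64 ∷ 82 ∷ 16 ∷ []) ∷ (32 ∷ 55 ∷ 76 ∷ 19 ∷ []) ∷ (32 ∷ 67 ∷ 84 ∷  0 ∷ []) ∷ (32 ∷ 83 ∷ 75 ∷  9 ∷ []) ∷ (37 ∷ 42 ∷ 84 ∷  1 ∷ []) ∷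
  (37 ∷ 28 ∷ 83 ∷  8 ∷ []) ∷ (37 ∷ 33 ∷ 78 ∷  0 ∷ []) ∷ (37 ∷ 43 ∷ 55 ∷ 16 ∷ []) ∷ (37 ∷ 29 ∷ 58 ∷ 22 ∷ []) ∷ (37 ∷ 34 ∷ 67 ∷ 12 ∷ []) ∷
  (37 ∷ 44 ∷ 63 ∷  7 ∷ []) ∷ (37 ∷ 30 ∷ 52 ∷ 64 ∷ []) ∷ (37 ∷ 35 ∷ 56 ∷ 14 ∷ []) ∷ (37 ∷ 45 ∷ 75 ∷ 13 ∷ []) ∷ (37 ∷ 46 ∷ 59 ∷  3 ∷ []) ∷
  (37 ∷ 51 ∷ 76 ∷ 15 ∷ []) ∷ (37 ∷ 61 ∷ 77 ∷ 23 ∷ []) ∷ (37 ∷ 57 ∷ 71 ∷ 20 ∷ []) ∷ (37 ∷ 62 ∷ 66 ∷ 21 ∷ []) ∷ (37 ∷ 48 ∷ 65 ∷  5 ∷ []) ∷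
  (37 ∷ 53 ∷ 74 ∷ 25 ∷ []) ∷ (37 ∷ 54 ∷ 85 ∷ 17 ∷ []) ∷ (37 ∷ 50 ∷ 68 ∷ 18 ∷ []) ∷ (37 ∷ 60 ∷ 81 ∷ 19 ∷ []) ∷ (37 ∷ 72 ∷ 70 ∷  2 ∷ []) ∷
  (37 ∷ 69 ∷ 80 ∷ 11 ∷ []) ∷ (42 ∷ 28 ∷ 70 ∷  3 ∷ []) ∷ (42 ∷ 33 ∷ 69 ∷ 10 ∷ []) ∷ (42 ∷ 38 ∷ 83 ∷  2 ∷ []) ∷ (42 ∷ 29 ∷ 60 ∷ 18 ∷ []) ∷
  (42 ∷ 34 ∷ 63 ∷ 24 ∷ []) ∷ (42 ∷ 39 ∷ 72 ∷ 14 ∷ []) ∷ (42 ∷ 30 ∷ 49 ∷  9 ∷ []) ∷ (42 ∷ 35 ∷ 57 ∷ 50 ∷ []) ∷ (42 ∷ 40 ∷ 61 ∷ 16 ∷ []) ∷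
  (42 ∷ 46 ∷ 53 ∷  7 ∷ []) ∷ (42 ∷ 51 ∷ 64 ∷  5 ∷ []) ∷ (42 ∷ 56 ∷ 81 ∷ 15 ∷ []) ∷ (42 ∷ 47 ∷ 82 ∷ 23 ∷ []) ∷ (42 ∷ 62 ∷ 76 ∷ 22 ∷ []) ∷
  (42 ∷ 48 ∷ 71 ∷ 21 ∷ []) ∷ (42 ∷ 58 ∷ 79 ∷ 25 ∷ []) ∷ (42 ∷ 59 ∷ 66 ∷ 17 ∷ []) ∷ (42 ∷ 55 ∷ 73 ∷ 20 ∷ []) ∷ (42 ∷ 65 ∷ 67 ∷ 19 ∷ []) ∷
  (42 ∷ 77 ∷ 75 ∷  4 ∷ []) ∷ (42 ∷ 74 ∷ 85 ∷ 13 ∷ []) ∷ (28 ∷ 33 ∷ 75 ∷  5 ∷ []) ∷ (28 ∷ 38 ∷ 74 ∷ 12 ∷ []) ∷ (28 ∷ 43 ∷ 69 ∷  4 ∷ []) ∷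
  (28 ∷ 34 ∷ 65 ∷ 20 ∷ []) ∷ (28 ∷ 39 ∷ 49 ∷  1 ∷ []) ∷ (28 ∷ 44 ∷ 77 ∷ 16 ∷ []) ∷ (28 ∷ 35 ∷ 54 ∷ 11 ∷ []) ∷ (28 ∷ 40 ∷ 62 ∷ 55 ∷ []) ∷
  (28 ∷ 45 ∷ 47 ∷ 18 ∷ []) ∷ (28 ∷ 46 ∷ 72 ∷ 19 ∷ []) ∷ (28 ∷ 51 ∷ 58 ∷  9 ∷ []) ∷ (28 ∷ 56 ∷ 50 ∷  7 ∷ []) ∷ (28 ∷ 61 ∷ 67 ∷ 15 ∷ []) ∷
  (28 ∷ 52 ∷ 68 ∷ 23 ∷ []) ∷ (28 ∷ 48 ∷ 81 ∷ 24 ∷ []) ∷ (28 ∷ 53 ∷ 76 ∷ 21 ∷ []) ∷ (28 ∷ 63 ∷ 84 ∷ 25 ∷ []) ∷ (28 ∷ 64 ∷ 71 ∷ 17 ∷ []) ∷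
  (28 ∷ 60 ∷ 78 ∷ 22 ∷ []) ∷ (28 ∷ 66 ∷ 79 ∷  0 ∷ []) ∷ (28 ∷ 82 ∷ 80 ∷  6 ∷ []) ∷ (33 ∷ 38 ∷ 80 ∷  7 ∷ []) ∷ (33 ∷ 43 ∷ 79 ∷ 14 ∷ []) ∷
  (33 ∷ 29 ∷ 74 ∷  6 ∷ []) ∷ (33 ∷ 39 ∷ 46 ∷ 22 ∷ []) ∷ (33 ∷ 44 ∷ 54 ∷  3 ∷ []) ∷ (33 ∷ 30 ∷ 82 ∷ 18 ∷ []) ∷ (33 ∷ 40 ∷ 59 ∷ 13 ∷ []) ∷
  (33 ∷ 45 ∷ 48 ∷ 60 ∷ []) ∷ (33 ∷ 51 ∷ 77 ∷ 19 ∷ []) ∷ (33 ∷ 56 ∷ 63 ∷ 11 ∷ []) ∷ (33 ∷ 61 ∷ 55 ∷  9 ∷ []) ∷ (33 ∷ 47 ∷ 72 ∷ 15 ∷ []) ∷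
  (33 ∷ 57 ∷ 73 ∷ 23 ∷ []) ∷ (33 ∷ 53 ∷ 67 ∷  1 ∷ []) ∷ (33 ∷ 58 ∷ 81 ∷ 21 ∷ []) ∷ (33 ∷ 49 ∷ 70 ∷ 25 ∷ []) ∷ (33 ∷ 50 ∷ 76 ∷ 17 ∷ []) ∷
  (33 ∷ 65 ∷ 83 ∷ 24 ∷ []) ∷ (33 ∷ 71 ∷ 84 ∷  2 ∷ []) ∷ (33 ∷ 68 ∷ 85 ∷  8 ∷ []) ∷ (38 ∷ 43 ∷ 85 ∷  9 ∷ []) ∷ (38 ∷ 29 ∷ 84 ∷ 16 ∷ []) ∷
  (38 ∷ 34 ∷ 79 ∷  8 ∷ []) ∷ (38 ∷ 44 ∷ 51 ∷ 24 ∷ []) ∷ (38 ∷ 30 ∷ 59 ∷  5 ∷ []) ∷ (38 ∷ 35 ∷ 68 ∷ 20 ∷ []) ∷ (38 ∷ 45 ∷ 64 ∷  0 ∷ []) ∷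
  (38 ∷ 46 ∷ 69 ∷  1 ∷ []) ∷ (38 ∷ 56 ∷ 82 ∷ 19 ∷ []) ∷ (38 ∷ 61 ∷ 49 ∷ 13 ∷ []) ∷ (38 ∷ 47 ∷ 60 ∷ 11 ∷ []) ∷ (38 ∷ 52 ∷ 77 ∷ 15 ∷ []) ∷
  (38 ∷ 62 ∷ 78 ∷ 23 ∷ []) ∷ (38 ∷ 58 ∷ 72 ∷  3 ∷ []) ∷ (38 ∷ 63 ∷ 67 ∷ 21 ∷ []) ∷ (38 ∷ 54 ∷ 75 ∷ 25 ∷ []) ∷ (38 ∷ 55 ∷ 81 ∷ 17 ∷ []) ∷
  (38 ∷ 66 ∷ 73 ∷ 10 ∷ []) ∷ (38 ∷ 76 ∷ 70 ∷  4 ∷ []) ∷ (43 ∷ 29 ∷ 66 ∷ 11 ∷ []) ∷ (43 ∷ 34 ∷ 70 ∷ 18 ∷ []) ∷ (43 ∷ 39 ∷ 84 ∷ 10 ∷ []) ∷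
  (43 ∷ 30 ∷ 56 ∷  1 ∷ []) ∷ (43 ∷ 35 ∷ 64 ∷  7 ∷ []) ∷ (43 ∷ 40 ∷ 73 ∷ 22 ∷ []) ∷ (43 ∷ 51 ∷ 74 ∷  3 ∷ []) ∷ (43 ∷ 61 ∷ 68 ∷ 19 ∷ []) ∷
  (43 ∷ 47 ∷ 54 ∷  0 ∷ []) ∷ (43 ∷ 52 ∷ 65 ∷ 13 ∷ []) ∷ (43 ∷ 57 ∷ 82 ∷ 15 ∷ []) ∷ (43 ∷ 48 ∷ 83 ∷ 23 ∷ []) ∷ (43 ∷ 63 ∷ 77 ∷  5 ∷ []) ∷
  (43 ∷ 49 ∷ 72 ∷ 21 ∷ []) ∷ (43 ∷ 59 ∷ 80 ∷ 25 ∷ []) ∷ (43 ∷ 60 ∷ 67 ∷ 17 ∷ []) ∷ (43 ∷ 71 ∷ 78 ∷ 12 ∷ []) ∷ (43 ∷ 81 ∷ 75 ∷  6 ∷ []) ∷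
  (29 ∷ 34 ∷ 71 ∷ 13 ∷ []) ∷ (29 ∷ 39 ∷ 75 ∷ 20 ∷ []) ∷ (29 ∷ 44 ∷ 70 ∷ 12 ∷ []) ∷ (29 ∷ 35 ∷ 61 ∷  3 ∷ []) ∷ (29 ∷ 40 ∷ 50 ∷  9 ∷ []) ∷
  (29 ∷ 45 ∷ 78 ∷ 24 ∷ []) ∷ (29 ∷ 46 ∷ 57 ∷  0 ∷ []) ∷ (29 ∷ 56 ∷ 79 ∷  5 ∷ []) ∷ (29 ∷ 47 ∷ 73 ∷ 19 ∷ []) ∷ (29 ∷ 52 ∷ 59 ∷  2 ∷ []) ∷
  (29 ∷ 62 ∷ 68 ∷ 15 ∷ []) ∷ (29 ∷ 53 ∷ 69 ∷ 23 ∷ []) ∷ (29 ∷ 49 ∷ 82 ∷  7 ∷ []) ∷ (29 ∷ 54 ∷ 77 ∷ 21 ∷ []) ∷ (29 ∷ 64 ∷ 85 ∷ 25 ∷ []) ∷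
  (29 ∷ 65 ∷ 72 ∷ 17 ∷ []) ∷ (29 ∷ 76 ∷ 83 ∷ 14 ∷ []) ∷ (29 ∷ 67 ∷ 80 ∷  8 ∷ []) ∷ (34 ∷ 39 ∷ 76 ∷  0 ∷ []) ∷ (34 ∷ 44 ∷ 80 ∷ 22 ∷ []) ∷
  (34 ∷ 30 ∷ 75 ∷ 14 ∷ []) ∷ (34 ∷ 40 ∷ 47 ∷  5 ∷ []) ∷ (34 ∷ 45 ∷ 55 ∷ 11 ∷ []) ∷ (34 ∷ 46 ∷ 77 ∷ 17 ∷ []) ∷ (34 ∷ 51 ∷ 62 ∷  2 ∷ []) ∷
  (34 ∷ 61 ∷ 84 ∷  7 ∷ []) ∷ (34 ∷ 52 ∷ 78 ∷ 19 ∷ []) ∷ (34 ∷ 57 ∷ 64 ∷  4 ∷ []) ∷ (34 ∷ 48 ∷ 73 ∷ 15 ∷ []) ∷ (34 ∷ 58 ∷ 74 ∷ 23 ∷ []) ∷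
  (34 ∷ 54 ∷ 68 ∷  9 ∷ []) ∷ (34 ∷ 59 ∷ 82 ∷ 21 ∷ []) ∷ (34 ∷ 50 ∷ 66 ∷ 25 ∷ []) ∷ (34 ∷ 81 ∷ 69 ∷ 16 ∷ []) ∷ (34 ∷ 72 ∷ 85 ∷ 10 ∷ []) ∷
  (39 ∷ 44 ∷ 81 ∷  2 ∷ []) ∷ (39 ∷ 30 ∷ 85 ∷ 24 ∷ []) ∷ (39 ∷ 35 ∷ 80 ∷ 16 ∷ []) ∷ (39 ∷ 45 ∷ 52 ∷  7 ∷ []) ∷ (39 ∷ 51 ∷ 82 ∷ 17 ∷ []) ∷
  (39 ∷ 56 ∷ 48 ∷  4 ∷ []) ∷ (39 ∷ 47 ∷ 70 ∷  9 ∷ []) ∷ (39 ∷ 57 ∷ 83 ∷ 19 ∷ []) ∷ (39 ∷ 62 ∷ 50 ∷  6 ∷ []) ∷ (39 ∷ 53 ∷ 78 ∷ 15 ∷ []) ∷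
  (39 ∷ 63 ∷ 79 ∷ 23 ∷ []) ∷ (39 ∷ 59 ∷ 73 ∷ 11 ∷ []) ∷ (39 ∷ 64 ∷ 68 ∷ 21 ∷ []) ∷ (39 ∷ 55 ∷ 71 ∷ 25 ∷ []) ∷ (39 ∷ 66 ∷ 77 ∷ 12 ∷ []) ∷
  (39 ∷ 67 ∷ 74 ∷ 18 ∷ []) ∷ (44 ∷ 30 ∷ 67 ∷  4 ∷ []) ∷ (44 ∷ 35 ∷ 66 ∷  1 ∷ []) ∷ (44 ∷ 40 ∷ 85 ∷ 18 ∷ []) ∷ (44 ∷ 56 ∷ 68 ∷ 17 ∷ []) ∷
  (44 ∷ 61 ∷ 53 ∷  6 ∷ []) ∷ (44 ∷ 52 ∷ 75 ∷ 11 ∷ []) ∷ (44 ∷ 62 ∷ 69 ∷ 19 ∷ []) ∷ (44 ∷ 48 ∷ 55 ∷  8 ∷ []) ∷ (44 ∷ 58 ∷ 83 ∷ 15 ∷ []) ∷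
  (44 ∷ 49 ∷ 84 ∷ 23 ∷ []) ∷ (44 ∷ 64 ∷ 78 ∷ 13 ∷ []) ∷ (44 ∷ 50 ∷ 73 ∷ 21 ∷ []) ∷ (44 ∷ 60 ∷ 76 ∷ 25 ∷ []) ∷ (44 ∷ 71 ∷ 82 ∷ 14 ∷ []) ∷
  (44 ∷ 72 ∷ 79 ∷ 20 ∷ []) ∷ (30 ∷ 35 ∷ 72 ∷  6 ∷ []) ∷ (30 ∷ 40 ∷ 71 ∷  3 ∷ []) ∷ (30 ∷ 45 ∷ 66 ∷ 20 ∷ []) ∷ (30 ∷ 61 ∷ 73 ∷ 17 ∷ []) ∷
  (30 ∷ 47 ∷ 58 ∷  8 ∷ []) ∷ (30 ∷ 57 ∷ 80 ∷ 13 ∷ []) ∷ (30 ∷ 48 ∷ 74 ∷ 19 ∷ []) ∷ (30 ∷ 53 ∷ 60 ∷ 10 ∷ []) ∷ (30 ∷ 63 ∷ 69 ∷ 15 ∷ []) ∷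
  (30 ∷ 54 ∷ 70 ∷ 23 ∷ []) ∷ (30 ∷ 50 ∷ 83 ∷  0 ∷ []) ∷ (30 ∷ 55 ∷ 78 ∷ 21 ∷ []) ∷ (30 ∷ 65 ∷ 81 ∷ 25 ∷ []) ∷ (30 ∷ 76 ∷ 68 ∷ 16 ∷ []) ∷
  (30 ∷ 77 ∷ 84 ∷ 22 ∷ []) ∷ (35 ∷ 40 ∷ 77 ∷  8 ∷ []) ∷ (35 ∷ 45 ∷ 76 ∷  5 ∷ []) ∷ (35 ∷ 46 ∷ 67 ∷ 25 ∷ []) ∷ (35 ∷ 47 ∷ 78 ∷ 17 ∷ []) ∷
  (35 ∷ 52 ∷ 63 ∷ 10 ∷ []) ∷ (35 ∷ 62 ∷ 85 ∷  0 ∷ []) ∷ (35 ∷ 53 ∷ 79 ∷ 19 ∷ []) ∷ (35 ∷ 58 ∷ 65 ∷ 12 ∷ []) ∷ (35 ∷ 49 ∷ 74 ∷ 15 ∷ []) ∷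
  (35 ∷ 59 ∷ 75 ∷ 23 ∷ []) ∷ (35 ∷ 55 ∷ 69 ∷  2 ∷ []) ∷ (35 ∷ 60 ∷ 83 ∷ 21 ∷ []) ∷ (35 ∷ 81 ∷ 73 ∷ 18 ∷ []) ∷ (35 ∷ 82 ∷ 70 ∷ 24 ∷ []) ∷
  (40 ∷ 45 ∷ 82 ∷ 10 ∷ []) ∷ (40 ∷ 46 ∷ 63 ∷ 14 ∷ []) ∷ (40 ∷ 51 ∷ 72 ∷ 25 ∷ []) ∷ (40 ∷ 52 ∷ 83 ∷ 17 ∷ []) ∷ (40 ∷ 57 ∷ 49 ∷ 12 ∷ []) ∷
  (40 ∷ 48 ∷ 66 ∷  2 ∷ []) ∷ (40 ∷ 58 ∷ 84 ∷ 19 ∷ []) ∷ (40 ∷ 54 ∷ 79 ∷ 15 ∷ []) ∷ (40 ∷ 64 ∷ 80 ∷ 23 ∷ []) ∷ (40 ∷ 60 ∷ 74 ∷  4 ∷ []) ∷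
  (40 ∷ 65 ∷ 69 ∷ 21 ∷ []) ∷ (40 ∷ 67 ∷ 78 ∷ 20 ∷ []) ∷ (40 ∷ 68 ∷ 75 ∷  1 ∷ []) ∷ (45 ∷ 46 ∷ 74 ∷ 21 ∷ []) ∷ (45 ∷ 51 ∷ 49 ∷ 16 ∷ []) ∷
  (45 ∷ 56 ∷ 77 ∷ 25 ∷ []) ∷ (45 ∷ 57 ∷ 69 ∷ 17 ∷ []) ∷ (45 ∷ 62 ∷ 54 ∷ 14 ∷ []) ∷ (45 ∷ 53 ∷ 71 ∷  4 ∷ []) ∷ (45 ∷ 63 ∷ 70 ∷ 19 ∷ []) ∷
  (45 ∷ 59 ∷ 84 ∷ 15 ∷ []) ∷ (45 ∷ 50 ∷ 85 ∷ 23 ∷ []) ∷ (45 ∷ 65 ∷ 79 ∷  6 ∷ []) ∷ (45 ∷ 72 ∷ 83 ∷ 22 ∷ []) ∷ (45 ∷ 73 ∷ 80 ∷  3 ∷ []) ∷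
  (46 ∷ 51 ∷ 68 ∷ 13 ∷ []) ∷ (46 ∷ 56 ∷ 76 ∷ 20 ∷ []) ∷ (46 ∷ 61 ∷ 85 ∷ 12 ∷ []) ∷ (46 ∷ 52 ∷ 79 ∷  9 ∷ []) ∷ (46 ∷ 62 ∷ 80 ∷  4 ∷ []) ∷
  (46 ∷ 54 ∷ 83 ∷  5 ∷ []) ∷ (46 ∷ 64 ∷ 73 ∷ 24 ∷ []) ∷ (46 ∷ 55 ∷ 70 ∷  6 ∷ []) ∷ (46 ∷ 60 ∷ 66 ∷ 16 ∷ []) ∷ (46 ∷ 65 ∷ 82 ∷ 11 ∷ []) ∷
  (46 ∷ 78 ∷ 75 ∷ 18 ∷ []) ∷ (51 ∷ 56 ∷ 73 ∷  0 ∷ []) ∷ (51 ∷ 61 ∷ 81 ∷ 22 ∷ []) ∷ (51 ∷ 47 ∷ 66 ∷ 14 ∷ []) ∷ (51 ∷ 57 ∷ 84 ∷ 11 ∷ []) ∷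
  (51 ∷ 48 ∷ 85 ∷  6 ∷ []) ∷ (51 ∷ 59 ∷ 69 ∷  7 ∷ []) ∷ (51 ∷ 50 ∷ 78 ∷  1 ∷ []) ∷ (51 ∷ 60 ∷ 75 ∷  8 ∷ []) ∷ (51 ∷ 65 ∷ 71 ∷ 18 ∷ []) ∷
  (51 ∷ 83 ∷ 80 ∷ 20 ∷ []) ∷ (56 ∷ 61 ∷ 78 ∷  2 ∷ []) ∷ (56 ∷ 47 ∷ 67 ∷ 24 ∷ []) ∷ (56 ∷ 52 ∷ 71 ∷ 16 ∷ []) ∷ (56 ∷ 62 ∷ 70 ∷ 13 ∷ []) ∷
  (56 ∷ 53 ∷ 66 ∷  8 ∷ []) ∷ (56 ∷ 64 ∷ 74 ∷  9 ∷ []) ∷ (56 ∷ 55 ∷ 83 ∷  3 ∷ []) ∷ (56 ∷ 65 ∷ 80 ∷ 10 ∷ []) ∷ (56 ∷ 69 ∷ 85 ∷ 22 ∷ []) ∷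
  (61 ∷ 47 ∷ 83 ∷  4 ∷ []) ∷ (61 ∷ 52 ∷ 72 ∷  1 ∷ []) ∷ (61 ∷ 57 ∷ 76 ∷ 18 ∷ []) ∷ (61 ∷ 48 ∷ 75 ∷  0 ∷ []) ∷ (61 ∷ 58 ∷ 71 ∷ 10 ∷ []) ∷
  (61 ∷ 50 ∷ 79 ∷ 11 ∷ []) ∷ (61 ∷ 60 ∷ 69 ∷  5 ∷ []) ∷ (61 ∷ 66 ∷ 74 ∷ 24 ∷ []) ∷ (47 ∷ 52 ∷ 69 ∷  6 ∷ []) ∷ (47 ∷ 57 ∷ 77 ∷  3 ∷ []) ∷
  (47 ∷ 62 ∷ 81 ∷ 20 ∷ []) ∷ (47 ∷ 53 ∷ 80 ∷  2 ∷ []) ∷ (47 ∷ 63 ∷ 76 ∷ 12 ∷ []) ∷ (47 ∷ 55 ∷ 84 ∷ 13 ∷ []) ∷ (47 ∷ 65 ∷ 74 ∷  7 ∷ []) ∷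
  (47 ∷ 71 ∷ 79 ∷  1 ∷ []) ∷ (52 ∷ 57 ∷ 74 ∷  8 ∷ []) ∷ (52 ∷ 62 ∷ 82 ∷  5 ∷ []) ∷ (52 ∷ 48 ∷ 67 ∷ 22 ∷ []) ∷ (52 ∷ 58 ∷ 85 ∷  4 ∷ []) ∷
  (52 ∷ 49 ∷ 81 ∷ 14 ∷ []) ∷ (52 ∷ 60 ∷ 70 ∷  0 ∷ []) ∷ (52 ∷ 76 ∷ 84 ∷  3 ∷ []) ∷ (57 ∷ 62 ∷ 79 ∷ 10 ∷ []) ∷ (57 ∷ 48 ∷ 68 ∷  7 ∷ []) ∷
  (57 ∷ 53 ∷ 72 ∷ 24 ∷ []) ∷ (57 ∷ 63 ∷ 66 ∷  6 ∷ []) ∷ (57 ∷ 54 ∷ 67 ∷ 16 ∷ []) ∷ (57 ∷ 65 ∷ 75 ∷  2 ∷ []) ∷ (57 ∷ 81 ∷ 70 ∷  5 ∷ []) ∷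
  (62 ∷ 48 ∷ 84 ∷ 12 ∷ []) ∷ (62 ∷ 53 ∷ 73 ∷  9 ∷ []) ∷ (62 ∷ 58 ∷ 77 ∷  1 ∷ []) ∷ (62 ∷ 49 ∷ 71 ∷  8 ∷ []) ∷ (62 ∷ 59 ∷ 72 ∷ 18 ∷ []) ∷
  (62 ∷ 67 ∷ 75 ∷  7 ∷ []) ∷ (48 ∷ 53 ∷ 70 ∷ 14 ∷ []) ∷ (48 ∷ 58 ∷ 78 ∷ 11 ∷ []) ∷ (48 ∷ 63 ∷ 82 ∷  3 ∷ []) ∷ (48 ∷ 54 ∷ 76 ∷ 10 ∷ []) ∷
  (48 ∷ 64 ∷ 77 ∷ 20 ∷ []) ∷ (48 ∷ 72 ∷ 80 ∷  9 ∷ []) ∷ (53 ∷ 58 ∷ 75 ∷ 16 ∷ []) ∷ (53 ∷ 63 ∷ 83 ∷ 13 ∷ []) ∷ (53 ∷ 49 ∷ 68 ∷  5 ∷ []) ∷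
  (53 ∷ 59 ∷ 81 ∷ 12 ∷ []) ∷ (53 ∷ 50 ∷ 82 ∷ 22 ∷ []) ∷ (53 ∷ 77 ∷ 85 ∷ 11 ∷ []) ∷ (58 ∷ 63 ∷ 80 ∷ 18 ∷ []) ∷ (58 ∷ 49 ∷ 69 ∷  0 ∷ []) ∷
  (58 ∷ 54 ∷ 73 ∷  7 ∷ []) ∷ (58 ∷ 64 ∷ 67 ∷ 14 ∷ []) ∷ (58 ∷ 55 ∷ 68 ∷ 24 ∷ []) ∷ (58 ∷ 66 ∷ 82 ∷ 13 ∷ []) ∷ (63 ∷ 49 ∷ 85 ∷ 20 ∷ []) ∷
  (63 ∷ 54 ∷ 74 ∷  2 ∷ []) ∷ (63 ∷ 59 ∷ 78 ∷  9 ∷ []) ∷ (63 ∷ 50 ∷ 72 ∷ 16 ∷ []) ∷ (63 ∷ 60 ∷ 73 ∷  1 ∷ []) ∷ (63 ∷ 71 ∷ 68 ∷  0 ∷ []) ∷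
  (49 ∷ 54 ∷ 66 ∷ 22 ∷ []) ∷ (49 ∷ 59 ∷ 79 ∷  4 ∷ []) ∷ (49 ∷ 64 ∷ 83 ∷ 11 ∷ []) ∷ (49 ∷ 55 ∷ 77 ∷ 18 ∷ []) ∷ (49 ∷ 65 ∷ 78 ∷  3 ∷ []) ∷
  (49 ∷ 76 ∷ 73 ∷  2 ∷ []) ∷ (54 ∷ 59 ∷ 71 ∷ 24 ∷ []) ∷ (54 ∷ 64 ∷ 84 ∷  6 ∷ []) ∷ (54 ∷ 50 ∷ 69 ∷ 13 ∷ []) ∷ (54 ∷ 60 ∷ 82 ∷ 20 ∷ []) ∷
  (54 ∷ 81 ∷ 78 ∷  4 ∷ []) ∷ (59 ∷ 64 ∷ 76 ∷  1 ∷ []) ∷ (59 ∷ 50 ∷ 70 ∷  8 ∷ []) ∷ (59 ∷ 55 ∷ 74 ∷  0 ∷ []) ∷ (59 ∷ 65 ∷ 68 ∷ 22 ∷ []) ∷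
  (59 ∷ 67 ∷ 83 ∷  6 ∷ []) ∷ (64 ∷ 50 ∷ 81 ∷  3 ∷ []) ∷ (64 ∷ 55 ∷ 75 ∷ 10 ∷ []) ∷ (64 ∷ 60 ∷ 79 ∷  2 ∷ []) ∷ (64 ∷ 72 ∷ 69 ∷  8 ∷ []) ∷
  (50 ∷ 55 ∷ 67 ∷  5 ∷ []) ∷ (50 ∷ 60 ∷ 80 ∷ 12 ∷ []) ∷ (50 ∷ 65 ∷ 84 ∷  4 ∷ []) ∷ (50 ∷ 77 ∷ 74 ∷ 10 ∷ []) ∷ (55 ∷ 60 ∷ 72 ∷  7 ∷ []) ∷
  (55 ∷ 65 ∷ 85 ∷ 14 ∷ []) ∷ (55 ∷ 82 ∷ 79 ∷ 12 ∷ []) ∷ (60 ∷ 65 ∷ 77 ∷  9 ∷ []) ∷ (60 ∷ 68 ∷ 84 ∷ 14 ∷ []) ∷ (65 ∷ 73 ∷ 70 ∷ 16 ∷ []) ∷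
  (66 ∷ 71 ∷ 80 ∷  5 ∷ []) ∷ (66 ∷ 76 ∷ 81 ∷  9 ∷ []) ∷ (66 ∷ 72 ∷ 78 ∷ 84 ∷ []) ∷ (66 ∷ 75 ∷ 85 ∷  3 ∷ []) ∷ (71 ∷ 76 ∷ 85 ∷  7 ∷ []) ∷
  (71 ∷ 81 ∷ 67 ∷ 11 ∷ []) ∷ (71 ∷ 77 ∷ 83 ∷ 70 ∷ []) ∷ (76 ∷ 67 ∷ 72 ∷ 13 ∷ []) ∷ (76 ∷ 82 ∷ 69 ∷ 75 ∷ []) ∷ (81 ∷ 72 ∷ 77 ∷  0 ∷ []) ∷
  (81 ∷ 68 ∷ 74 ∷ 80 ∷ []) ∷ (67 ∷ 77 ∷ 82 ∷  2 ∷ []) ∷ (67 ∷ 73 ∷ 79 ∷ 85 ∷ []) ∷ (72 ∷ 82 ∷ 68 ∷  4 ∷ []) ∷ (77 ∷ 68 ∷ 73 ∷  6 ∷ []) ∷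
  (82 ∷ 73 ∷ 78 ∷  8 ∷ []) ∷ (68 ∷ 78 ∷ 83 ∷ 10 ∷ []) ∷ (73 ∷ 83 ∷ 69 ∷ 12 ∷ []) ∷ (78 ∷ 69 ∷ 74 ∷ 14 ∷ []) ∷ (83 ∷ 74 ∷ 79 ∷ 16 ∷ []) ∷
  (69 ∷ 79 ∷ 84 ∷ 18 ∷ []) ∷ (74 ∷ 84 ∷ 70 ∷ 20 ∷ []) ∷ (79 ∷ 70 ∷ 75 ∷ 22 ∷ []) ∷ (84 ∷ 75 ∷ 80 ∷ 24 ∷ []) ∷ (70 ∷ 80 ∷ 85 ∷  1 ∷ []) ∷
  ( 0 ∷  2 ∷  8 ∷ 13 ∷ []) ∷ ( 0 ∷  4 ∷ 14 ∷  7 ∷ []) ∷ ( 0 ∷  6 ∷ 24 ∷ 11 ∷ []) ∷ ( 0 ∷ 10 ∷ 22 ∷  3 ∷ []) ∷ ( 0 ∷ 12 ∷ 16 ∷ 19 ∷ []) ∷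
  ( 0 ∷ 18 ∷ 20 ∷  5 ∷ []) ∷ ( 0 ∷  9 ∷ 21 ∷ 25 ∷ []) ∷ ( 0 ∷ 15 ∷ 17 ∷ 23 ∷ []) ∷ ( 2 ∷  4 ∷ 10 ∷ 15 ∷ []) ∷ ( 2 ∷  6 ∷ 16 ∷  9 ∷ []) ∷
  ( 2 ∷ 12 ∷ 24 ∷  5 ∷ []) ∷ ( 2 ∷ 14 ∷ 18 ∷ 21 ∷ []) ∷ ( 2 ∷ 20 ∷ 22 ∷  7 ∷ []) ∷ ( 2 ∷  1 ∷ 11 ∷ 23 ∷ []) ∷ ( 2 ∷ 17 ∷ 19 ∷ 25 ∷ []) ∷
  ( 4 ∷  6 ∷ 12 ∷ 17 ∷ []) ∷ ( 4 ∷  8 ∷ 18 ∷ 11 ∷ []) ∷ ( 4 ∷ 16 ∷ 20 ∷ 23 ∷ []) ∷ ( 4 ∷ 22 ∷ 24 ∷  9 ∷ []) ∷ ( 4 ∷  1 ∷ 19 ∷ 21 ∷ []) ∷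
  ( 4 ∷  3 ∷ 13 ∷ 25 ∷ []) ∷ ( 6 ∷  8 ∷ 14 ∷ 19 ∷ []) ∷ ( 6 ∷ 10 ∷ 20 ∷ 13 ∷ []) ∷ ( 6 ∷ 18 ∷ 22 ∷ 25 ∷ []) ∷ ( 6 ∷  1 ∷  5 ∷ 15 ∷ []) ∷
  ( 6 ∷  3 ∷ 21 ∷ 23 ∷ []) ∷ ( 8 ∷ 10 ∷ 16 ∷ 21 ∷ []) ∷ ( 8 ∷ 12 ∷ 22 ∷ 15 ∷ []) ∷ ( 8 ∷ 20 ∷ 24 ∷  1 ∷ []) ∷ ( 8 ∷  3 ∷  7 ∷ 17 ∷ []) ∷
  ( 8 ∷  5 ∷ 23 ∷ 25 ∷ []) ∷ (10 ∷ 12 ∷ 18 ∷ 23 ∷ []) ∷ (10 ∷ 14 ∷ 24 ∷ 17 ∷ []) ∷ (10 ∷  1 ∷  7 ∷ 25 ∷ []) ∷ (10 ∷  5 ∷  9 ∷ 19 ∷ []) ∷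
  (12 ∷ 14 ∷ 20 ∷ 25 ∷ []) ∷ (12 ∷  1 ∷  3 ∷  9 ∷ []) ∷ (12 ∷  7 ∷ 11 ∷ 21 ∷ []) ∷ (14 ∷ 16 ∷ 22 ∷  1 ∷ []) ∷ (14 ∷  3 ∷  5 ∷ 11 ∷ []) ∷
  (14 ∷  9 ∷ 13 ∷ 23 ∷ []) ∷ (16 ∷ 18 ∷ 24 ∷  3 ∷ []) ∷ (16 ∷  5 ∷  7 ∷ 13 ∷ []) ∷ (16 ∷ 11 ∷ 15 ∷ 25 ∷ []) ∷ (18 ∷  1 ∷ 13 ∷ 17 ∷ []) ∷
  (18 ∷  7 ∷  9 ∷ 15 ∷ []) ∷ (20 ∷  3 ∷ 15 ∷ 19 ∷ []) ∷ (20 ∷  9 ∷ 11 ∷ 17 ∷ []) ∷ (22 ∷  5 ∷ 17 ∷ 21 ∷ []) ∷ (22 ∷ 11 ∷ 13 ∷ 19 ∷ []) ∷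
  (24 ∷  7 ∷ 19 ∷ 23 ∷ []) ∷ (24 ∷ 13 ∷ 15 ∷ 21 ∷ []) ∷
  []

blocks-2³5¹⁶ : List (Vec ℕ 4)
blocks-2³5¹⁶ =
  ( 6 ∷ 11 ∷ 53 ∷ 74 ∷ []) ∷ ( 6 ∷ 16 ∷ 52 ∷ 80 ∷ []) ∷ ( 6 ∷ 21 ∷ 47 ∷ 83 ∷ []) ∷ ( 6 ∷ 12 ∷ 43 ∷ 68 ∷ []) ∷ ( 6 ∷ 17 ∷ 27 ∷ 72 ∷ []) ∷
  ( 6 ∷ 22 ∷ 60 ∷ 66 ∷ []) ∷ ( 6 ∷ 13 ∷ 32 ∷ 78 ∷ []) ∷ ( 6 ∷ 18 ∷ 33 ∷ 45 ∷ []) ∷ ( 6 ∷ 23 ∷ 30 ∷ 67 ∷ []) ∷ ( 6 ∷ 14 ∷ 63 ∷ 82 ∷ []) ∷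
  ( 6 ∷ 19 ∷ 40 ∷ 85 ∷ []) ∷ ( 6 ∷ 24 ∷ 37 ∷ 75 ∷ []) ∷ ( 6 ∷ 15 ∷ 51 ∷ 79 ∷ []) ∷ ( 6 ∷ 20 ∷ 61 ∷ 70 ∷ []) ∷ ( 6 ∷ 25 ∷ 48 ∷ 73 ∷ []) ∷
  ( 6 ∷ 26 ∷ 64 ∷ 71 ∷ []) ∷ ( 6 ∷ 31 ∷ 59 ∷  3 ∷ []) ∷ ( 6 ∷ 36 ∷ 34 ∷ 77 ∷ []) ∷ ( 6 ∷ 41 ∷ 62 ∷  5 ∷ []) ∷ ( 6 ∷ 42 ∷ 54 ∷  1 ∷ []) ∷
  ( 6 ∷ 28 ∷ 39 ∷ 76 ∷ []) ∷ ( 6 ∷ 38 ∷ 56 ∷ 69 ∷ []) ∷ ( 6 ∷ 29 ∷ 55 ∷  2 ∷ []) ∷ ( 6 ∷ 44 ∷ 50 ∷  0 ∷ []) ∷ ( 6 ∷ 35 ∷ 46 ∷  4 ∷ []) ∷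
  ( 6 ∷ 57 ∷ 49 ∷ 81 ∷ []) ∷ ( 6 ∷ 58 ∷ 65 ∷ 84 ∷ []) ∷ (11 ∷ 16 ∷ 58 ∷ 76 ∷ []) ∷ (11 ∷ 21 ∷ 57 ∷ 85 ∷ []) ∷ (11 ∷  7 ∷ 52 ∷ 84 ∷ []) ∷
  (11 ∷ 17 ∷ 29 ∷ 69 ∷ []) ∷ (11 ∷ 22 ∷ 32 ∷ 73 ∷ []) ∷ (11 ∷  8 ∷ 65 ∷ 67 ∷ []) ∷ (11 ∷ 18 ∷ 37 ∷ 79 ∷ []) ∷ (11 ∷ 23 ∷ 26 ∷ 38 ∷ []) ∷
  (11 ∷  9 ∷ 35 ∷ 68 ∷ []) ∷ (11 ∷ 19 ∷ 49 ∷ 83 ∷ []) ∷ (11 ∷ 24 ∷ 45 ∷ 66 ∷ []) ∷ (11 ∷ 10 ∷ 42 ∷ 80 ∷ []) ∷ (11 ∷ 20 ∷ 56 ∷ 81 ∷ []) ∷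
  (11 ∷ 25 ∷ 47 ∷ 75 ∷ []) ∷ (11 ∷ 31 ∷ 50 ∷ 72 ∷ []) ∷ (11 ∷ 36 ∷ 64 ∷  3 ∷ []) ∷ (11 ∷ 41 ∷ 39 ∷ 78 ∷ []) ∷ (11 ∷ 27 ∷ 48 ∷  5 ∷ []) ∷
  (11 ∷ 28 ∷ 59 ∷  1 ∷ []) ∷ (11 ∷ 33 ∷ 44 ∷ 77 ∷ []) ∷ (11 ∷ 43 ∷ 61 ∷ 71 ∷ []) ∷ (11 ∷ 34 ∷ 60 ∷  2 ∷ []) ∷ (11 ∷ 30 ∷ 55 ∷  0 ∷ []) ∷
  (11 ∷ 40 ∷ 51 ∷  4 ∷ []) ∷ (11 ∷ 46 ∷ 63 ∷ 70 ∷ []) ∷ (11 ∷ 62 ∷ 54 ∷ 82 ∷ []) ∷ (16 ∷ 21 ∷ 63 ∷ 77 ∷ []) ∷ (16 ∷  7 ∷ 62 ∷ 66 ∷ []) ∷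
  (16 ∷ 12 ∷ 57 ∷ 70 ∷ []) ∷ (16 ∷ 22 ∷ 34 ∷ 71 ∷ []) ∷ (16 ∷  8 ∷ 37 ∷ 74 ∷ []) ∷ (16 ∷ 13 ∷ 46 ∷ 68 ∷ []) ∷ (16 ∷ 23 ∷ 42 ∷ 81 ∷ []) ∷
  (16 ∷  9 ∷ 31 ∷ 43 ∷ []) ∷ (16 ∷ 14 ∷ 40 ∷ 69 ∷ []) ∷ (16 ∷ 24 ∷ 54 ∷ 84 ∷ []) ∷ (16 ∷ 10 ∷ 26 ∷ 67 ∷ []) ∷ (16 ∷ 15 ∷ 28 ∷ 85 ∷ []) ∷
  (16 ∷ 25 ∷ 61 ∷ 82 ∷ []) ∷ (16 ∷ 36 ∷ 55 ∷ 73 ∷ []) ∷ (16 ∷ 41 ∷ 50 ∷  3 ∷ []) ∷ (16 ∷ 27 ∷ 44 ∷ 79 ∷ []) ∷ (16 ∷ 32 ∷ 53 ∷  5 ∷ []) ∷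
  (16 ∷ 33 ∷ 64 ∷  1 ∷ []) ∷ (16 ∷ 38 ∷ 30 ∷ 78 ∷ []) ∷ (16 ∷ 29 ∷ 47 ∷ 72 ∷ []) ∷ (16 ∷ 39 ∷ 65 ∷  2 ∷ []) ∷ (16 ∷ 35 ∷ 60 ∷  0 ∷ []) ∷
  (16 ∷ 45 ∷ 56 ∷  4 ∷ []) ∷ (16 ∷ 51 ∷ 49 ∷ 75 ∷ []) ∷ (16 ∷ 48 ∷ 59 ∷ 83 ∷ []) ∷ (21 ∷  7 ∷ 49 ∷ 78 ∷ []) ∷ (21 ∷ 12 ∷ 48 ∷ 67 ∷ []) ∷
  (21 ∷ 17 ∷ 62 ∷ 75 ∷ []) ∷ (21 ∷  8 ∷ 39 ∷ 72 ∷ []) ∷ (21 ∷ 13 ∷ 42 ∷ 76 ∷ []) ∷ (21 ∷ 18 ∷ 51 ∷ 69 ∷ []) ∷ (21 ∷  9 ∷ 28 ∷ 82 ∷ []) ∷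
  (21 ∷ 14 ∷ 36 ∷ 29 ∷ []) ∷ (21 ∷ 19 ∷ 45 ∷ 71 ∷ []) ∷ (21 ∷ 10 ∷ 59 ∷ 70 ∷ []) ∷ (21 ∷ 15 ∷ 31 ∷ 68 ∷ []) ∷ (21 ∷ 20 ∷ 33 ∷ 66 ∷ []) ∷
  (21 ∷ 26 ∷ 61 ∷  4 ∷ []) ∷ (21 ∷ 41 ∷ 60 ∷ 74 ∷ []) ∷ (21 ∷ 27 ∷ 55 ∷  3 ∷ []) ∷ (21 ∷ 32 ∷ 30 ∷ 81 ∷ []) ∷ (21 ∷ 37 ∷ 58 ∷  5 ∷ []) ∷
  (21 ∷ 38 ∷ 50 ∷  1 ∷ []) ∷ (21 ∷ 43 ∷ 35 ∷ 79 ∷ []) ∷ (21 ∷ 34 ∷ 52 ∷ 73 ∷ []) ∷ (21 ∷ 44 ∷ 46 ∷  2 ∷ []) ∷ (21 ∷ 40 ∷ 65 ∷  0 ∷ []) ∷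
  (21 ∷ 56 ∷ 54 ∷ 80 ∷ []) ∷ (21 ∷ 53 ∷ 64 ∷ 84 ∷ []) ∷ ( 7 ∷ 12 ∷ 54 ∷ 79 ∷ []) ∷ ( 7 ∷ 17 ∷ 53 ∷ 68 ∷ []) ∷ ( 7 ∷ 22 ∷ 48 ∷ 80 ∷ []) ∷
  ( 7 ∷ 13 ∷ 44 ∷ 73 ∷ []) ∷ ( 7 ∷ 18 ∷ 28 ∷ 77 ∷ []) ∷ ( 7 ∷ 23 ∷ 56 ∷ 71 ∷ []) ∷ ( 7 ∷ 14 ∷ 33 ∷ 83 ∷ []) ∷ ( 7 ∷ 19 ∷ 41 ∷ 34 ∷ []) ∷
  ( 7 ∷ 24 ∷ 26 ∷ 72 ∷ []) ∷ ( 7 ∷ 15 ∷ 64 ∷ 75 ∷ []) ∷ ( 7 ∷ 20 ∷ 36 ∷ 69 ∷ []) ∷ ( 7 ∷ 25 ∷ 38 ∷ 67 ∷ []) ∷ ( 7 ∷ 31 ∷ 47 ∷  4 ∷ []) ∷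
  ( 7 ∷ 27 ∷ 65 ∷ 76 ∷ []) ∷ ( 7 ∷ 32 ∷ 60 ∷  3 ∷ []) ∷ ( 7 ∷ 37 ∷ 35 ∷ 82 ∷ []) ∷ ( 7 ∷ 42 ∷ 63 ∷  5 ∷ []) ∷ ( 7 ∷ 43 ∷ 55 ∷  1 ∷ []) ∷
  ( 7 ∷ 29 ∷ 40 ∷ 81 ∷ []) ∷ ( 7 ∷ 39 ∷ 57 ∷ 74 ∷ []) ∷ ( 7 ∷ 30 ∷ 51 ∷  2 ∷ []) ∷ ( 7 ∷ 45 ∷ 46 ∷  0 ∷ []) ∷ ( 7 ∷ 61 ∷ 59 ∷ 85 ∷ []) ∷
  ( 7 ∷ 58 ∷ 50 ∷ 70 ∷ []) ∷ (12 ∷ 17 ∷ 59 ∷ 81 ∷ []) ∷ (12 ∷ 22 ∷ 58 ∷ 69 ∷ []) ∷ (12 ∷  8 ∷ 53 ∷ 85 ∷ []) ∷ (12 ∷ 18 ∷ 30 ∷ 74 ∷ []) ∷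
  (12 ∷ 23 ∷ 33 ∷ 78 ∷ []) ∷ (12 ∷  9 ∷ 61 ∷ 72 ∷ []) ∷ (12 ∷ 19 ∷ 38 ∷ 84 ∷ []) ∷ (12 ∷ 24 ∷ 27 ∷ 39 ∷ []) ∷ (12 ∷ 10 ∷ 31 ∷ 73 ∷ []) ∷
  (12 ∷ 20 ∷ 50 ∷ 80 ∷ []) ∷ (12 ∷ 25 ∷ 41 ∷ 71 ∷ []) ∷ (12 ∷ 26 ∷ 51 ∷  0 ∷ []) ∷ (12 ∷ 36 ∷ 52 ∷  4 ∷ []) ∷ (12 ∷ 32 ∷ 46 ∷ 77 ∷ []) ∷
  (12 ∷ 37 ∷ 65 ∷  3 ∷ []) ∷ (12 ∷ 42 ∷ 40 ∷ 83 ∷ []) ∷ (12 ∷ 28 ∷ 49 ∷  5 ∷ []) ∷ (12 ∷ 29 ∷ 60 ∷  1 ∷ []) ∷ (12 ∷ 34 ∷ 45 ∷ 82 ∷ []) ∷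
  (12 ∷ 44 ∷ 62 ∷ 76 ∷ []) ∷ (12 ∷ 35 ∷ 56 ∷  2 ∷ []) ∷ (12 ∷ 47 ∷ 64 ∷ 66 ∷ []) ∷ (12 ∷ 63 ∷ 55 ∷ 75 ∷ []) ∷ (17 ∷ 22 ∷ 64 ∷ 82 ∷ []) ∷
  (17 ∷  8 ∷ 63 ∷ 71 ∷ []) ∷ (17 ∷ 13 ∷ 58 ∷ 66 ∷ []) ∷ (17 ∷ 23 ∷ 35 ∷ 76 ∷ []) ∷ (17 ∷  9 ∷ 38 ∷ 79 ∷ []) ∷ (17 ∷ 14 ∷ 47 ∷ 73 ∷ []) ∷
  (17 ∷ 24 ∷ 43 ∷ 70 ∷ []) ∷ (17 ∷ 10 ∷ 32 ∷ 44 ∷ []) ∷ (17 ∷ 15 ∷ 36 ∷ 74 ∷ []) ∷ (17 ∷ 25 ∷ 55 ∷ 85 ∷ []) ∷ (17 ∷ 26 ∷ 39 ∷ 83 ∷ []) ∷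
  (17 ∷ 31 ∷ 56 ∷  0 ∷ []) ∷ (17 ∷ 41 ∷ 57 ∷  4 ∷ []) ∷ (17 ∷ 37 ∷ 51 ∷ 78 ∷ []) ∷ (17 ∷ 42 ∷ 46 ∷  3 ∷ []) ∷ (17 ∷ 28 ∷ 45 ∷ 84 ∷ []) ∷
  (17 ∷ 33 ∷ 54 ∷  5 ∷ []) ∷ (17 ∷ 34 ∷ 65 ∷  1 ∷ []) ∷ (17 ∷ 30 ∷ 48 ∷ 77 ∷ []) ∷ (17 ∷ 40 ∷ 61 ∷  2 ∷ []) ∷ (17 ∷ 52 ∷ 50 ∷ 67 ∷ []) ∷
  (17 ∷ 49 ∷ 60 ∷ 80 ∷ []) ∷ (22 ∷  8 ∷ 50 ∷ 83 ∷ []) ∷ (22 ∷ 13 ∷ 49 ∷ 72 ∷ []) ∷ (22 ∷ 18 ∷ 63 ∷ 67 ∷ []) ∷ (22 ∷  9 ∷ 40 ∷ 77 ∷ []) ∷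
  (22 ∷ 14 ∷ 43 ∷ 81 ∷ []) ∷ (22 ∷ 19 ∷ 52 ∷ 74 ∷ []) ∷ (22 ∷ 10 ∷ 29 ∷ 75 ∷ []) ∷ (22 ∷ 15 ∷ 37 ∷ 30 ∷ []) ∷ (22 ∷ 20 ∷ 41 ∷ 76 ∷ []) ∷
  (22 ∷ 26 ∷ 33 ∷ 70 ∷ []) ∷ (22 ∷ 31 ∷ 44 ∷ 84 ∷ []) ∷ (22 ∷ 36 ∷ 61 ∷  0 ∷ []) ∷ (22 ∷ 27 ∷ 62 ∷  4 ∷ []) ∷ (22 ∷ 42 ∷ 56 ∷ 79 ∷ []) ∷
  (22 ∷ 28 ∷ 51 ∷  3 ∷ []) ∷ (22 ∷ 38 ∷ 59 ∷  5 ∷ []) ∷ (22 ∷ 39 ∷ 46 ∷  1 ∷ []) ∷ (22 ∷ 35 ∷ 53 ∷ 78 ∷ []) ∷ (22 ∷ 45 ∷ 47 ∷  2 ∷ []) ∷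
  (22 ∷ 57 ∷ 55 ∷ 68 ∷ []) ∷ (22 ∷ 54 ∷ 65 ∷ 85 ∷ []) ∷ ( 8 ∷ 13 ∷ 55 ∷ 84 ∷ []) ∷ ( 8 ∷ 18 ∷ 54 ∷ 73 ∷ []) ∷ ( 8 ∷ 23 ∷ 49 ∷ 68 ∷ []) ∷
  ( 8 ∷ 14 ∷ 45 ∷ 78 ∷ []) ∷ ( 8 ∷ 19 ∷ 29 ∷ 82 ∷ []) ∷ ( 8 ∷ 24 ∷ 57 ∷ 76 ∷ []) ∷ ( 8 ∷ 15 ∷ 34 ∷ 80 ∷ []) ∷ ( 8 ∷ 20 ∷ 42 ∷ 35 ∷ []) ∷
  ( 8 ∷ 25 ∷ 27 ∷ 77 ∷ []) ∷ ( 8 ∷ 26 ∷ 52 ∷  2 ∷ []) ∷ ( 8 ∷ 31 ∷ 38 ∷ 75 ∷ []) ∷ ( 8 ∷ 36 ∷ 30 ∷ 70 ∷ []) ∷ ( 8 ∷ 41 ∷ 47 ∷  0 ∷ []) ∷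
  ( 8 ∷ 32 ∷ 48 ∷  4 ∷ []) ∷ ( 8 ∷ 28 ∷ 61 ∷ 81 ∷ []) ∷ ( 8 ∷ 33 ∷ 56 ∷  3 ∷ []) ∷ ( 8 ∷ 43 ∷ 64 ∷  5 ∷ []) ∷ ( 8 ∷ 44 ∷ 51 ∷  1 ∷ []) ∷
  ( 8 ∷ 40 ∷ 58 ∷ 79 ∷ []) ∷ ( 8 ∷ 46 ∷ 59 ∷ 66 ∷ []) ∷ ( 8 ∷ 62 ∷ 60 ∷ 69 ∷ []) ∷ (13 ∷ 18 ∷ 60 ∷ 70 ∷ []) ∷ (13 ∷ 23 ∷ 59 ∷ 74 ∷ []) ∷
  (13 ∷  9 ∷ 54 ∷ 69 ∷ []) ∷ (13 ∷ 19 ∷ 26 ∷ 79 ∷ []) ∷ (13 ∷ 24 ∷ 34 ∷ 83 ∷ []) ∷ (13 ∷ 10 ∷ 62 ∷ 77 ∷ []) ∷ (13 ∷ 20 ∷ 39 ∷ 85 ∷ []) ∷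
  (13 ∷ 25 ∷ 28 ∷ 40 ∷ []) ∷ (13 ∷ 31 ∷ 57 ∷  2 ∷ []) ∷ (13 ∷ 36 ∷ 43 ∷ 80 ∷ []) ∷ (13 ∷ 41 ∷ 35 ∷ 75 ∷ []) ∷ (13 ∷ 27 ∷ 52 ∷  0 ∷ []) ∷
  (13 ∷ 37 ∷ 53 ∷  4 ∷ []) ∷ (13 ∷ 33 ∷ 47 ∷ 82 ∷ []) ∷ (13 ∷ 38 ∷ 61 ∷  3 ∷ []) ∷ (13 ∷ 29 ∷ 50 ∷  5 ∷ []) ∷ (13 ∷ 30 ∷ 56 ∷  1 ∷ []) ∷
  (13 ∷ 45 ∷ 63 ∷ 81 ∷ []) ∷ (13 ∷ 51 ∷ 64 ∷ 67 ∷ []) ∷ (13 ∷ 48 ∷ 65 ∷ 71 ∷ []) ∷ (18 ∷ 23 ∷ 65 ∷ 75 ∷ []) ∷ (18 ∷  9 ∷ 64 ∷ 76 ∷ []) ∷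
  (18 ∷ 14 ∷ 59 ∷ 71 ∷ []) ∷ (18 ∷ 24 ∷ 31 ∷ 81 ∷ []) ∷ (18 ∷ 10 ∷ 39 ∷ 84 ∷ []) ∷ (18 ∷ 15 ∷ 48 ∷ 78 ∷ []) ∷ (18 ∷ 25 ∷ 44 ∷ 66 ∷ []) ∷
  (18 ∷ 26 ∷ 49 ∷ 82 ∷ []) ∷ (18 ∷ 36 ∷ 62 ∷  2 ∷ []) ∷ (18 ∷ 41 ∷ 29 ∷ 85 ∷ []) ∷ (18 ∷ 27 ∷ 40 ∷ 80 ∷ []) ∷ (18 ∷ 32 ∷ 57 ∷  0 ∷ []) ∷
  (18 ∷ 42 ∷ 58 ∷  4 ∷ []) ∷ (18 ∷ 38 ∷ 52 ∷ 83 ∷ []) ∷ (18 ∷ 43 ∷ 47 ∷  3 ∷ []) ∷ (18 ∷ 34 ∷ 55 ∷  5 ∷ []) ∷ (18 ∷ 35 ∷ 61 ∷  1 ∷ []) ∷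
  (18 ∷ 46 ∷ 53 ∷ 72 ∷ []) ∷ (18 ∷ 56 ∷ 50 ∷ 68 ∷ []) ∷ (23 ∷  9 ∷ 46 ∷ 80 ∷ []) ∷ (23 ∷ 14 ∷ 50 ∷ 77 ∷ []) ∷ (23 ∷ 19 ∷ 64 ∷ 72 ∷ []) ∷
  (23 ∷ 10 ∷ 36 ∷ 82 ∷ []) ∷ (23 ∷ 15 ∷ 44 ∷ 70 ∷ []) ∷ (23 ∷ 20 ∷ 53 ∷ 79 ∷ []) ∷ (23 ∷ 31 ∷ 54 ∷ 83 ∷ []) ∷ (23 ∷ 41 ∷ 48 ∷  2 ∷ []) ∷
  (23 ∷ 27 ∷ 34 ∷ 66 ∷ []) ∷ (23 ∷ 32 ∷ 45 ∷ 85 ∷ []) ∷ (23 ∷ 37 ∷ 62 ∷  0 ∷ []) ∷ (23 ∷ 28 ∷ 63 ∷  4 ∷ []) ∷ (23 ∷ 43 ∷ 57 ∷ 84 ∷ []) ∷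
  (23 ∷ 29 ∷ 52 ∷  3 ∷ []) ∷ (23 ∷ 39 ∷ 60 ∷  5 ∷ []) ∷ (23 ∷ 40 ∷ 47 ∷  1 ∷ []) ∷ (23 ∷ 51 ∷ 58 ∷ 73 ∷ []) ∷ (23 ∷ 61 ∷ 55 ∷ 69 ∷ []) ∷
  ( 9 ∷ 14 ∷ 51 ∷ 85 ∷ []) ∷ ( 9 ∷ 19 ∷ 55 ∷ 78 ∷ []) ∷ ( 9 ∷ 24 ∷ 50 ∷ 73 ∷ []) ∷ ( 9 ∷ 15 ∷ 41 ∷ 83 ∷ []) ∷ ( 9 ∷ 20 ∷ 30 ∷ 75 ∷ []) ∷
  ( 9 ∷ 25 ∷ 58 ∷ 81 ∷ []) ∷ ( 9 ∷ 26 ∷ 37 ∷ 66 ∷ []) ∷ ( 9 ∷ 36 ∷ 59 ∷ 84 ∷ []) ∷ ( 9 ∷ 27 ∷ 53 ∷  2 ∷ []) ∷ ( 9 ∷ 32 ∷ 39 ∷ 67 ∷ []) ∷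
  ( 9 ∷ 42 ∷ 48 ∷  0 ∷ []) ∷ ( 9 ∷ 33 ∷ 49 ∷  4 ∷ []) ∷ ( 9 ∷ 29 ∷ 62 ∷ 70 ∷ []) ∷ ( 9 ∷ 34 ∷ 57 ∷  3 ∷ []) ∷ ( 9 ∷ 44 ∷ 65 ∷  5 ∷ []) ∷
  ( 9 ∷ 45 ∷ 52 ∷  1 ∷ []) ∷ ( 9 ∷ 56 ∷ 63 ∷ 74 ∷ []) ∷ ( 9 ∷ 47 ∷ 60 ∷ 71 ∷ []) ∷ (14 ∷ 19 ∷ 56 ∷ 66 ∷ []) ∷ (14 ∷ 24 ∷ 60 ∷ 79 ∷ []) ∷
  (14 ∷ 10 ∷ 55 ∷ 74 ∷ []) ∷ (14 ∷ 20 ∷ 27 ∷ 84 ∷ []) ∷ (14 ∷ 25 ∷ 35 ∷ 80 ∷ []) ∷ (14 ∷ 26 ∷ 57 ∷  1 ∷ []) ∷ (14 ∷ 31 ∷ 42 ∷ 67 ∷ []) ∷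
  (14 ∷ 41 ∷ 64 ∷ 70 ∷ []) ∷ (14 ∷ 32 ∷ 58 ∷  2 ∷ []) ∷ (14 ∷ 37 ∷ 44 ∷ 68 ∷ []) ∷ (14 ∷ 28 ∷ 53 ∷  0 ∷ []) ∷ (14 ∷ 38 ∷ 54 ∷  4 ∷ []) ∷
  (14 ∷ 34 ∷ 48 ∷ 75 ∷ []) ∷ (14 ∷ 39 ∷ 62 ∷  3 ∷ []) ∷ (14 ∷ 30 ∷ 46 ∷  5 ∷ []) ∷ (14 ∷ 61 ∷ 49 ∷ 76 ∷ []) ∷ (14 ∷ 52 ∷ 65 ∷ 72 ∷ []) ∷
  (19 ∷ 24 ∷ 61 ∷ 67 ∷ []) ∷ (19 ∷ 10 ∷ 65 ∷ 81 ∷ []) ∷ (19 ∷ 15 ∷ 60 ∷ 76 ∷ []) ∷ (19 ∷ 25 ∷ 32 ∷ 70 ∷ []) ∷ (19 ∷ 31 ∷ 62 ∷  1 ∷ []) ∷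
  (19 ∷ 36 ∷ 28 ∷ 68 ∷ []) ∷ (19 ∷ 27 ∷ 50 ∷ 75 ∷ []) ∷ (19 ∷ 37 ∷ 63 ∷  2 ∷ []) ∷ (19 ∷ 42 ∷ 30 ∷ 69 ∷ []) ∷ (19 ∷ 33 ∷ 58 ∷  0 ∷ []) ∷
  (19 ∷ 43 ∷ 59 ∷  4 ∷ []) ∷ (19 ∷ 39 ∷ 53 ∷ 80 ∷ []) ∷ (19 ∷ 44 ∷ 48 ∷  3 ∷ []) ∷ (19 ∷ 35 ∷ 51 ∷  5 ∷ []) ∷ (19 ∷ 46 ∷ 57 ∷ 73 ∷ []) ∷
  (19 ∷ 47 ∷ 54 ∷ 77 ∷ []) ∷ (24 ∷ 10 ∷ 47 ∷ 68 ∷ []) ∷ (24 ∷ 15 ∷ 46 ∷ 82 ∷ []) ∷ (24 ∷ 20 ∷ 65 ∷ 77 ∷ []) ∷ (24 ∷ 36 ∷ 48 ∷  1 ∷ []) ∷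
  (24 ∷ 41 ∷ 33 ∷ 69 ∷ []) ∷ (24 ∷ 32 ∷ 55 ∷ 80 ∷ []) ∷ (24 ∷ 42 ∷ 49 ∷  2 ∷ []) ∷ (24 ∷ 28 ∷ 35 ∷ 71 ∷ []) ∷ (24 ∷ 38 ∷ 63 ∷  0 ∷ []) ∷
  (24 ∷ 29 ∷ 64 ∷  4 ∷ []) ∷ (24 ∷ 44 ∷ 58 ∷ 85 ∷ []) ∷ (24 ∷ 30 ∷ 53 ∷  3 ∷ []) ∷ (24 ∷ 40 ∷ 56 ∷  5 ∷ []) ∷ (24 ∷ 51 ∷ 62 ∷ 74 ∷ []) ∷
  (24 ∷ 52 ∷ 59 ∷ 78 ∷ []) ∷ (10 ∷ 15 ∷ 52 ∷ 69 ∷ []) ∷ (10 ∷ 20 ∷ 51 ∷ 83 ∷ []) ∷ (10 ∷ 25 ∷ 46 ∷ 78 ∷ []) ∷ (10 ∷ 41 ∷ 53 ∷  1 ∷ []) ∷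
  (10 ∷ 27 ∷ 38 ∷ 71 ∷ []) ∷ (10 ∷ 37 ∷ 60 ∷ 85 ∷ []) ∷ (10 ∷ 28 ∷ 54 ∷  2 ∷ []) ∷ (10 ∷ 33 ∷ 40 ∷ 72 ∷ []) ∷ (10 ∷ 43 ∷ 49 ∷  0 ∷ []) ∷
  (10 ∷ 34 ∷ 50 ∷  4 ∷ []) ∷ (10 ∷ 30 ∷ 63 ∷ 66 ∷ []) ∷ (10 ∷ 35 ∷ 58 ∷  3 ∷ []) ∷ (10 ∷ 45 ∷ 61 ∷  5 ∷ []) ∷ (10 ∷ 56 ∷ 48 ∷ 76 ∷ []) ∷
  (10 ∷ 57 ∷ 64 ∷ 79 ∷ []) ∷ (15 ∷ 20 ∷ 57 ∷ 71 ∷ []) ∷ (15 ∷ 25 ∷ 56 ∷ 84 ∷ []) ∷ (15 ∷ 26 ∷ 47 ∷  5 ∷ []) ∷ (15 ∷ 27 ∷ 58 ∷  1 ∷ []) ∷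
  (15 ∷ 32 ∷ 43 ∷ 72 ∷ []) ∷ (15 ∷ 42 ∷ 65 ∷ 66 ∷ []) ∷ (15 ∷ 33 ∷ 59 ∷  2 ∷ []) ∷ (15 ∷ 38 ∷ 45 ∷ 73 ∷ []) ∷ (15 ∷ 29 ∷ 54 ∷  0 ∷ []) ∷
  (15 ∷ 39 ∷ 55 ∷  4 ∷ []) ∷ (15 ∷ 35 ∷ 49 ∷ 67 ∷ []) ∷ (15 ∷ 40 ∷ 63 ∷  3 ∷ []) ∷ (15 ∷ 61 ∷ 53 ∷ 77 ∷ []) ∷ (15 ∷ 62 ∷ 50 ∷ 81 ∷ []) ∷
  (20 ∷ 25 ∷ 62 ∷ 72 ∷ []) ∷ (20 ∷ 26 ∷ 43 ∷ 74 ∷ []) ∷ (20 ∷ 31 ∷ 52 ∷  5 ∷ []) ∷ (20 ∷ 32 ∷ 63 ∷  1 ∷ []) ∷ (20 ∷ 37 ∷ 29 ∷ 73 ∷ []) ∷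
  (20 ∷ 28 ∷ 46 ∷ 67 ∷ []) ∷ (20 ∷ 38 ∷ 64 ∷  2 ∷ []) ∷ (20 ∷ 34 ∷ 59 ∷  0 ∷ []) ∷ (20 ∷ 44 ∷ 60 ∷  4 ∷ []) ∷ (20 ∷ 40 ∷ 54 ∷ 68 ∷ []) ∷
  (20 ∷ 45 ∷ 49 ∷  3 ∷ []) ∷ (20 ∷ 47 ∷ 58 ∷ 78 ∷ []) ∷ (20 ∷ 48 ∷ 55 ∷ 82 ∷ []) ∷ (25 ∷ 26 ∷ 54 ∷  3 ∷ []) ∷ (25 ∷ 31 ∷ 29 ∷ 76 ∷ []) ∷
  (25 ∷ 36 ∷ 57 ∷  5 ∷ []) ∷ (25 ∷ 37 ∷ 49 ∷  1 ∷ []) ∷ (25 ∷ 42 ∷ 34 ∷ 74 ∷ []) ∷ (25 ∷ 33 ∷ 51 ∷ 68 ∷ []) ∷ (25 ∷ 43 ∷ 50 ∷  2 ∷ []) ∷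
  (25 ∷ 39 ∷ 64 ∷  0 ∷ []) ∷ (25 ∷ 30 ∷ 65 ∷  4 ∷ []) ∷ (25 ∷ 45 ∷ 59 ∷ 69 ∷ []) ∷ (25 ∷ 52 ∷ 63 ∷ 79 ∷ []) ∷ (25 ∷ 53 ∷ 60 ∷ 83 ∷ []) ∷
  (26 ∷ 31 ∷ 48 ∷ 85 ∷ []) ∷ (26 ∷ 36 ∷ 56 ∷ 78 ∷ []) ∷ (26 ∷ 41 ∷ 65 ∷ 73 ∷ []) ∷ (26 ∷ 32 ∷ 59 ∷ 75 ∷ []) ∷ (26 ∷ 42 ∷ 60 ∷ 68 ∷ []) ∷
  (26 ∷ 34 ∷ 63 ∷ 84 ∷ []) ∷ (26 ∷ 44 ∷ 53 ∷ 81 ∷ []) ∷ (26 ∷ 35 ∷ 50 ∷ 69 ∷ []) ∷ (26 ∷ 40 ∷ 46 ∷ 76 ∷ []) ∷ (26 ∷ 45 ∷ 62 ∷ 80 ∷ []) ∷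
  (26 ∷ 58 ∷ 55 ∷ 77 ∷ []) ∷ (31 ∷ 36 ∷ 53 ∷ 66 ∷ []) ∷ (31 ∷ 41 ∷ 61 ∷ 79 ∷ []) ∷ (31 ∷ 27 ∷ 46 ∷ 74 ∷ []) ∷ (31 ∷ 37 ∷ 64 ∷ 80 ∷ []) ∷
  (31 ∷ 28 ∷ 65 ∷ 69 ∷ []) ∷ (31 ∷ 39 ∷ 49 ∷ 70 ∷ []) ∷ (31 ∷ 30 ∷ 58 ∷ 82 ∷ []) ∷ (31 ∷ 40 ∷ 55 ∷ 71 ∷ []) ∷ (31 ∷ 45 ∷ 51 ∷ 77 ∷ []) ∷
  (31 ∷ 63 ∷ 60 ∷ 78 ∷ []) ∷ (36 ∷ 41 ∷ 58 ∷ 67 ∷ []) ∷ (36 ∷ 27 ∷ 47 ∷ 81 ∷ []) ∷ (36 ∷ 32 ∷ 51 ∷ 76 ∷ []) ∷ (36 ∷ 42 ∷ 50 ∷ 85 ∷ []) ∷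
  (36 ∷ 33 ∷ 46 ∷ 71 ∷ []) ∷ (36 ∷ 44 ∷ 54 ∷ 75 ∷ []) ∷ (36 ∷ 35 ∷ 63 ∷ 83 ∷ []) ∷ (36 ∷ 45 ∷ 60 ∷ 72 ∷ []) ∷ (36 ∷ 49 ∷ 65 ∷ 79 ∷ []) ∷
  (41 ∷ 27 ∷ 63 ∷ 68 ∷ []) ∷ (41 ∷ 32 ∷ 52 ∷ 82 ∷ []) ∷ (41 ∷ 37 ∷ 56 ∷ 77 ∷ []) ∷ (41 ∷ 28 ∷ 55 ∷ 66 ∷ []) ∷ (41 ∷ 38 ∷ 51 ∷ 72 ∷ []) ∷
  (41 ∷ 30 ∷ 59 ∷ 80 ∷ []) ∷ (41 ∷ 40 ∷ 49 ∷ 84 ∷ []) ∷ (41 ∷ 46 ∷ 54 ∷ 81 ∷ []) ∷ (27 ∷ 32 ∷ 49 ∷ 69 ∷ []) ∷ (27 ∷ 37 ∷ 57 ∷ 83 ∷ []) ∷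
  (27 ∷ 42 ∷ 61 ∷ 78 ∷ []) ∷ (27 ∷ 33 ∷ 60 ∷ 67 ∷ []) ∷ (27 ∷ 43 ∷ 56 ∷ 73 ∷ []) ∷ (27 ∷ 35 ∷ 64 ∷ 85 ∷ []) ∷ (27 ∷ 45 ∷ 54 ∷ 70 ∷ []) ∷
  (27 ∷ 51 ∷ 59 ∷ 82 ∷ []) ∷ (32 ∷ 37 ∷ 54 ∷ 71 ∷ []) ∷ (32 ∷ 42 ∷ 62 ∷ 84 ∷ []) ∷ (32 ∷ 28 ∷ 47 ∷ 79 ∷ []) ∷ (32 ∷ 38 ∷ 65 ∷ 68 ∷ []) ∷
  (32 ∷ 29 ∷ 61 ∷ 74 ∷ []) ∷ (32 ∷ 40 ∷ 50 ∷ 66 ∷ []) ∷ (32 ∷ 56 ∷ 64 ∷ 83 ∷ []) ∷ (37 ∷ 42 ∷ 59 ∷ 72 ∷ []) ∷ (37 ∷ 28 ∷ 48 ∷ 70 ∷ []) ∷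
  (37 ∷ 33 ∷ 52 ∷ 81 ∷ []) ∷ (37 ∷ 43 ∷ 46 ∷ 69 ∷ []) ∷ (37 ∷ 34 ∷ 47 ∷ 76 ∷ []) ∷ (37 ∷ 45 ∷ 55 ∷ 67 ∷ []) ∷ (37 ∷ 61 ∷ 50 ∷ 84 ∷ []) ∷
  (42 ∷ 28 ∷ 64 ∷ 73 ∷ []) ∷ (42 ∷ 33 ∷ 53 ∷ 75 ∷ []) ∷ (42 ∷ 38 ∷ 57 ∷ 82 ∷ []) ∷ (42 ∷ 29 ∷ 51 ∷ 71 ∷ []) ∷ (42 ∷ 39 ∷ 52 ∷ 77 ∷ []) ∷
  (42 ∷ 47 ∷ 55 ∷ 70 ∷ []) ∷ (28 ∷ 33 ∷ 50 ∷ 74 ∷ []) ∷ (28 ∷ 38 ∷ 58 ∷ 80 ∷ []) ∷ (28 ∷ 43 ∷ 62 ∷ 83 ∷ []) ∷ (28 ∷ 34 ∷ 56 ∷ 72 ∷ []) ∷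
  (28 ∷ 44 ∷ 57 ∷ 78 ∷ []) ∷ (28 ∷ 52 ∷ 60 ∷ 75 ∷ []) ∷ (33 ∷ 38 ∷ 55 ∷ 76 ∷ []) ∷ (33 ∷ 43 ∷ 63 ∷ 85 ∷ []) ∷ (33 ∷ 29 ∷ 48 ∷ 84 ∷ []) ∷
  (33 ∷ 39 ∷ 61 ∷ 73 ∷ []) ∷ (33 ∷ 30 ∷ 62 ∷ 79 ∷ []) ∷ (33 ∷ 57 ∷ 65 ∷ 80 ∷ []) ∷ (38 ∷ 43 ∷ 60 ∷ 77 ∷ []) ∷ (38 ∷ 29 ∷ 49 ∷ 66 ∷ []) ∷
  (38 ∷ 34 ∷ 53 ∷ 70 ∷ []) ∷ (38 ∷ 44 ∷ 47 ∷ 74 ∷ []) ∷ (38 ∷ 35 ∷ 48 ∷ 81 ∷ []) ∷ (38 ∷ 46 ∷ 62 ∷ 85 ∷ []) ∷ (43 ∷ 29 ∷ 65 ∷ 78 ∷ []) ∷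
  (43 ∷ 34 ∷ 54 ∷ 67 ∷ []) ∷ (43 ∷ 39 ∷ 58 ∷ 75 ∷ []) ∷ (43 ∷ 30 ∷ 52 ∷ 76 ∷ []) ∷ (43 ∷ 40 ∷ 53 ∷ 82 ∷ []) ∷ (43 ∷ 51 ∷ 48 ∷ 66 ∷ []) ∷
  (29 ∷ 34 ∷ 46 ∷ 79 ∷ []) ∷ (29 ∷ 39 ∷ 59 ∷ 68 ∷ []) ∷ (29 ∷ 44 ∷ 63 ∷ 80 ∷ []) ∷ (29 ∷ 35 ∷ 57 ∷ 77 ∷ []) ∷ (29 ∷ 45 ∷ 58 ∷ 83 ∷ []) ∷
  (29 ∷ 56 ∷ 53 ∷ 67 ∷ []) ∷ (34 ∷ 39 ∷ 51 ∷ 81 ∷ []) ∷ (34 ∷ 44 ∷ 64 ∷ 69 ∷ []) ∷ (34 ∷ 30 ∷ 49 ∷ 85 ∷ []) ∷ (34 ∷ 40 ∷ 62 ∷ 78 ∷ []) ∷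
  (34 ∷ 61 ∷ 58 ∷ 68 ∷ []) ∷ (39 ∷ 44 ∷ 56 ∷ 82 ∷ []) ∷ (39 ∷ 30 ∷ 50 ∷ 71 ∷ []) ∷ (39 ∷ 35 ∷ 54 ∷ 66 ∷ []) ∷ (39 ∷ 45 ∷ 48 ∷ 79 ∷ []) ∷
  (39 ∷ 47 ∷ 63 ∷ 69 ∷ []) ∷ (44 ∷ 30 ∷ 61 ∷ 83 ∷ []) ∷ (44 ∷ 35 ∷ 55 ∷ 72 ∷ []) ∷ (44 ∷ 40 ∷ 59 ∷ 67 ∷ []) ∷ (44 ∷ 52 ∷ 49 ∷ 71 ∷ []) ∷
  (30 ∷ 35 ∷ 47 ∷ 84 ∷ []) ∷ (30 ∷ 40 ∷ 60 ∷ 73 ∷ []) ∷ (30 ∷ 45 ∷ 64 ∷ 68 ∷ []) ∷ (30 ∷ 57 ∷ 54 ∷ 72 ∷ []) ∷ (35 ∷ 40 ∷ 52 ∷ 70 ∷ []) ∷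
  (35 ∷ 45 ∷ 65 ∷ 74 ∷ []) ∷ (35 ∷ 62 ∷ 59 ∷ 73 ∷ []) ∷ (40 ∷ 45 ∷ 57 ∷ 75 ∷ []) ∷ (40 ∷ 48 ∷ 64 ∷ 74 ∷ []) ∷ (45 ∷ 53 ∷ 50 ∷ 76 ∷ []) ∷
  (46 ∷ 51 ∷ 60 ∷ 84 ∷ []) ∷ (46 ∷ 56 ∷ 61 ∷ 75 ∷ []) ∷ (46 ∷ 52 ∷ 58 ∷ 64 ∷ []) ∷ (46 ∷ 55 ∷ 65 ∷ 83 ∷ []) ∷ (51 ∷ 56 ∷ 65 ∷ 70 ∷ []) ∷
  (51 ∷ 61 ∷ 47 ∷ 80 ∷ []) ∷ (51 ∷ 57 ∷ 63 ∷ 50 ∷ []) ∷ (56 ∷ 47 ∷ 52 ∷ 85 ∷ []) ∷ (56 ∷ 62 ∷ 49 ∷ 55 ∷ []) ∷ (61 ∷ 52 ∷ 57 ∷ 66 ∷ []) ∷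
  (61 ∷ 48 ∷ 54 ∷ 60 ∷ []) ∷ (47 ∷ 57 ∷ 62 ∷ 67 ∷ []) ∷ (47 ∷ 53 ∷ 59 ∷ 65 ∷ []) ∷ (52 ∷ 62 ∷ 48 ∷ 68 ∷ []) ∷ (57 ∷ 48 ∷ 53 ∷ 69 ∷ []) ∷
  (62 ∷ 53 ∷ 58 ∷ 71 ∷ []) ∷ (48 ∷ 58 ∷ 63 ∷ 72 ∷ []) ∷ (53 ∷ 63 ∷ 49 ∷ 73 ∷ []) ∷ (58 ∷ 49 ∷ 54 ∷ 74 ∷ []) ∷ (63 ∷ 54 ∷ 59 ∷ 76 ∷ []) ∷
  (49 ∷ 59 ∷ 64 ∷ 77 ∷ []) ∷ (54 ∷ 64 ∷ 50 ∷ 78 ∷ []) ∷ (59 ∷ 50 ∷ 55 ∷ 79 ∷ []) ∷ (64 ∷ 55 ∷ 60 ∷ 81 ∷ []) ∷ (50 ∷ 60 ∷ 65 ∷ 82 ∷ []) ∷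
  (66 ∷ 71 ∷ 78 ∷  4 ∷ []) ∷ (66 ∷ 72 ∷ 76 ∷ 83 ∷ []) ∷ (66 ∷ 73 ∷ 82 ∷  2 ∷ []) ∷ (66 ∷ 74 ∷ 77 ∷ 85 ∷ []) ∷ (66 ∷ 79 ∷ 84 ∷  1 ∷ []) ∷
  (66 ∷ 81 ∷ 80 ∷  5 ∷ []) ∷ (66 ∷ 75 ∷  0 ∷  3 ∷ []) ∷ (67 ∷ 71 ∷ 77 ∷ 84 ∷ []) ∷ (67 ∷ 72 ∷ 79 ∷  5 ∷ []) ∷ (67 ∷ 73 ∷ 76 ∷ 85 ∷ []) ∷
  (67 ∷ 74 ∷ 81 ∷  3 ∷ []) ∷ (67 ∷ 78 ∷ 83 ∷  0 ∷ []) ∷ (67 ∷ 82 ∷ 80 ∷  4 ∷ []) ∷ (67 ∷ 75 ∷  1 ∷  2 ∷ []) ∷ (68 ∷ 71 ∷ 82 ∷  0 ∷ []) ∷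
  (68 ∷ 72 ∷ 80 ∷  2 ∷ []) ∷ (68 ∷ 73 ∷ 78 ∷ 81 ∷ []) ∷ (68 ∷ 74 ∷ 83 ∷  5 ∷ []) ∷ (68 ∷ 76 ∷ 84 ∷ 75 ∷ []) ∷ (68 ∷ 77 ∷  1 ∷  4 ∷ []) ∷
  (68 ∷ 79 ∷ 85 ∷  3 ∷ []) ∷ (69 ∷ 71 ∷ 80 ∷  3 ∷ []) ∷ (69 ∷ 72 ∷ 81 ∷  1 ∷ []) ∷ (69 ∷ 73 ∷ 84 ∷  4 ∷ []) ∷ (69 ∷ 74 ∷ 79 ∷ 82 ∷ []) ∷
  (69 ∷ 76 ∷  0 ∷  5 ∷ []) ∷ (69 ∷ 77 ∷ 83 ∷ 75 ∷ []) ∷ (69 ∷ 78 ∷ 85 ∷  2 ∷ []) ∷ (71 ∷ 76 ∷ 81 ∷ 70 ∷ []) ∷ (71 ∷ 79 ∷ 83 ∷  2 ∷ []) ∷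
  (71 ∷ 85 ∷  1 ∷  5 ∷ []) ∷ (72 ∷ 77 ∷ 82 ∷ 70 ∷ []) ∷ (72 ∷ 78 ∷ 84 ∷  3 ∷ []) ∷ (72 ∷ 85 ∷  0 ∷  4 ∷ []) ∷ (73 ∷ 77 ∷  3 ∷  5 ∷ []) ∷
  (73 ∷ 79 ∷ 70 ∷  0 ∷ []) ∷ (73 ∷ 83 ∷ 80 ∷  1 ∷ []) ∷ (74 ∷ 76 ∷  2 ∷  4 ∷ []) ∷ (74 ∷ 78 ∷ 70 ∷  1 ∷ []) ∷ (74 ∷ 84 ∷ 80 ∷  0 ∷ []) ∷
  (76 ∷ 82 ∷  1 ∷  3 ∷ []) ∷ (77 ∷ 81 ∷  0 ∷  2 ∷ []) ∷ (78 ∷ 82 ∷ 75 ∷  5 ∷ []) ∷ (79 ∷ 81 ∷ 75 ∷  4 ∷ []) ∷ (83 ∷ 70 ∷  3 ∷  4 ∷ []) ∷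
  (84 ∷ 70 ∷  2 ∷  5 ∷ []) ∷ (70 ∷ 75 ∷ 80 ∷ 85 ∷ []) ∷
  []

lemma4p8 : Exists4GDD-2-5 7 9 × Exists4GDD-2-5 10 9 × Exists4GDD-2-5 9 13 × Exists4GDD-2-5 13 12 × Exists4GDD-2-5 3 16
lemma4p8 = exists4GDD-2-5  7  9 59 blocks-2⁷5⁹
         , exists4GDD-2-5 10  9 65 blocks-2¹⁰5⁹
         , exists4GDD-2-5  9 13 83 blocks-2⁹5¹³
         , exists4GDD-2-5 13 12 86 blocks-2¹³5¹²
         , exists4GDD-2-5  3 16 86 blocks-2³5¹⁶
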